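{- Let $\mathcal C\subseteq 2^{[n]}$ be a code (satisfying the standing conventions below). Then $\mathcal C$ is inductively pierced if and only if $\mathcal C$ is degree two and the general relationship graph $G(\mathcal C)$ is chordal. Moreover, if $k$ is the smallest integer such that $\mathcal C$ is $k$-inductively pierced, then the largest clique in $G(\mathcal C)$ has size $k+1$.
   Context: $[n]=\{1,\dots,n\}$. A code is a set $\mathcal C\subseteq 2^{[n]}$; its elements are codewords and the elements of $[n]$ are neurons. Standing conventions: (1) $\emptyset\in\mathcal C$; (2) every neuron lies in some codeword; (3) no two distinct neurons lie in exactly the same codewords. For $\sigma\subseteq\tau\subseteq[n]$, the interval $[\sigma,\tau]=\{\gamma:\sigma\subseteq\gamma\subseteq\tau\}$ has rank $|\tau\setminus\sigma|$. For a neuron $i$, the deletion $\mathcal C\setminus i$ is the code obtained by removing $i$ from every codeword in which it appears. A neuron $i$ is a $k$-piercing of $\mathcal C$ if there exist $\sigma\subseteq\tau\subseteq[n]\setminus\{i\}$ with $[\sigma,\tau]$ of rank $k$, $[\sigma,\tau]\subseteq\mathcal C\setminus i$, and $\mathcal C=(\mathcal C\setminus i)\cup[\sigma\cup\{i\},\tau\cup\{i\}]$. A code is $k$-inductively pierced if $\mathcal C=\{\emptyset\}$, or some neuron $i$ is a $k'$-piercing of $\mathcal C$ for some $k'\le k$ and $\mathcal C\setminus i$ is $k$-inductively pierced (on the remaining neurons). It is inductively pierced if it is $k$-inductively pierced for some $k$. A pseudo-monomial in $\mathbb F_2[x_1,\dots,x_n]$ is a polynomial $\prod_{i\in\sigma}x_i\prod_{j\in\tau}(1-x_j)$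 with $\sigma\cap\tau=\emptyset$; pseudo-monomials are partially ordered by divisibility. For $\sigma\subseteq[n]$ let $\rho_\sigma=\prod_{i\in\sigma}x_i\prod_{j\notin\sigma}(1-x_j)$. The neural ideal is $J_{\mathcal C}=\langle\rho_\sigma:\sigma\notin\mathcal C\rangle$, and its canonical form $\mathrm{CF}(J_{\mathcal C})$ is the set of minimal (under divisibility) pseudo-monomials in $J_{\mathcal C}$. $\mathcal C$ is degree two if every element of $\mathrm{CF}(J_{\mathcal C})$ has degree exactly two. For a degree two code, $G(\mathcal C)$ is the graph on vertex set $[n]$ with an edge $ij$ ($i\ne j$) whenever $\mathrm{CF}(J_{\mathcal C})$ contains no pseudo-monomial whose two variables are $x_i$ and $x_j$. -}

module Defs where

open import Data.Nat using (ℕ; zero; suc; _+_; _≤_)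
open import Data.Bool using (Bool; true; false; not; if_then_else_)
open import Data.Fin using (Fin; toℕ)
open import Data.Fin.Subset as S using (Subset; ⁅_⁆; _∪_; _∩_; _─_; _-_; ∁; ∣_∣; _⊆_)
import Data.Fin.Subset as Sub
open import Data.Vec using (Vec; tabulate; replicate; zipWith; _[_]≔_; lookup)
import Data.Vec.Properties as VecP
open import Data.List using (List; []; _∷_; _++_; map; foldr; concatMap)
open import Data.List.Membership.Propositional using (_∈_)
open import Data.List.Relation.Unary.All using (All)
open import Data.Product using (Σ; ∃; ∃-syntax; _×_; _,_; proj₁; proj₂)
open import Data.Sum using (_⊎_)
open import Data.Empty using () renaming (⊥ to False)
open import Relation.Nullary using (¬_; does)
open import Relation.Binary.PropositionalEquality using (_≡_; _≢_)
open import Function.Bundles using (_⇔_)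
import Data.Nat.Properties as NatP
open import Data.Nat.ListAction using (sum)

-- A code is a finite set of codewords, given as a list (duplicates and
-- order are irrelevant: all notions below only use list membership).

Code : ℕ → Set
Code n = List (Subset n)

module _ {n : ℕ} where

  _≐_ : Code n → Code n → Set
  C ≐ D = ∀ γ → (γ ∈ C) ⇔ (γ ∈ D)

  emptyCode : Code n
  emptyCode = Sub.⊥ ∷ []

  StandingConventions : Code n → Set
  StandingConventions C =
    (Sub.⊥ ∈ C)
    × (∀ (i : Fin n) → ∃[ c ] (c ∈ C × i Sub.∈ c))
    × (∀ (i j : Fin n) → (∀ c → c ∈ C → (i Sub.∈ c ⇔ j Sub.∈ c)) → i ≡ j)

  InInterval : Subset n → Subset n → Subset n → Set
  InInterval σ τ γ = σ ⊆ γ × γ ⊆ τ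

  -- deletion  C \ i : remove i from every codeword.  The neuron i stays
  -- in the index set Fin n but lies in no codeword afterwards.
  delete : Fin n → Code n → Code n
  delete i C = map (λ c → c - i) C

  IsPiercing : ℕ → Fin n → Code n → Set
  IsPiercing k i C = Σ (Subset n) λ σ → Σ (Subset n) λ τ →
      σ ⊆ τ × i Sub.∉ τ
    × ∣ τ ─ σ ∣ ≡ k
    × (∀ γ → InInterval σ τ γ → γ ∈ delete i C)
    × (∀ γ → (γ ∈ C) ⇔ ((γ ∈ delete i C) ⊎ InInterval (σ ∪ ⁅ i ⁆) (τ ∪ ⁅ i ⁆) γ))

  data KIndPierced (k : ℕ) : Code n → Set where
    base : ∀ {C} → C ≐ emptyCode → KIndPierced k C
    step : ∀ {C} (i : Fin n) (k′ : ℕ) → k′ ≤ k → IsPiercing k′ i C →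
           KIndPierced k (delete i C) → KIndPierced k C

  InductivelyPierced : Code n → Set
  InductivelyPierced C = ∃[ k ] KIndPierced k C

  MinPiercing : ℕ → Code n → Set
  MinPiercing k C = KIndPierced k C × (∀ k′ → KIndPierced k′ C → k ≤ k′)

-- A monomial is an exponent vector; a polynomial is a formal sum of
-- monomials (a list), whose coefficient at a monomial m is the number of
-- occurrences of m, taken mod 2.  Two polynomials are equal iff all their
-- coefficients agree.

Monomial : ℕ → Set
Monomial n = Vec ℕ n

Poly : ℕ → Set
Poly n = List (Monomial n)

module _ {n : ℕ} where

  coeff : Poly n → Monomial n → Bool
  coeff p m = foldr (λ m′ b → if does (VecP.≡-dec NatP._≟_ m′ m) then not b else b) false p

  _≈_ : Poly n → Poly n → Set
  p ≈ q = ∀ m → coeff p m ≡ coeff q m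

  0P : Poly n
  0P = []

  1P : Poly n
  1P = replicate n 0 ∷ []

  _+P_ : Poly n → Poly n → Poly n
  p +P q = p ++ q

  _*P_ : Poly n → Poly n → Poly n
  p *P q = concatMap (λ a → map (λ b → zipWith _+_ a b) q) p

  var : Fin n → Poly n
  var i = tabulate (λ j → if does (i Data.Fin.≟ j) then 1 else 0) ∷ []

  -- 1 - xⱼ  (= 1 + xⱼ in characteristic 2)
  oneMinus : Fin n → Poly n
  oneMinus j = 1P +P var j

  prodP : List (Poly n) → Poly n
  prodP = foldr _*P_ 1P

  sumP : List (Poly n) → Poly n
  sumP = foldr _+P_ 0P

  allFins : List (Fin n)
  allFins = Data.List.allFin n

  mdeg : Monomial n → ℕ
  mdeg m = sum (Data.Vec.toList m)

  HasDegree : Poly n → ℕ → Set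
  HasDegree f d = (∃[ m ] (coeff f m ≡ true × mdeg m ≡ d))
                × (∀ m → coeff f m ≡ true → mdeg m ≤ d)

  _∣P_ : Poly n → Poly n → Set
  g ∣P f = ∃[ h ] (f ≈ (h *P g))

  -- the pseudo-monomial ∏_{i∈σ} xᵢ ∏_{j∈τ} (1 - xⱼ)  (used with σ ∩ τ = ∅)
  pm : Subset n → Subset n → Poly n
  pm σ τ = prodP (map (λ i → if lookup σ i then var i
                              else if lookup τ i then oneMinus i else 1P) allFins)

  Disjoint : Subset n → Subset n → Set
  Disjoint σ τ = Sub.Empty (σ ∩ τ)

  IsPseudoMonomial : Poly n → Set
  IsPseudoMonomial f = ∃[ σ ] ∃[ τ ] (Disjoint σ τ × f ≈ pm σ τ)

  ρ : Subset n → Poly n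
  ρ σ = pm σ (∁ σ)

  InJ : Code n → Poly n → Set
  InJ C f = ∃[ hs ] (All (λ (p : Poly n × Subset n) → ¬ (proj₂ p ∈ C)) hs
                    × f ≈ sumP (map (λ (p : Poly n × Subset n) → proj₁ p *P ρ (proj₂ p)) hs))

  InCF : Code n → Poly n → Set
  InCF C f = IsPseudoMonomial f × InJ C f
           × (∀ g → IsPseudoMonomial g → InJ C g → g ∣P f → g ≈ f)

  DegreeTwo : Code n → Set
  DegreeTwo C = ∀ f → InCF C f → HasDegree f 2

  GEdge : Code n → Fin n → Fin n → Set
  GEdge C i j = i ≢ j
    × ¬ (∃[ σ ] ∃[ τ ] (Disjoint σ τ × InCF C (pm σ τ) × (σ ∪ τ) ≡ (⁅ i ⁆ ∪ ⁅ j ⁆)))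

CycAdj : (l : ℕ) → Fin (4 + l) → Fin (4 + l) → Set
CycAdj l a b = (toℕ b ≡ suc (toℕ a)) ⊎ (toℕ a ≡ suc (toℕ b))
             ⊎ (toℕ a ≡ 0 × toℕ b ≡ 3 + l) ⊎ (toℕ b ≡ 0 × toℕ a ≡ 3 + l)

module _ {n : ℕ} (E : Fin n → Fin n → Set) where

  Chordal : Set
  Chordal = ∀ (l : ℕ) (v : Fin (4 + l) → Fin n) →
              (∀ a b → v a ≡ v b → a ≡ b) →
              (∀ a b → CycAdj l a b → E (v a) (v b)) →
              ∃[ a ] ∃[ b ] (a ≢ b × ¬ CycAdj l a b × E (v a) (v b))

  IsClique : Subset n → Set
  IsClique K = ∀ i j → i Sub.∈ K → j Sub.∈ K → i ≢ j → E i j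

  MaxCliqueSize : ℕ → Set
  MaxCliqueSize s = (∃[ K ] (IsClique K × ∣ K ∣ ≡ s))
                  × (∀ K → IsClique K → ∣ K ∣ ≤ s)

{-# OPTIONS --safe #-}
-- A pseudo-monomial ∏_{σ} xᵢ ∏_{τ} (1 − xⱼ) is the sum of the ρ_γ over its box
-- {γ : σ ⊆ γ, γ ∩ τ = ∅}, so it lies in J_C exactly when no codeword lies in that box.
-- Its degree is |σ ∪ τ|, so C is degree two iff every box missing C is already missed by two of its
-- literals, and then ij is an edge of G(C) iff all four patterns of (xᵢ, xⱼ) occur in C.
-- If i is a k′-piercing, the neighbours of i lie among the k′ neurons of τ ∖ σ and pairwise cross,
-- so i is simplicial: by induction a k-inductively pierced code is degree two, chordal, and has
-- cliques of size at most k + 1. Conversely, a degree two code contains every set all of whose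
-- pairwise patterns occur in it. Dirac's lemma gives a simplicial neuron i, chosen minimal for
-- inclusion of receptive fields Uᵢ = {c ∈ C : i ∈ c}, and this closure property shows that i is a
-- |N(i)|-piercing with σ = {j : Uᵢ ⊆ Uⱼ} and τ = σ ∪ N(i). Deleting i and recursing produces a
-- piercing sequence whose largest step is witnessed by the clique {i} ∪ N(i), so the least k is one
-- less than the clique number.
module Submission where

open import Defs
open import Data.Nat as N using (ℕ; zero; suc; _+_; _≤_; z≤n; s≤s; _<_; _⊔_)
import Data.Nat.Properties as NP
open import Data.Bool as B using (Bool; true; false; not; _∧_; _∨_; _xor_; if_then_else_)
import Data.Bool.Properties as BP
open import Data.Fin as F using (Fin; zero; suc; toℕ)
import Data.Fin.Properties as FP
open import Data.Fin.Subset as S using (Subset; ∁; _∪_; _∩_; _─_; _-_; ∣_∣; _⊆_; Empty; ⁅_⁆)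
import Data.Fin.Subset.Properties as SP
open import Data.Vec using ([]; _∷_; lookup; replicate; zipWith; tabulate)
import Data.Vec.Base as VB
open import Data.Vec.Base using (here; there)
import Data.Vec.Properties as VP
open import Data.List using (List; []; _∷_; _++_; map; concatMap; length)
import Data.List.Properties as LP
open import Data.List.Membership.Propositional using (_∈_; find; lose)
open import Data.List.Membership.Propositional.Properties using (∈-map⁺; ∈-map⁻)
import Data.List.Membership.DecPropositional as DecMem
open import Data.List.Relation.Unary.All as All using (All; []; _∷_)
import Data.List.Relation.Unary.All.Properties as AllP
open import Data.List.Relation.Unary.Any as Any using (Any; here; there)
open import Data.Product using (∃-syntax; _×_; _,_; proj₁; proj₂)
open import Data.Sum using (_⊎_; inj₁; inj₂)
open import Data.Unit using (⊤; tt)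
open import Data.Empty using (⊥; ⊥-elim)
open import Relation.Binary.PropositionalEquality
open import Relation.Binary.Definitions using (tri<; tri≈; tri>)
open import Relation.Nullary
open import Relation.Nullary.Decidable using (dec-true; dec-false; _×-dec_; _⊎-dec_; ¬?; _→-dec_; map′; decidable-stable)
open import Function.Bundles using (_⇔_; mk⇔; Equivalence)
open Equivalence using (to; from)
open import Function.Properties.Equivalence using () renaming (sym to ⇔-sym)
open import Function.Base using (_∘_)
open import Algebra.Bundles using (CommutativeRing; CommutativeMonoid)
open import Algebra.Properties.CommutativeSemigroup (CommutativeRing.+-commutativeSemigroup BP.xor-∧-commutativeRing)
  using () renaming (interchange to xor-interchange)
open import Algebra.Properties.CommutativeSemigroup (CommutativeMonoid.commutativeSemigroup BP.∧-commutativeMonoid)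
  using () renaming (interchange to ∧-interchange)

-- Booleans, decisions and subsets

true≢false : true ≡ false → ⊥
true≢false ()

true-or-false : ∀ (b : Bool) → b ≡ true ⊎ b ≡ false
true-or-false true = inj₁ refl
true-or-false false = inj₂ refl

does-true⇒ : ∀ {A : Set} (d : Dec A) → does d ≡ true → A
does-true⇒ (yes a) _ = a
does-true⇒ (no _) ()

does-false⇒ : ∀ {A : Set} (d : Dec A) → not (does d) ≡ true → ¬ A
does-false⇒ (yes a) ()
does-false⇒ (no na) _ = na

∧-trueˡ : ∀ a b → a ∧ b ≡ true → a ≡ true
∧-trueˡ true b e = refl
∧-trueʳ : ∀ a b → a ∧ b ≡ true → b ≡ true
∧-trueʳ true b e = e

∨≡true⇒ : ∀ x y → x ∨ y ≡ true → x ≡ true ⊎ y ≡ true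
∨≡true⇒ true y e = inj₁ refl
∨≡true⇒ false y e = inj₂ e

subset-ext : ∀ {n} {p q : Subset n} → (∀ k → lookup p k ≡ lookup q k) → p ≡ q
subset-ext {p = p} {q} h = trans (sym (VP.tabulate∘lookup p)) (trans (VP.tabulate-cong h) (VP.tabulate∘lookup q))

∈⇒lookup : ∀ {n} {k : Fin n} {p} → k S.∈ p → lookup p k ≡ true
∈⇒lookup = VP.[]=⇒lookup

lookup⇒∈ : ∀ {n} {k : Fin n} {p} → lookup p k ≡ true → k S.∈ p
lookup⇒∈ {k = k} {p} = VP.lookup⇒[]= k p

lookup-∪ : ∀ {n} (p q : Subset n) k → lookup (p ∪ q) k ≡ lookup p k ∨ lookup q k
lookup-∪ p q k = VP.lookup-zipWith _∨_ k p q

lookup-∩ : ∀ {n} (p q : Subset n) k → lookup (p ∩ q) k ≡ lookup p k ∧ lookup q k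
lookup-∩ p q k = VP.lookup-zipWith _∧_ k p q

lookup-─ : ∀ {n} (p q : Subset n) k → lookup (p ─ q) k ≡ lookup p k ∧ not (lookup q k)
lookup-─ (a ∷ p) (true ∷ q) zero = sym (BP.∧-zeroʳ a)
lookup-─ (a ∷ p) (false ∷ q) zero = sym (BP.∧-identityʳ a)
lookup-─ (a ∷ p) (b ∷ q) (suc k) = lookup-─ p q k

lookup-∁ : ∀ {n} (p : Subset n) k → lookup (∁ p) k ≡ not (lookup p k)
lookup-∁ p k = VP.lookup-map k not p

lookup-⊥ : ∀ {n} (k : Fin n) → lookup (S.⊥ {n}) k ≡ false
lookup-⊥ k = VP.lookup-replicate k false

eqᵇ : ∀ {n} → Fin n → Fin n → Bool
eqᵇ i k = does (i FP.≟ k)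

lookup-⁅⁆ : ∀ {n} (i k : Fin n) → lookup ⁅ i ⁆ k ≡ eqᵇ i k
lookup-⁅⁆ zero zero = refl
lookup-⁅⁆ zero (suc k) = lookup-⊥ k
lookup-⁅⁆ (suc i) zero = refl
lookup-⁅⁆ (suc i) (suc k) = lookup-⁅⁆ i k

eqᵇ-refl : ∀ {n} (i : Fin n) → eqᵇ i i ≡ true
eqᵇ-refl i = dec-true (i FP.≟ i) refl

eqᵇ-≢ : ∀ {n} {i k : Fin n} → i ≢ k → eqᵇ i k ≡ false
eqᵇ-≢ {i = i} {k} ne = dec-false (i FP.≟ k) ne

eqᵇ⇒≡ : ∀ {n} {i k : Fin n} → eqᵇ i k ≡ true → i ≡ k
eqᵇ⇒≡ {i = i} {k} e with i FP.≟ k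
... | yes p = p
eqᵇ⇒≡ {i = i} {k} () | no _

lookup-⁅⁆-self : ∀ {n} (i : Fin n) → lookup ⁅ i ⁆ i ≡ true
lookup-⁅⁆-self i = trans (lookup-⁅⁆ i i) (eqᵇ-refl i)

lookup-⁅⁆-other : ∀ {n} {i j : Fin n} → i ≢ j → lookup ⁅ i ⁆ j ≡ false
lookup-⁅⁆-other {i = i} {j} ne = trans (lookup-⁅⁆ i j) (eqᵇ-≢ ne)

lookup-minus : ∀ {n} (p : Subset n) i k → lookup (p - i) k ≡ lookup p k ∧ not (eqᵇ i k)
lookup-minus p i k = trans (lookup-─ p ⁅ i ⁆ k) (cong (λ z → lookup p k ∧ not z) (lookup-⁅⁆ i k))

lookup-tabulate : ∀ {n} (f : Fin n → Bool) k → lookup (tabulate f) k ≡ f k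
lookup-tabulate f k = VP.lookup∘tabulate f k

⊆⇒lookup : ∀ {n} {p q : Subset n} → p ⊆ q → ∀ k → lookup p k ≡ true → lookup q k ≡ true
⊆⇒lookup h k e = ∈⇒lookup (h (lookup⇒∈ e))

lookup⇒⊆ : ∀ {n} {p q : Subset n} → (∀ k → lookup p k ≡ true → lookup q k ≡ true) → p ⊆ q
lookup⇒⊆ h {k} x = lookup⇒∈ (h k (∈⇒lookup x))

Apart : ∀ {n} → Subset n → Subset n → Set
Apart σ τ = ∀ k → lookup σ k ≡ true → lookup τ k ≡ true → ⊥

Apart-⁅⁆ : ∀ {n} {i j : Fin n} → i ≢ j → Apart ⁅ i ⁆ ⁅ j ⁆
Apart-⁅⁆ {i = i} {j} ne x a b = ne (trans (eqᵇ⇒≡ (trans (sym (lookup-⁅⁆ i x)) a)) (sym (eqᵇ⇒≡ (trans (sym (lookup-⁅⁆ j x)) b))))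

Disjoint⇒Apart : ∀ {n} {σ τ : Subset n} → Empty (σ ∩ τ) → Apart σ τ
Disjoint⇒Apart {σ = σ} {τ} e k a b = e (k , lookup⇒∈ (trans (lookup-∩ σ τ k) (cong₂ _∧_ a b)))

Apart⇒Disjoint : ∀ {n} {σ τ : Subset n} → Apart σ τ → Empty (σ ∩ τ)
Apart⇒Disjoint {σ = σ} {τ} d (k , x) = d k (∧-trueˡ _ _ (trans (sym (lookup-∩ σ τ k)) (∈⇒lookup x))) (∧-trueʳ _ _ (trans (sym (lookup-∩ σ τ k)) (∈⇒lookup x)))

lookup-minus-self : ∀ {n} (c : Subset n) i → lookup (c - i) i ≡ false
lookup-minus-self c i = trans (lookup-minus c i i) (trans (cong (λ z → lookup c i ∧ not z) (eqᵇ-refl i)) (BP.∧-zeroʳ _))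

lookup-minus-other : ∀ {n} (c : Subset n) i k → i ≢ k → lookup (c - i) k ≡ lookup c k
lookup-minus-other c i k ne = trans (lookup-minus c i k) (trans (cong (λ z → lookup c k ∧ not z) (eqᵇ-≢ ne)) (BP.∧-identityʳ _))

∣p∪⁅i⁆∣≤ : ∀ {n} (p : Subset n) i → ∣ p ∪ ⁅ i ⁆ ∣ ≤ suc ∣ p ∣
∣p∪⁅i⁆∣≤ (true ∷ p) zero = s≤s (NP.≤-trans (NP.≤-reflexive (cong ∣_∣ (SP.∪-identityʳ p))) (NP.n≤1+n _))
∣p∪⁅i⁆∣≤ (false ∷ p) zero = s≤s (NP.≤-reflexive (cong ∣_∣ (SP.∪-identityʳ p)))
∣p∪⁅i⁆∣≤ (true ∷ p) (suc i) = s≤s (∣p∪⁅i⁆∣≤ p i)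
∣p∪⁅i⁆∣≤ (false ∷ p) (suc i) = ∣p∪⁅i⁆∣≤ p i

edgeless⇒∣K∣≤1 : ∀ {n} (K : Subset n) → (∀ x y → lookup K x ≡ true → lookup K y ≡ true → x ≢ y → ⊥) → ∣ K ∣ ≤ 1
edgeless⇒∣K∣≤1 [] h = z≤n
edgeless⇒∣K∣≤1 {suc n} (true ∷ K) h = s≤s (NP.≤-reflexive (trans (cong ∣_∣ (subset-ext {p = K} {q = S.⊥} λ y → go y)) (SP.∣⊥∣≡0 n)))
  where
  go : ∀ y → lookup K y ≡ lookup (S.⊥ {n = _}) y
  go y with true-or-false (lookup K y)
  ... | inj₁ t = ⊥-elim (h zero (suc y) refl t (λ ()))
  ... | inj₂ f = trans f (sym (lookup-⊥ y))
edgeless⇒∣K∣≤1 (false ∷ K) h = edgeless⇒∣K∣≤1 K (λ x y a b ne → h (suc x) (suc y) a b (λ e → ne (FP.suc-injective e)))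

∣p∣≡0⇒ : ∀ {n} (p : Subset n) → ∣ p ∣ ≡ 0 → ∀ x → lookup p x ≡ false
∣p∣≡0⇒ (true ∷ p) () x
∣p∣≡0⇒ (false ∷ p) e zero = refl
∣p∣≡0⇒ (false ∷ p) e (suc x) = ∣p∣≡0⇒ p e x

∣p∣≡1⇒ : ∀ {n} (p : Subset n) → ∣ p ∣ ≡ 1 → ∃[ i ] (lookup p i ≡ true × (∀ x → lookup p x ≡ true → x ≡ i))
∣p∣≡1⇒ (true ∷ p) e = zero , refl , λ { zero _ → refl ; (suc x) t → ⊥-elim (true≢false (trans (sym t) (∣p∣≡0⇒ p (NP.suc-injective e) x))) }
∣p∣≡1⇒ (false ∷ p) e = let (i , t , u) = ∣p∣≡1⇒ p e in suc i , t , λ { zero () ; (suc x) t' → cong suc (u x t') }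

∣p∣≡2⇒ : ∀ {n} (p : Subset n) → ∣ p ∣ ≡ 2 → ∃[ i ] ∃[ j ] (i ≢ j × lookup p i ≡ true × lookup p j ≡ true × (∀ x → lookup p x ≡ true → x ≡ i ⊎ x ≡ j))
∣p∣≡2⇒ (true ∷ p) e = let (j , t , u) = ∣p∣≡1⇒ p (NP.suc-injective e) in
  zero , suc j , (λ ()) , refl , t , λ { zero _ → inj₁ refl ; (suc x) t' → inj₂ (cong suc (u x t')) }
∣p∣≡2⇒ (false ∷ p) e = let (i , j , ne , ti , tj , u) = ∣p∣≡2⇒ p e in
  suc i , suc j , (λ eq → ne (FP.suc-injective eq)) , ti , tj ,
  λ { zero () ; (suc x) t' → Data.Sum.map (cong suc) (cong suc) (u x t') }

∣⁅i⁆∪⁅j⁆∣≡2 : ∀ {n} (i j : Fin n) → i ≢ j → ∣ ⁅ i ⁆ ∪ ⁅ j ⁆ ∣ ≡ 2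
∣⁅i⁆∪⁅j⁆∣≡2 zero zero ne = ⊥-elim (ne refl)
∣⁅i⁆∪⁅j⁆∣≡2 {suc n} zero (suc j) ne = cong suc (trans (cong ∣_∣ (SP.∪-identityˡ ⁅ j ⁆)) (SP.∣⁅x⁆∣≡1 j))
∣⁅i⁆∪⁅j⁆∣≡2 {suc n} (suc i) zero ne = cong suc (trans (cong ∣_∣ (SP.∪-identityʳ ⁅ i ⁆)) (SP.∣⁅x⁆∣≡1 i))
∣⁅i⁆∪⁅j⁆∣≡2 (suc i) (suc j) ne = ∣⁅i⁆∪⁅j⁆∣≡2 i j (λ e → ne (cong suc e))

⊆-minus : ∀ {n} (σ σ' : Subset n) k → σ' ⊆ σ → lookup σ' k ≡ false → σ' ⊆ (σ - k)
⊆-minus σ σ' k h f = lookup⇒⊆ λ x e → trans (lookup-minus σ k x) (go x e)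
  where
  go : ∀ x → lookup σ' x ≡ true → lookup σ x ∧ not (eqᵇ k x) ≡ true
  go x e with k FP.≟ x
  ... | yes refl = ⊥-elim (true≢false (trans (sym e) f))
  ... | no _ = trans (BP.∧-identityʳ _) (⊆⇒lookup h x e)

-- Polynomials over F₂: coefficients mod 2 and evaluation at 0/1 points

≟-monomial : ∀ {n} → (a b : Monomial n) → Dec (a ≡ b)
≟-monomial = VP.≡-dec NP._≟_

parity : ∀ {A : Set} → List A → (A → Bool) → Bool
parity [] F = false
parity (a ∷ l) F = F a xor parity l F

module _ {A : Set} where
  parity-++ : ∀ (p q : List A) F → parity (p ++ q) F ≡ parity p F xor parity q F
  parity-++ [] q F = refl
  parity-++ (a ∷ p) q F rewrite parity-++ p q F = sym (BP.xor-assoc (F a) (parity p F) (parity q F))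

  parity-cong : ∀ (l : List A) {F G} → (∀ a → F a ≡ G a) → parity l F ≡ parity l G
  parity-cong [] e = refl
  parity-cong (a ∷ l) e = cong₂ _xor_ (e a) (parity-cong l e)

  parity-false : ∀ (l : List A) → parity l (λ _ → false) ≡ false
  parity-false [] = refl
  parity-false (a ∷ l) = parity-false l

  parity-∧ˡ : ∀ (l : List A) b F → parity l (λ a → b ∧ F a) ≡ b ∧ parity l F
  parity-∧ˡ l true F = refl
  parity-∧ˡ l false F = parity-false l

  parity-∧ʳ : ∀ (l : List A) b F → parity l (λ a → F a ∧ b) ≡ parity l F ∧ b
  parity-∧ʳ l b F = trans (parity-cong l (λ a → BP.∧-comm (F a) b))
                 (trans (parity-∧ˡ l b F) (BP.∧-comm b (parity l F)))

  parity-xor : ∀ (l : List A) F G → parity l (λ a → F a xor G a) ≡ parity l F xor parity l G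
  parity-xor [] F G = refl
  parity-xor (a ∷ l) F G rewrite parity-xor l F G = xor-interchange (F a) (G a) (parity l F) (parity l G)

parity-map : ∀ {A B : Set} (f : A → B) (l : List A) F → parity (map f l) F ≡ parity l (λ a → F (f a))
parity-map f [] F = refl
parity-map f (a ∷ l) F = cong (F (f a) xor_) (parity-map f l F)

parity-concatMap : ∀ {A B : Set} (g : A → List B) (l : List A) F →
  parity (concatMap g l) F ≡ parity l (λ a → parity (g a) F)
parity-concatMap g [] F = refl
parity-concatMap g (a ∷ l) F = trans (parity-++ (g a) (concatMap g l) F) (cong (parity (g a) F xor_) (parity-concatMap g l F))

module _ {n : ℕ} where
  coefficient : Poly n → Monomial n → Bool
  coefficient p m = parity p (λ a → does (≟-monomial a m))

  coeff≡coefficient : ∀ (p : Poly n) m → coeff p m ≡ coefficient p m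
  coeff≡coefficient [] m = refl
  coeff≡coefficient (a ∷ p) m rewrite coeff≡coefficient p m with does (≟-monomial a m)
  ... | true = refl
  ... | false = refl

  removeAll : Monomial n → Poly n → Poly n
  removeAll a [] = []
  removeAll a (b ∷ l) = if does (≟-monomial b a) then removeAll a l else b ∷ removeAll a l

  xor-absorb : ∀ x r c → x xor (r xor (c ∧ x)) ≡ r xor (not c ∧ x)
  xor-absorb true true true = refl
  xor-absorb true true false = refl
  xor-absorb true false true = refl
  xor-absorb true false false = refl
  xor-absorb false r c rewrite BP.∧-zeroʳ (not c) | BP.∧-zeroʳ c = refl

  parity-removeAll : ∀ a (l : Poly n) F → parity l F ≡ parity (removeAll a l) F xor (coefficient l a ∧ F a)
  parity-removeAll a [] F = refl
  parity-removeAll a (b ∷ l) F with ≟-monomial b a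
  ... | yes refl rewrite parity-removeAll b l F = xor-absorb (F b) (parity (removeAll b l) F) (coefficient l b)
  ... | no _ rewrite parity-removeAll a l F = sym (BP.xor-assoc (F b) (parity (removeAll a l) F) (coefficient l a ∧ F a))

  length-removeAll : ∀ a (l : Poly n) → length (removeAll a l) ≤ length l
  length-removeAll a [] = z≤n
  length-removeAll a (b ∷ l) with does (≟-monomial b a)
  ... | true = NP.m≤n⇒m≤1+n (length-removeAll a l)
  ... | false = s≤s (length-removeAll a l)

  coefficient-removeAll-self : ∀ a (l : Poly n) → coefficient (removeAll a l) a ≡ false
  coefficient-removeAll-self a [] = refl
  coefficient-removeAll-self a (b ∷ l) with ≟-monomial b a
  ... | yes _ = coefficient-removeAll-self a l
  ... | no ¬p rewrite dec-false (≟-monomial b a) ¬p = coefficient-removeAll-self a l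

  coefficient-removeAll-other : ∀ a m (l : Poly n) → a ≢ m → coefficient (removeAll a l) m ≡ coefficient l m
  coefficient-removeAll-other a m [] ne = refl
  coefficient-removeAll-other a m (b ∷ l) ne with ≟-monomial b a
  ... | yes refl rewrite dec-false (≟-monomial b m) ne = coefficient-removeAll-other a m l ne
  ... | no _ = cong (does (≟-monomial b m) xor_) (coefficient-removeAll-other a m l ne)

  xor≡false⇒≡ : ∀ x y → x xor y ≡ false → x ≡ y
  xor≡false⇒≡ false false e = refl
  xor≡false⇒≡ true true e = refl
  xor≡false⇒≡ false true ()
  xor≡false⇒≡ true false ()

  true-xor≡false⇒ : ∀ c → true xor c ≡ false → c ≡ true
  true-xor≡false⇒ true e = refl

  parity-vanishing : ∀ k (l : Poly n) → length l ≤ k → (∀ m → coefficient l m ≡ false) → ∀ F → parity l F ≡ false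
  parity-vanishing k [] _ _ F = refl
  parity-vanishing (suc k) (a ∷ l) (s≤s le) Z F =
    trans (cong (F a xor_) (parity-removeAll a l F))
         (trans (cong (λ z → F a xor (parity (removeAll a l) F xor (z ∧ F a))) caa)
           (trans (xor-absorb (F a) (parity (removeAll a l) F) true) (trans (BP.xor-identityʳ _) ih)))
    where
    caa : coefficient l a ≡ true
    caa = true-xor≡false⇒ (coefficient l a) (subst (λ z → z xor coefficient l a ≡ false) (dec-true (≟-monomial a a) refl) (Z a))
    Z' : ∀ m → coefficient (removeAll a l) m ≡ false
    Z' m with ≟-monomial a m
    ... | yes refl = coefficient-removeAll-self a l
    ... | no ne = trans (coefficient-removeAll-other a m l ne)
                   (trans (sym (cong (_xor coefficient l m) (dec-false (≟-monomial a m) ne))) (Z m))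
    ih : parity (removeAll a l) F ≡ false
    ih = parity-vanishing k (removeAll a l) (NP.≤-trans (length-removeAll a l) le) Z' F

  -- p ++ q has only zero coefficients, and such a list cancels in pairs under any weight F.
  parity-cong-≈ : ∀ {p q : Poly n} → p ≈ q → ∀ F → parity p F ≡ parity q F
  parity-cong-≈ {p} {q} e F = xor≡false⇒≡ _ _ (trans (sym (parity-++ p q F))
     (parity-vanishing (length (p ++ q)) (p ++ q) NP.≤-refl
        (λ m → trans (parity-++ p q _) (trans (cong₂ _xor_ (sym (coeff≡coefficient p m)) (sym (coeff≡coefficient q m)))
                 (trans (cong (_xor coeff q m) (e m)) (BP.xor-same (coeff q m))))) F))

  ≈-sym : ∀ {p q : Poly n} → p ≈ q → q ≈ p
  ≈-sym e m = sym (e m)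
  ≈-trans : ∀ {p q r : Poly n} → p ≈ q → q ≈ r → p ≈ r
  ≈-trans e f m = trans (e m) (f m)

  coefficient-*P : ∀ (p q : Poly n) m → coefficient (p *P q) m ≡ parity p (λ a → parity q (λ b → does (≟-monomial (zipWith _+_ a b) m)))
  coefficient-*P p q m = trans (parity-concatMap (λ a → map (λ b → zipWith _+_ a b) q) p _)
                     (parity-cong p (λ a → parity-map (λ b → zipWith _+_ a b) q _))

  *P-congˡ : ∀ {p p' : Poly n} q → p ≈ p' → (p *P q) ≈ (p' *P q)
  *P-congˡ {p} {p'} q e m = trans (coeff≡coefficient (p *P q) m) (trans (coefficient-*P p q m)
     (trans (parity-cong-≈ {p} {p'} e _) (trans (sym (coefficient-*P p' q m)) (sym (coeff≡coefficient (p' *P q) m)))))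

  *P-congʳ : ∀ p {q q' : Poly n} → q ≈ q' → (p *P q) ≈ (p *P q')
  *P-congʳ p {q} {q'} e m = trans (coeff≡coefficient (p *P q) m) (trans (coefficient-*P p q m)
     (trans (parity-cong p (λ a → parity-cong-≈ {q} {q'} e _)) (trans (sym (coefficient-*P p q' m)) (sym (coeff≡coefficient (p *P q') m)))))

isZero : ℕ → Bool
isZero zero = true
isZero (suc _) = false

evalMonomial : ∀ {n} → Monomial n → Subset n → Bool
evalMonomial [] [] = true
evalMonomial (a ∷ m) (b ∷ x) = (isZero a ∨ b) ∧ evalMonomial m x

eval : ∀ {n} → Poly n → Subset n → Bool
eval p x = parity p (λ m → evalMonomial m x)

isZero-+ : ∀ a b → isZero (a + b) ≡ isZero a ∧ isZero b
isZero-+ zero b = refl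
isZero-+ (suc a) b = refl

evalMonomial-+ : ∀ {n} (a b : Monomial n) x → evalMonomial (zipWith _+_ a b) x ≡ evalMonomial a x ∧ evalMonomial b x
evalMonomial-+ [] [] [] = refl
evalMonomial-+ (a ∷ as) (b ∷ bs) (c ∷ x) rewrite evalMonomial-+ as bs x | isZero-+ a b =
  trans (cong (_∧ (evalMonomial as x ∧ evalMonomial bs x)) (BP.∨-distribʳ-∧ c (isZero a) (isZero b)))
        (∧-interchange (isZero a ∨ c) (isZero b ∨ c) (evalMonomial as x) (evalMonomial bs x))

eval-*P : ∀ {n} (p q : Poly n) x → eval (p *P q) x ≡ eval p x ∧ eval q x
eval-*P p q x = trans (parity-concatMap (λ a → map (λ b → zipWith _+_ a b) q) p _)
  (trans (parity-cong p (λ a → trans (parity-map (λ b → zipWith _+_ a b) q _)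
           (trans (parity-cong q (λ b → evalMonomial-+ a b x)) (parity-∧ˡ q (evalMonomial a x) _))))
         (parity-∧ʳ p (eval q x) _))

eval-cong : ∀ {n} {p q : Poly n} → p ≈ q → ∀ x → eval p x ≡ eval q x
eval-cong {p = p} {q} e x = parity-cong-≈ {p = p} {q} e _

parity-sumP : ∀ {n} (ps : List (Poly n)) G → parity (sumP ps) G ≡ parity ps (λ p → parity p G)
parity-sumP [] G = refl
parity-sumP (p ∷ ps) G = trans (parity-++ p (sumP ps) G) (cong (parity p G xor_) (parity-sumP ps G))

liftPoly : ∀ {n} → Poly n → Poly (suc n)
liftPoly = map (0 ∷_)

liftPoly-*P : ∀ {n} (p q : Poly n) → liftPoly p *P liftPoly q ≡ liftPoly (p *P q)
liftPoly-*P [] q = refl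
liftPoly-*P (a ∷ p) q = trans (cong₂ _++_ (trans (sym (LP.map-∘ {g = λ b → zipWith _+_ (0 ∷ a) b} {f = 0 ∷_} q)) (LP.map-∘ {g = 0 ∷_} {f = λ b → zipWith _+_ a b} q)) (liftPoly-*P p q))
                         (sym (LP.map-++ (0 ∷_) (map (λ b → zipWith _+_ a b) q) (p *P q)))

module PseudoMonomialCons {n : ℕ} (s t : Bool) (σ τ : Subset n) where
  factor₊ : Fin (suc n) → Poly (suc n)
  factor₊ i = if lookup (s ∷ σ) i then var i else if lookup (t ∷ τ) i then oneMinus i else 1P
  factor : Fin n → Poly n
  factor i = if lookup σ i then var i else if lookup τ i then oneMinus i else 1P

  factor₊-suc : ∀ i → factor₊ (suc i) ≡ liftPoly (factor i)
  factor₊-suc i with lookup σ i | lookup τ i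
  ... | true | _ = refl
  ... | false | true = refl
  ... | false | false = refl

  prodP-liftPoly : ∀ (l : List (Fin n)) → prodP (map (λ i → factor₊ (suc i)) l) ≡ liftPoly (prodP (map factor l))
  prodP-liftPoly [] = refl
  prodP-liftPoly (i ∷ l) rewrite prodP-liftPoly l | factor₊-suc i = liftPoly-*P (factor i) (prodP (map factor l))

  pm-cons : pm (s ∷ σ) (t ∷ τ) ≡ factor₊ zero *P liftPoly (pm σ τ)
  pm-cons = cong (factor₊ zero *P_) (trans (cong prodP (trans (LP.map-tabulate suc factor₊) (sym (LP.map-tabulate (λ i → i) (λ i → factor₊ (suc i))))))
                                   (prodP-liftPoly (allFins)))

-- The factor of pm in a single variable y selected by (s, t) is y, 1 + y or 1; this is its
-- coefficient of y^a.
factorCoeff : Bool → Bool → ℕ → Bool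
factorCoeff true t a = does (1 N.≟ a)
factorCoeff false true a = does (0 N.≟ a) xor does (1 N.≟ a)
factorCoeff false false a = does (0 N.≟ a)

literalHolds : Bool → Bool → Bool → Bool
literalHolds s t b = if s then b else (if t then not b else true)

-- x lies in the box of (σ, τ): σ ⊆ x and x ∩ τ = ∅, i.e. pm σ τ evaluates to 1 at x.
inBox : ∀ {n} → Subset n → Subset n → Subset n → Bool
inBox [] [] [] = true
inBox (s ∷ σ) (t ∷ τ) (b ∷ x) = literalHolds s t b ∧ inBox σ τ x

extend : ∀ {n} → Bool → Bool → Poly n → Poly (suc n)
extend true t P = map (1 ∷_) P
extend false true P = map (0 ∷_) P ++ map (1 ∷_) P
extend false false P = map (0 ∷_) P

replicate0-+ : ∀ {n} (b : Monomial n) → zipWith _+_ (replicate n 0) b ≡ b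
replicate0-+ [] = refl
replicate0-+ (x ∷ b) = cong (x ∷_) (replicate0-+ b)

tabulate0-+ : ∀ {n} (b : Monomial n) → zipWith _+_ (tabulate (λ _ → 0)) b ≡ b
tabulate0-+ [] = refl
tabulate0-+ (x ∷ b) = cong (x ∷_) (tabulate0-+ b)

parity-cons : ∀ {n} k (P : Poly n) a m →
  parity P (λ b → does (≟-monomial (k ∷ b) (a ∷ m))) ≡ does (k N.≟ a) ∧ coefficient P m
parity-cons k P a m = parity-∧ˡ P (does (k N.≟ a)) _

parity-liftPoly-cons : ∀ {n} k (z : Monomial n) → (∀ b → zipWith _+_ z b ≡ b) → ∀ (P : Poly n) a m →
  parity (liftPoly P) (λ b → does (≟-monomial (zipWith _+_ (k ∷ z) b) (a ∷ m))) ≡ does (k + 0 N.≟ a) ∧ coefficient P m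
parity-liftPoly-cons k z zw P a m = trans (parity-map (0 ∷_) P _) (trans (parity-cong P (λ b → cong (λ w → does (≟-monomial ((k + 0) ∷ w) (a ∷ m))) (zw b)))
  (parity-cons (k + 0) P a m))

coefficient-pm-cons : ∀ {n} s t (σ τ : Subset n) a m → coefficient (pm (s ∷ σ) (t ∷ τ)) (a ∷ m) ≡ factorCoeff s t a ∧ coefficient (pm σ τ) m
coefficient-pm-cons {n} s t σ τ a m rewrite PseudoMonomialCons.pm-cons s t σ τ = trans (coefficient-*P (PseudoMonomialCons.factor₊ s t σ τ zero) (liftPoly (pm σ τ)) (a ∷ m)) (go s t)
  where
  P : Poly n
  P = pm σ τ
  go : ∀ s t → parity (if s then var zero else if t then oneMinus zero else 1P)
         (λ u → parity (liftPoly P) (λ b → does (≟-monomial (zipWith _+_ u b) (a ∷ m)))) ≡ factorCoeff s t a ∧ coefficient P m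
  go true t = trans (cong (_xor false) (parity-liftPoly-cons 1 (tabulate (λ _ → 0)) tabulate0-+ P a m)) (BP.xor-identityʳ _)
  go false true = trans (cong₂ (λ u v → u xor (v xor false)) (parity-liftPoly-cons 0 (replicate n 0) replicate0-+ P a m) (parity-liftPoly-cons 1 (tabulate (λ _ → 0)) tabulate0-+ P a m))
                   (trans (cong ((does (0 N.≟ a) ∧ coefficient P m) xor_) (BP.xor-identityʳ _)) (sym (BP.∧-distribʳ-xor (coefficient P m) (does (0 N.≟ a)) (does (1 N.≟ a)))))
  go false false = trans (cong (_xor false) (parity-liftPoly-cons 0 (replicate n 0) replicate0-+ P a m)) (BP.xor-identityʳ _)

coefficient-extend : ∀ {n} s t (P : Poly n) a m → coefficient (extend s t P) (a ∷ m) ≡ factorCoeff s t a ∧ coefficient P m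
coefficient-extend true t P a m = trans (parity-map (1 ∷_) P _) (parity-cons 1 P a m)
coefficient-extend false true P a m = trans (parity-++ (map (0 ∷_) P) (map (1 ∷_) P) _)
  (trans (cong₂ _xor_ (trans (parity-map (0 ∷_) P _) (parity-cons 0 P a m)) (trans (parity-map (1 ∷_) P _) (parity-cons 1 P a m)))
    (sym (BP.∧-distribʳ-xor (coefficient P m) (does (0 N.≟ a)) (does (1 N.≟ a)))))
coefficient-extend false false P a m = trans (parity-map (0 ∷_) P _) (parity-cons 0 P a m)

pm≈extend : ∀ {n} s t (σ τ : Subset n) → pm (s ∷ σ) (t ∷ τ) ≈ extend s t (pm σ τ)
pm≈extend s t σ τ (a ∷ m) = trans (coeff≡coefficient (pm (s ∷ σ) (t ∷ τ)) (a ∷ m)) (trans (coefficient-pm-cons s t σ τ a m)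
   (trans (sym (coefficient-extend s t (pm σ τ) a m)) (sym (coeff≡coefficient (extend s t (pm σ τ)) (a ∷ m)))))

parity-evalMonomial-cons : ∀ {n} k (P : Poly n) b x → parity (map (k ∷_) P) (λ m → evalMonomial m (b ∷ x)) ≡ (isZero k ∨ b) ∧ eval P x
parity-evalMonomial-cons k P b x = trans (parity-map (k ∷_) P _) (parity-∧ˡ P (isZero k ∨ b) _)

eval-extend : ∀ {n} s t (P : Poly n) b x → eval (extend s t P) (b ∷ x) ≡ literalHolds s t b ∧ eval P x
eval-extend true t P b x = parity-evalMonomial-cons 1 P b x
eval-extend false true P b x = trans (parity-++ (map (0 ∷_) P) (map (1 ∷_) P) _)
  (trans (cong₂ _xor_ (parity-evalMonomial-cons 0 P b x) (parity-evalMonomial-cons 1 P b x)) (xor-∧-absorb b (eval P x)))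
  where
  xor-∧-absorb : ∀ b e → (e xor (b ∧ e)) ≡ not b ∧ e
  xor-∧-absorb true true = refl
  xor-∧-absorb true false = refl
  xor-∧-absorb false e = BP.xor-identityʳ e
eval-extend false false P b x = parity-evalMonomial-cons 0 P b x

eval-pm : ∀ {n} (σ τ x : Subset n) → eval (pm σ τ) x ≡ inBox σ τ x
eval-pm [] [] [] = refl
eval-pm (s ∷ σ) (t ∷ τ) (b ∷ x) = trans (eval-cong {p = pm (s ∷ σ) (t ∷ τ)} {q = extend s t (pm σ τ)} (pm≈extend s t σ τ) (b ∷ x))
   (trans (eval-extend s t (pm σ τ) b x) (cong (literalHolds s t b ∧_) (eval-pm σ τ x)))

parity-All-false : ∀ {A : Set} {P : A → Set} (l : List A) F → All P l → (∀ a → P a → F a ≡ false) → parity l F ≡ false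
parity-All-false [] F _ h = refl
parity-All-false (a ∷ l) F (pa ∷ al) h rewrite h a pa = parity-All-false l F al h

inBox-ρ : ∀ {n} (σ c : Subset n) → inBox σ (∁ σ) c ≡ true → c ≡ σ
inBox-ρ [] [] e = refl
inBox-ρ (true ∷ σ) (true ∷ c) e = cong (true ∷_) (inBox-ρ σ c e)
inBox-ρ (true ∷ σ) (false ∷ c) ()
inBox-ρ (false ∷ σ) (true ∷ c) ()
inBox-ρ (false ∷ σ) (false ∷ c) e = cong (false ∷_) (inBox-ρ σ c e)

InJ-vanishes : ∀ {n} (C : Code n) f → InJ C f → ∀ c → c ∈ C → eval f c ≡ false
InJ-vanishes C f (hs , al , e) c c∈C =
  trans (eval-cong {p = f} {q = sumP (map (λ p → proj₁ p *P ρ (proj₂ p)) hs)} e c)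
   (trans (parity-sumP (map (λ p → proj₁ p *P ρ (proj₂ p)) hs) _)
    (trans (parity-map (λ p → proj₁ p *P ρ (proj₂ p)) hs _)
      (parity-All-false hs _ al (λ { (h , σ) σ∉C → trans (eval-*P h (ρ σ) c)
          (trans (cong (eval h c ∧_) (trans (eval-pm σ (∁ σ) c) (ρ-vanishes σ σ∉C))) (BP.∧-zeroʳ _)) }))))
  where
  ρ-vanishes : ∀ σ → ¬ (σ ∈ C) → inBox σ (∁ σ) c ≡ false
  ρ-vanishes σ σ∉C with inBox σ (∁ σ) c in eq
  ... | true = ⊥-elim (σ∉C (subst (_∈ C) (inBox-ρ σ c eq) c∈C))
  ... | false = refl

∣P-eval : ∀ {n} (g f : Poly n) → g ∣P f → ∀ x → eval f x ≡ true → eval g x ≡ true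
∣P-eval g f (h , e) x ef = ∧-trueʳ (eval h x) (eval g x) (trans (sym (trans (eval-cong {p = f} {q = h *P g} e x) (eval-*P h g x))) ef)

boxPoints-cons : ∀ {n} → Bool → Bool → List (Subset n) → List (Subset (suc n))
boxPoints-cons true t L = map (true ∷_) L
boxPoints-cons false true L = map (false ∷_) L
boxPoints-cons false false L = map (true ∷_) L ++ map (false ∷_) L

boxPoints : ∀ {n} → Subset n → Subset n → List (Subset n)
boxPoints [] [] = [] ∷ []
boxPoints (s ∷ σ) (t ∷ τ) = boxPoints-cons s t (boxPoints σ τ)

boxPoints-inBox : ∀ {n} (σ τ : Subset n) → All (λ c → inBox σ τ c ≡ true) (boxPoints σ τ)
boxPoints-inBox [] [] = refl ∷ []
boxPoints-inBox (s ∷ σ) (t ∷ τ) = go s t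
  where
  IH : All (λ c → inBox σ τ c ≡ true) (boxPoints σ τ)
  IH = boxPoints-inBox σ τ
  go : ∀ s t → All (λ c → inBox (s ∷ σ) (t ∷ τ) c ≡ true) (boxPoints-cons s t (boxPoints σ τ))
  go true t = AllP.map⁺ (All.map (λ e → e) IH)
  go false true = AllP.map⁺ (All.map (λ e → e) IH)
  go false false = AllP.++⁺ (AllP.map⁺ (All.map (λ e → e) IH)) (AllP.map⁺ (All.map (λ e → e) IH))

coefficient-1P*P : ∀ {n} (X : Poly n) m → coefficient (1P *P X) m ≡ coefficient X m
coefficient-1P*P {n} X m = trans (coefficient-*P 1P X m) (trans (BP.xor-identityʳ _) (parity-cong X (λ b → cong (λ w → does (≟-monomial w m)) (replicate0-+ b))))

parity-ρ-cons : ∀ {n} b (L : List (Subset n)) a m →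
  parity (map (b ∷_) L) (λ c → coefficient (ρ c) (a ∷ m)) ≡ factorCoeff b (not b) a ∧ parity L (λ c → coefficient (ρ c) m)
parity-ρ-cons b L a m = trans (parity-map (b ∷_) L _) (trans (parity-cong L (λ c → coefficient-pm-cons b (not b) c (∁ c) a m)) (parity-∧ˡ L (factorCoeff b (not b) a) _))

boolE : ∀ d0 d1 X → ((d1 ∧ X) xor ((d0 xor d1) ∧ X)) ≡ d0 ∧ X
boolE true true true = refl
boolE true true false = refl
boolE true false true = refl
boolE true false false = refl
boolE false true true = refl
boolE false true false = refl
boolE false false true = refl
boolE false false false = refl

coefficient-pm-boxPoints : ∀ {n} (σ τ : Subset n) m → coefficient (pm σ τ) m ≡ parity (boxPoints σ τ) (λ c → coefficient (ρ c) m)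
coefficient-pm-boxPoints [] [] [] = refl
coefficient-pm-boxPoints {suc n} (s ∷ σ) (t ∷ τ) (a ∷ m) = trans (coefficient-pm-cons s t σ τ a m) (trans (cong (factorCoeff s t a ∧_) (coefficient-pm-boxPoints σ τ m)) (go s t))
  where
  L : List (Subset n)
  L = boxPoints σ τ
  X : Bool
  X = parity L (λ c → coefficient (ρ c) m)
  go : ∀ s t → factorCoeff s t a ∧ X ≡ parity (boxPoints-cons s t L) (λ c → coefficient (ρ c) (a ∷ m))
  go true t = sym (parity-ρ-cons true L a m)
  go false true = sym (parity-ρ-cons false L a m)
  go false false = sym (trans (parity-++ (map (true ∷_) L) (map (false ∷_) L) _)
     (trans (cong₂ _xor_ (parity-ρ-cons true L a m) (parity-ρ-cons false L a m)) (boolE (does (0 N.≟ a)) (does (1 N.≟ a)) X)))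

BoxMisses⇒InJ : ∀ {n} (C : Code n) σ τ → (∀ c → c ∈ C → inBox σ τ c ≡ false) → InJ C (pm σ τ)
BoxMisses⇒InJ {n} C σ τ bx = hs , AllP.map⁺ (All.map (λ {c} e c∈C → true≢false (trans (sym e) (bx c c∈C))) (boxPoints-inBox σ τ)) , eq
  where
  L : List (Subset n)
  L = boxPoints σ τ
  hs : List (Poly n × Subset n)
  hs = map (λ c → (1P , c)) L
  eq : pm σ τ ≈ sumP (map (λ p → proj₁ p *P ρ (proj₂ p)) hs)
  eq m = trans (coeff≡coefficient (pm σ τ) m) (trans (coefficient-pm-boxPoints σ τ m) (sym (trans (coeff≡coefficient (sumP (map (λ p → proj₁ p *P ρ (proj₂ p)) hs)) m)
          (trans (parity-sumP (map (λ p → proj₁ p *P ρ (proj₂ p)) hs) (λ a → does (≟-monomial a m)))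
            (trans (parity-map (λ p → proj₁ p *P ρ (proj₂ p)) hs (λ p → coefficient p m))
              (trans (parity-map (λ c → (1P , c)) L (λ p → coefficient (proj₁ p *P ρ (proj₂ p)) m)) (parity-cong L (λ c → coefficient-1P*P (ρ c) m))))))))

coefficient-*P-cons : ∀ {n} k k' (A B : Poly n) a m →
  coefficient (map (k ∷_) A *P map (k' ∷_) B) (a ∷ m) ≡ does (k + k' N.≟ a) ∧ coefficient (A *P B) m
coefficient-*P-cons k k' A B a m = trans (coefficient-*P (map (k ∷_) A) (map (k' ∷_) B) (a ∷ m))
  (trans (parity-map (k ∷_) A _) (trans (parity-cong A (λ u → trans (parity-map (k' ∷_) B _) (parity-∧ˡ B (does (k + k' N.≟ a)) _)))
    (trans (parity-∧ˡ A (does (k + k' N.≟ a)) _) (cong (does (k + k' N.≟ a) ∧_) (sym (coefficient-*P A B m))))))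

coefficient-++-*P : ∀ {n} (X X' Y : Poly n) m → coefficient ((X ++ X') *P Y) m ≡ coefficient (X *P Y) m xor coefficient (X' *P Y) m
coefficient-++-*P X X' Y m = trans (coefficient-*P (X ++ X') Y m) (trans (parity-++ X X' _) (sym (cong₂ _xor_ (coefficient-*P X Y m) (coefficient-*P X' Y m))))

coefficient-*P-++ : ∀ {n} (X Y Y' : Poly n) m → coefficient (X *P (Y ++ Y')) m ≡ coefficient (X *P Y) m xor coefficient (X *P Y') m
coefficient-*P-++ X Y Y' m = trans (coefficient-*P X (Y ++ Y') m) (trans (parity-cong X (λ u → parity-++ Y Y' _))
  (trans (parity-xor X _ _) (sym (cong₂ _xor_ (coefficient-*P X Y m) (coefficient-*P X Y' m)))))

pm-cons-*P : ∀ {n} s t s₁ t₁ s' t' (σ τ σ₁ τ₁ σ' τ' : Subset n) → (pm σ τ ≈ (pm σ₁ τ₁ *P pm σ' τ')) →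
  (∀ (A B : Poly n) a m → coefficient (extend s₁ t₁ A *P extend s' t' B) (a ∷ m) ≡ factorCoeff s t a ∧ coefficient (A *P B) m) →
  pm (s ∷ σ) (t ∷ τ) ≈ (pm (s₁ ∷ σ₁) (t₁ ∷ τ₁) *P pm (s' ∷ σ') (t' ∷ τ'))
pm-cons-*P {n} s t s₁ t₁ s' t' σ τ σ₁ τ₁ σ' τ' ih combo (a ∷ m) =
  trans (coeff≡coefficient (pm (s ∷ σ) (t ∷ τ)) (a ∷ m)) (trans (coefficient-pm-cons s t σ τ a m)
   (trans (cong (factorCoeff s t a ∧_) (trans (sym (coeff≡coefficient (pm σ τ) m)) (trans (ih m) (coeff≡coefficient (A *P B) m))))
    (trans (sym (combo A B a m)) (trans (sym (coeff≡coefficient (extend s₁ t₁ A *P extend s' t' B) (a ∷ m)))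
      (sym (≈-trans {p = pm (s₁ ∷ σ₁) (t₁ ∷ τ₁) *P pm (s' ∷ σ') (t' ∷ τ')} {q = extend s₁ t₁ A *P pm (s' ∷ σ') (t' ∷ τ')}
              {r = extend s₁ t₁ A *P extend s' t' B}
              (*P-congˡ {p = pm (s₁ ∷ σ₁) (t₁ ∷ τ₁)} {p' = extend s₁ t₁ A} (pm (s' ∷ σ') (t' ∷ τ')) (pm≈extend s₁ t₁ σ₁ τ₁))
              (*P-congʳ (extend s₁ t₁ A) {q = pm (s' ∷ σ') (t' ∷ τ')} {q' = extend s' t' B} (pm≈extend s' t' σ' τ')) (a ∷ m)))))))
  where
  A : Poly n
  A = pm σ₁ τ₁
  B : Poly n
  B = pm σ' τ'

zero∉false∷ : ∀ {n} {σ : Subset n} → zero S.∈ (false ∷ σ) → ⊥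
zero∉false∷ ()

pm-factorise : ∀ {n} (σ τ σ' τ' : Subset n) → Empty (σ ∩ τ) → σ' ⊆ σ → τ' ⊆ τ → pm σ τ ≈ (pm (σ ─ σ') (τ ─ τ') *P pm σ' τ')
pm-factorise [] [] [] [] dj h1 h2 m = refl
pm-factorise (true ∷ σ) (true ∷ τ) _ _ dj h1 h2 = ⊥-elim (dj (zero , here))
pm-factorise (true ∷ σ) (false ∷ τ) (true ∷ σ') (false ∷ τ') dj h1 h2 =
  pm-cons-*P true false false false true false σ τ (σ ─ σ') (τ ─ τ') σ' τ' (pm-factorise σ τ σ' τ' (SP.drop-∷-Empty dj) (SP.drop-∷-⊆ h1) (SP.drop-∷-⊆ h2))
    (λ A B a m → coefficient-*P-cons 0 1 A B a m)
pm-factorise (true ∷ σ) (false ∷ τ) (false ∷ σ') (false ∷ τ') dj h1 h2 =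
  pm-cons-*P true false true false false false σ τ (σ ─ σ') (τ ─ τ') σ' τ' (pm-factorise σ τ σ' τ' (SP.drop-∷-Empty dj) (SP.drop-∷-⊆ h1) (SP.drop-∷-⊆ h2))
    (λ A B a m → coefficient-*P-cons 1 0 A B a m)
pm-factorise (true ∷ σ) (false ∷ τ) (_ ∷ σ') (true ∷ τ') dj h1 h2 = ⊥-elim (zero∉false∷ (h2 here))
pm-factorise (false ∷ σ) (t ∷ τ) (true ∷ σ') _ dj h1 h2 = ⊥-elim (zero∉false∷ (h1 here))
pm-factorise (false ∷ σ) (true ∷ τ) (false ∷ σ') (true ∷ τ') dj h1 h2 =
  pm-cons-*P false true false false false true σ τ (σ ─ σ') (τ ─ τ') σ' τ' (pm-factorise σ τ σ' τ' (SP.drop-∷-Empty dj) (SP.drop-∷-⊆ h1) (SP.drop-∷-⊆ h2))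
    (λ A B a m → trans (coefficient-*P-++ (map (0 ∷_) A) (map (0 ∷_) B) (map (1 ∷_) B) (a ∷ m))
       (trans (cong₂ _xor_ (coefficient-*P-cons 0 0 A B a m) (coefficient-*P-cons 0 1 A B a m)) (sym (BP.∧-distribʳ-xor _ (does (0 N.≟ a)) (does (1 N.≟ a))))))
pm-factorise (false ∷ σ) (true ∷ τ) (false ∷ σ') (false ∷ τ') dj h1 h2 =
  pm-cons-*P false true false true false false σ τ (σ ─ σ') (τ ─ τ') σ' τ' (pm-factorise σ τ σ' τ' (SP.drop-∷-Empty dj) (SP.drop-∷-⊆ h1) (SP.drop-∷-⊆ h2))
    (λ A B a m → trans (coefficient-++-*P (map (0 ∷_) A) (map (1 ∷_) A) (map (0 ∷_) B) (a ∷ m))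
       (trans (cong₂ _xor_ (coefficient-*P-cons 0 0 A B a m) (coefficient-*P-cons 1 0 A B a m)) (sym (BP.∧-distribʳ-xor _ (does (0 N.≟ a)) (does (1 N.≟ a))))))
pm-factorise (false ∷ σ) (false ∷ τ) (false ∷ σ') (true ∷ τ') dj h1 h2 = ⊥-elim (zero∉false∷ (h2 here))
pm-factorise (false ∷ σ) (false ∷ τ) (false ∷ σ') (false ∷ τ') dj h1 h2 =
  pm-cons-*P false false false false false false σ τ (σ ─ σ') (τ ─ τ') σ' τ' (pm-factorise σ τ σ' τ' (SP.drop-∷-Empty dj) (SP.drop-∷-⊆ h1) (SP.drop-∷-⊆ h2))
    (λ A B a m → coefficient-*P-cons 0 0 A B a m)

indicator : ∀ {n} → Subset n → Monomial n
indicator = VB.map (λ b → if b then 1 else 0)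

coefficient-pm-indicator : ∀ {n} (σ τ : Subset n) → coefficient (pm σ τ) (indicator (σ ∪ τ)) ≡ true
coefficient-pm-indicator [] [] = refl
coefficient-pm-indicator (s ∷ σ) (t ∷ τ) = trans (coefficient-pm-cons s t σ τ _ (indicator (σ ∪ τ))) (go s t)
  where
  go : ∀ s t → factorCoeff s t (if s ∨ t then 1 else 0) ∧ coefficient (pm σ τ) (indicator (σ ∪ τ)) ≡ true
  go true t = coefficient-pm-indicator σ τ
  go false true = coefficient-pm-indicator σ τ
  go false false = coefficient-pm-indicator σ τ

mdeg-indicator : ∀ {n} (S : Subset n) → mdeg (indicator S) ≡ ∣ S ∣
mdeg-indicator [] = refl
mdeg-indicator (true ∷ S) = cong suc (mdeg-indicator S)
mdeg-indicator (false ∷ S) = mdeg-indicator S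

coefficient-pm⇒mdeg≤ : ∀ {n} (σ τ : Subset n) m → coefficient (pm σ τ) m ≡ true → mdeg m ≤ ∣ σ ∪ τ ∣
coefficient-pm⇒mdeg≤ [] [] [] e = z≤n
coefficient-pm⇒mdeg≤ (s ∷ σ) (t ∷ τ) (a ∷ m) e = go s t a (∧-trueˡ _ _ e')
  where
  e' : factorCoeff s t a ∧ coefficient (pm σ τ) m ≡ true
  e' = trans (sym (coefficient-pm-cons s t σ τ a m)) e
  ih : mdeg m ≤ ∣ σ ∪ τ ∣
  ih = coefficient-pm⇒mdeg≤ σ τ m (∧-trueʳ _ _ e')
  go : ∀ s t a → factorCoeff s t a ≡ true → a + mdeg m ≤ ∣ (s ∨ t) ∷ (σ ∪ τ) ∣
  go s t zero k = NP.≤-trans ih (SP.∣p∣≤∣x∷p∣ (s ∨ t) (σ ∪ τ))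
  go true t (suc zero) k = s≤s ih
  go false true (suc zero) k = s≤s ih
  go false false (suc zero) ()
  go true t (suc (suc a)) ()
  go false true (suc (suc a)) ()
  go false false (suc (suc a)) ()

HasDegree-≈ : ∀ {n} {f g : Poly n} {d} → f ≈ g → HasDegree f d → HasDegree g d
HasDegree-≈ e ((m , c , dm) , bd) = (m , trans (sym (e m)) c , dm) , λ m' c' → bd m' (trans (e m') c')

pm-HasDegree : ∀ {n} (σ τ : Subset n) → HasDegree (pm σ τ) ∣ σ ∪ τ ∣
pm-HasDegree σ τ = (indicator (σ ∪ τ) , trans (coeff≡coefficient (pm σ τ) _) (coefficient-pm-indicator σ τ) , mdeg-indicator (σ ∪ τ)) ,
  λ m c → coefficient-pm⇒mdeg≤ σ τ m (trans (sym (coeff≡coefficient (pm σ τ) m)) c)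

HasDegree-pm⇒ : ∀ {n} (σ τ : Subset n) d → HasDegree (pm σ τ) d → ∣ σ ∪ τ ∣ ≡ d
HasDegree-pm⇒ σ τ d ((m , c , dm) , bd) = NP.≤-antisym
  (subst (_≤ d) (mdeg-indicator (σ ∪ τ)) (bd (indicator (σ ∪ τ)) (trans (coeff≡coefficient (pm σ τ) _) (coefficient-pm-indicator σ τ))))
  (subst (_≤ ∣ σ ∪ τ ∣) dm (coefficient-pm⇒mdeg≤ σ τ m (trans (sym (coeff≡coefficient (pm σ τ) m)) c)))

-- Boxes, the neural ideal and its canonical form

inBox⇒literalHolds : ∀ {n} (σ τ x : Subset n) → inBox σ τ x ≡ true → ∀ k → literalHolds (lookup σ k) (lookup τ k) (lookup x k) ≡ true
inBox⇒literalHolds (s ∷ σ) (t ∷ τ) (b ∷ x) e zero = ∧-trueˡ _ _ e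
inBox⇒literalHolds (s ∷ σ) (t ∷ τ) (b ∷ x) e (suc k) = inBox⇒literalHolds σ τ x (∧-trueʳ _ _ e) k

literalHolds⇒inBox : ∀ {n} (σ τ x : Subset n) → (∀ k → literalHolds (lookup σ k) (lookup τ k) (lookup x k) ≡ true) → inBox σ τ x ≡ true
literalHolds⇒inBox [] [] [] h = refl
literalHolds⇒inBox (s ∷ σ) (t ∷ τ) (b ∷ x) h = cong₂ _∧_ (h zero) (literalHolds⇒inBox σ τ x (λ k → h (suc k)))

literalHolds-negative : ∀ {s b} → literalHolds s true b ≡ true → s ≡ false → b ≡ false
literalHolds-negative {false} {false} e _ = refl
literalHolds-negative {false} {true} () _

module _ {n : ℕ} where
  BoxMisses : Code n → Subset n → Subset n → Set
  BoxMisses C σ τ = ∀ c → c ∈ C → inBox σ τ c ≡ false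

  MinimalBoxMisses : Code n → Subset n → Subset n → Set
  MinimalBoxMisses C σ τ = BoxMisses C σ τ × (∀ σ' τ' → σ' ⊆ σ → τ' ⊆ τ → BoxMisses C σ' τ' → (σ' ≡ σ) × (τ' ≡ τ))

literalHolds-mono : ∀ s t s' t' b → (s ≡ true → t ≡ true → ⊥) → (s' ≡ true → s ≡ true) → (t' ≡ true → t ≡ true) →
  literalHolds s t b ≡ true → literalHolds s' t' b ≡ true
literalHolds-mono s t true t' b dj h1 h2 e rewrite h1 refl = e
literalHolds-mono s t false false b dj h1 h2 e = refl
literalHolds-mono true t false true b dj h1 h2 e = ⊥-elim (dj refl (h2 refl))
literalHolds-mono false t false true b dj h1 h2 e rewrite h2 refl = e

inBox-mono : ∀ {n} (σ τ σ' τ' x : Subset n) → Apart σ τ → σ' ⊆ σ → τ' ⊆ τ → inBox σ τ x ≡ true → inBox σ' τ' x ≡ true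
inBox-mono σ τ σ' τ' x dj h1 h2 e = literalHolds⇒inBox σ' τ' x (λ k → literalHolds-mono _ _ _ _ _ (dj k) (⊆⇒lookup h1 k) (⊆⇒lookup h2 k) (inBox⇒literalHolds σ τ x e k))

BoxMisses-mono : ∀ {n} (C : Code n) σ τ σ' τ' → Apart σ τ → σ' ⊆ σ → τ' ⊆ τ → BoxMisses C σ' τ' → BoxMisses C σ τ
BoxMisses-mono C σ τ σ' τ' dj h1 h2 bx c c∈C with inBox σ τ c in eq
... | true = ⊥-elim (true≢false (trans (sym (inBox-mono σ τ σ' τ' c dj h1 h2 eq)) (bx c c∈C)))
... | false = refl

inBox-σ : ∀ {n} (σ τ : Subset n) → Apart σ τ → inBox σ τ σ ≡ true
inBox-σ σ τ dj = literalHolds⇒inBox σ τ σ (λ k → go (lookup σ k) (lookup τ k))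
  where
  go : ∀ s t → literalHolds s t s ≡ true
  go true t = refl
  go false true = refl
  go false false = refl

inBox-∁τ : ∀ {n} (σ τ : Subset n) → Apart σ τ → inBox σ τ (∁ τ) ≡ true
inBox-∁τ σ τ dj = literalHolds⇒inBox σ τ (∁ τ) (λ k → subst (λ z → literalHolds (lookup σ k) (lookup τ k) z ≡ true) (sym (lookup-∁ τ k)) (go (lookup σ k) (lookup τ k) (dj k)))
  where
  go : ∀ s t → (s ≡ true → t ≡ true → ⊥) → literalHolds s t (not t) ≡ true
  go true true d = ⊥-elim (d refl refl)
  go true false d = refl
  go false true d = refl
  go false false d = refl

inBox-⊆⇒literals-⊇ : ∀ {n} (σ τ α β : Subset n) → Apart σ τ → Apart α β → (∀ x → inBox σ τ x ≡ true → inBox α β x ≡ true) → (α ⊆ σ) × (β ⊆ τ)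
inBox-⊆⇒literals-⊇ σ τ α β djs dja h = lookup⇒⊆ (λ k e → subst (λ z → literalHolds z (lookup β k) (lookup σ k) ≡ true) e (inBox⇒literalHolds α β σ (h σ (inBox-σ σ τ djs)) k))
  , lookup⇒⊆ (λ k e → go (lookup α k) (lookup τ k) (λ a → dja k a e)
       (subst₂ (λ u v → literalHolds (lookup α k) u v ≡ true) e (lookup-∁ τ k) (inBox⇒literalHolds α β (∁ τ) (h (∁ τ) (inBox-∁τ σ τ djs)) k)))
  where
  go : ∀ a t → (a ≡ true → ⊥) → literalHolds a true (not t) ≡ true → t ≡ true
  go true t d e = ⊥-elim (d refl)
  go false true d e = refl

subset-antisym : ∀ {n} {p q : Subset n} → p ⊆ q → q ⊆ p → p ≡ q
subset-antisym h1 h2 = subset-ext (λ k → go (⊆⇒lookup h1 k) (⊆⇒lookup h2 k))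
  where
  go : ∀ {a b} → (a ≡ true → b ≡ true) → (b ≡ true → a ≡ true) → a ≡ b
  go {true} f g = sym (f refl)
  go {false} {true} f g = g refl
  go {false} {false} f g = refl

Apart-mono : ∀ {n} {σ τ σ' τ' : Subset n} → Apart σ τ → σ' ⊆ σ → τ' ⊆ τ → Apart σ' τ'
Apart-mono dj h1 h2 k a b = dj k (⊆⇒lookup h1 k a) (⊆⇒lookup h2 k b)

pm-IsPseudoMonomial : ∀ {n} (σ τ : Subset n) → Apart σ τ → IsPseudoMonomial (pm σ τ)
pm-IsPseudoMonomial σ τ dj = σ , τ , Apart⇒Disjoint dj , (λ m → refl)

InJ⇒BoxMisses : ∀ {n} (C : Code n) σ τ → InJ C (pm σ τ) → BoxMisses C σ τ
InJ⇒BoxMisses C σ τ j c c∈C = trans (sym (eval-pm σ τ c)) (InJ-vanishes C (pm σ τ) j c c∈C)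

MinimalBoxMisses⇒InCF : ∀ {n} (C : Code n) σ τ → Apart σ τ → MinimalBoxMisses C σ τ → InCF C (pm σ τ)
MinimalBoxMisses⇒InCF C σ τ dj (bx , mn) = pm-IsPseudoMonomial σ τ dj , BoxMisses⇒InJ C σ τ bx , minimal
  where
  minimal : ∀ g → IsPseudoMonomial g → InJ C g → g ∣P pm σ τ → g ≈ pm σ τ
  minimal g (α , β , djab , g≈) jg dv = subst (λ z → g ≈ z) (cong₂ pm (proj₁ eqs) (proj₂ eqs)) g≈
    where
    bxab : BoxMisses C α β
    bxab c c∈C = trans (sym (trans (eval-cong {p = g} {q = pm α β} g≈ c) (eval-pm α β c))) (InJ-vanishes C g jg c c∈C)
    incl : (α ⊆ σ) × (β ⊆ τ)
    incl = inBox-⊆⇒literals-⊇ σ τ α β dj (Disjoint⇒Apart djab)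
      (λ x e → trans (sym (trans (eval-cong {p = g} {q = pm α β} g≈ x) (eval-pm α β x)))
                 (∣P-eval g (pm σ τ) dv x (trans (eval-pm σ τ x) e)))
    eqs : (α ≡ σ) × (β ≡ τ)
    eqs = mn α β (proj₁ incl) (proj₂ incl) bxab

InCF⇒MinimalBoxMisses : ∀ {n} (C : Code n) f → InCF C f → ∃[ σ ] ∃[ τ ] (Apart σ τ × (f ≈ pm σ τ) × MinimalBoxMisses C σ τ)
InCF⇒MinimalBoxMisses C f ((σ , τ , dj , f≈) , jf , minf) = σ , τ , Disjoint⇒Apart dj , f≈ , bx , mn
  where
  bx : BoxMisses C σ τ
  bx c c∈C = trans (sym (trans (eval-cong {p = f} {q = pm σ τ} f≈ c) (eval-pm σ τ c))) (InJ-vanishes C f jf c c∈C)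
  mn : ∀ σ' τ' → σ' ⊆ σ → τ' ⊆ τ → BoxMisses C σ' τ' → (σ' ≡ σ) × (τ' ≡ τ)
  mn σ' τ' h1 h2 bx' = subset-antisym h1 (proj₁ incl) , subset-antisym h2 (proj₂ incl)
    where
    dj' : Apart σ' τ'
    dj' = Apart-mono (Disjoint⇒Apart dj) h1 h2
    g≈f : pm σ' τ' ≈ f
    g≈f = minf (pm σ' τ') (pm-IsPseudoMonomial σ' τ' dj') (BoxMisses⇒InJ C σ' τ' bx')
      (pm (σ ─ σ') (τ ─ τ') , λ m → trans (f≈ m) (pm-factorise σ τ σ' τ' dj h1 h2 m))
    incl : (σ ⊆ σ') × (τ ⊆ τ')
    incl = inBox-⊆⇒literals-⊇ σ' τ' σ τ dj' (Disjoint⇒Apart dj)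
      (λ x e → trans (sym (eval-pm σ τ x)) (trans (sym (eval-cong {p = f} {q = pm σ τ} f≈ x))
         (trans (sym (eval-cong {p = pm σ' τ'} {q = f} g≈f x)) (trans (eval-pm σ' τ' x) e))))

module _ {n : ℕ} where
  Realized : Code n → Fin n → Fin n → Bool → Bool → Set
  Realized C i j a b = ∃[ c ] (c ∈ C × lookup c i ≡ a × lookup c j ≡ b)

  Realized? : ∀ C i j a b → Dec (Realized C i j a b)
  Realized? C i j a b = map′ find (λ (_ , c∈ , p) → lose c∈ p) (Any.any? (λ c → (lookup c i B.≟ a) ×-dec (lookup c j B.≟ b)) C)

  BoxMisses? : ∀ (C : Code n) σ τ → Dec (BoxMisses C σ τ)
  BoxMisses? C σ τ = map′ (λ misses c → All.lookup misses) (λ misses → All.tabulate (misses _)) (All.all? (λ c → inBox σ τ c B.≟ false) C)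

  HasLiteral : Subset n → Subset n → Fin n → Bool → Set
  HasLiteral σ τ i true = lookup σ i ≡ true
  HasLiteral σ τ i false = lookup τ i ≡ true

  Obstruction : Code n → Subset n → Subset n → Set
  Obstruction C σ τ = ∃[ i ] ∃[ j ] ∃[ a ] ∃[ b ] (HasLiteral σ τ i a × HasLiteral σ τ j b × ¬ Realized C i j a b)

  PairObstructed : Code n → Set
  PairObstructed C = ∀ σ τ → Apart σ τ → BoxMisses C σ τ → Obstruction C σ τ

  Conventions : Code n → Set
  Conventions C = (S.⊥ ∈ C) × (∀ i → ∃[ c ] (c ∈ C × lookup c i ≡ true)) ×
           (∀ i j → (∀ c → c ∈ C → lookup c i ≡ lookup c j) → i ≡ j)

conventions : ∀ {n} (C : Code n) → StandingConventions C → Conventions C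
conventions C (b , act , dist) = b , (λ i → let (c , c∈ , x) = act i in c , c∈ , ∈⇒lookup x) ,
  λ i j h → dist i j (λ c c∈ → mk⇔ (λ x → lookup⇒∈ (trans (sym (h c c∈)) (∈⇒lookup x))) (λ x → lookup⇒∈ (trans (h c c∈) (∈⇒lookup x))))

Realized-diagonal : ∀ {n} (C : Code n) → Conventions C → ∀ i a → Realized C i i a a
Realized-diagonal C (b , act , _) i true = let (c , c∈ , x) = act i in c , c∈ , x , x
Realized-diagonal C (b , act , _) i false = S.⊥ , b , lookup-⊥ i , lookup-⊥ i

Realized-00 : ∀ {n} (C : Code n) → S.⊥ ∈ C → ∀ i j → Realized C i j false false
Realized-00 C b i j = S.⊥ , b , lookup-⊥ i , lookup-⊥ j

inBox-agreeing : ∀ {n} (σ τ c : Subset n) → (∀ x → (lookup σ x ≡ true ⊎ lookup τ x ≡ true) → lookup c x ≡ lookup σ x) → inBox σ τ c ≡ true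
inBox-agreeing σ τ c h = literalHolds⇒inBox σ τ c λ x → go (lookup σ x) (lookup τ x) (lookup c x) (h x)
  where
  go : ∀ s t b → ((s ≡ true ⊎ t ≡ true) → b ≡ s) → literalHolds s t b ≡ true
  go true t b h = h (inj₁ refl)
  go false true b h rewrite h (inj₂ refl) = refl
  go false false b h = refl

-- When no single literal can be dropped the box is minimal, because BoxMisses is monotone.
minimalBoxMisses-below : ∀ {n} (C : Code n) k σ τ → ∣ σ ∣ + ∣ τ ∣ ≤ k → Apart σ τ → BoxMisses C σ τ →
  ∃[ σ₀ ] ∃[ τ₀ ] (σ₀ ⊆ σ × τ₀ ⊆ τ × Apart σ₀ τ₀ × MinimalBoxMisses C σ₀ τ₀)
minimalBoxMisses-below {n} C k σ τ le dj bx with FP.any? {P = R} (λ j → ((lookup σ j B.≟ true) ×-dec BoxMisses? C (σ - j) τ) ⊎-dec ((lookup τ j B.≟ true) ×-dec BoxMisses? C σ (τ - j)))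
  where
  R : Fin n → Set
  R j = (lookup σ j ≡ true × BoxMisses C (σ - j) τ) ⊎ (lookup τ j ≡ true × BoxMisses C σ (τ - j))
... | yes (j , inj₁ (e , bx')) with k
...   | zero = ⊥-elim (NP.<⇒≱ (NP.<-≤-trans (SP.x∈p⇒∣p-x∣<∣p∣ (lookup⇒∈ {p = σ} e)) (NP.m≤m+n ∣ σ ∣ ∣ τ ∣)) (NP.≤-trans le z≤n))
...   | suc k' = let (σ₀ , τ₀ , h1 , h2 , d , mb) = minimalBoxMisses-below C k' (σ - j) τ
                        (NP.≤-pred (NP.<-≤-trans (NP.+-monoˡ-< ∣ τ ∣ (SP.x∈p⇒∣p-x∣<∣p∣ (lookup⇒∈ {p = σ} e))) le))
                        (Apart-mono {σ = σ} {τ} {σ - j} {τ} dj (SP.p─q⊆p σ ⁅ j ⁆) (λ x → x)) bx'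
               in σ₀ , τ₀ , (λ x → SP.p─q⊆p σ ⁅ j ⁆ (h1 x)) , h2 , d , mb
minimalBoxMisses-below {n} C k σ τ le dj bx | yes (j , inj₂ (e , bx')) with k
...   | zero = ⊥-elim (NP.<⇒≱ (NP.<-≤-trans (SP.x∈p⇒∣p-x∣<∣p∣ (lookup⇒∈ {p = τ} e)) (NP.m≤n+m ∣ τ ∣ ∣ σ ∣)) (NP.≤-trans le z≤n))
...   | suc k' = let (σ₀ , τ₀ , h1 , h2 , d , mb) = minimalBoxMisses-below C k' σ (τ - j)
                        (NP.≤-pred (NP.<-≤-trans (NP.+-monoʳ-< ∣ σ ∣ (SP.x∈p⇒∣p-x∣<∣p∣ (lookup⇒∈ {p = τ} e))) le))
                        (Apart-mono {σ = σ} {τ} {σ} {τ - j} dj (λ x → x) (SP.p─q⊆p τ ⁅ j ⁆)) bx'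
               in σ₀ , τ₀ , h1 , (λ x → SP.p─q⊆p τ ⁅ j ⁆ (h2 x)) , d , mb
minimalBoxMisses-below {n} C k σ τ le dj bx | no ¬R = σ , τ , (λ x → x) , (λ x → x) , dj , bx , mn
  where
  mn : ∀ σ' τ' → σ' ⊆ σ → τ' ⊆ τ → BoxMisses C σ' τ' → (σ' ≡ σ) × (τ' ≡ τ)
  mn σ' τ' h1 h2 bx' = subset-antisym h1 (lookup⇒⊆ g1) , subset-antisym h2 (lookup⇒⊆ g2)
    where
    g1 : ∀ k → lookup σ k ≡ true → lookup σ' k ≡ true
    g1 k e with true-or-false (lookup σ' k)
    ... | inj₁ ok = ok
    ... | inj₂ f = ⊥-elim (¬R (k , inj₁ (e , BoxMisses-mono C (σ - k) τ σ' τ' (Apart-mono {σ = σ} {τ} {σ - k} {τ} dj (SP.p─q⊆p σ ⁅ k ⁆) (λ x → x)) (⊆-minus σ σ' k h1 f) h2 bx')))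
    g2 : ∀ k → lookup τ k ≡ true → lookup τ' k ≡ true
    g2 k e with true-or-false (lookup τ' k)
    ... | inj₁ ok = ok
    ... | inj₂ f = ⊥-elim (¬R (k , inj₂ (e , BoxMisses-mono C σ (τ - k) σ' τ' (Apart-mono {σ = σ} {τ} {σ} {τ - k} dj (λ x → x) (SP.p─q⊆p τ ⁅ k ⁆)) h1 (⊆-minus τ τ' k h2 f) bx')))

∨-literals : ∀ x y a b → ((x ∧ a) ∨ (y ∧ b)) ∨ ((x ∧ not a) ∨ (y ∧ not b)) ≡ x ∨ y
∨-literals true true true true = refl
∨-literals true true true false = refl
∨-literals true true false true = refl
∨-literals true true false false = refl
∨-literals true false true true = refl
∨-literals true false true false = refl
∨-literals true false false true = refl
∨-literals true false false false = refl
∨-literals false true true true = refl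
∨-literals false true true false = refl
∨-literals false true false true = refl
∨-literals false true false false = refl
∨-literals false false true true = refl
∨-literals false false true false = refl
∨-literals false false false true = refl
∨-literals false false false false = refl

literalHolds-complement : ∀ a b → literalHolds a (not a) b ≡ true → b ≡ a
literalHolds-complement true b e = e
literalHolds-complement false true ()
literalHolds-complement false false e = refl

HasLiteral-true : ∀ {n} {σ τ : Subset n} {i a} → HasLiteral σ τ i a → a ≡ true → lookup σ i ≡ true
HasLiteral-true l refl = l
HasLiteral-false : ∀ {n} {σ τ : Subset n} {i a} → HasLiteral σ τ i a → a ≡ false → lookup τ i ≡ true
HasLiteral-false l refl = l

size2Box⇒obstruction : ∀ {n} (C : Code n) σ τ σ₀ τ₀ → σ₀ ⊆ σ → τ₀ ⊆ τ → BoxMisses C σ₀ τ₀ → ∣ σ₀ ∪ τ₀ ∣ ≡ 2 →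
  ∃[ i ] ∃[ j ] ∃[ a ] ∃[ b ] (HasLiteral σ τ i a × HasLiteral σ τ j b × ¬ Realized C i j a b)
size2Box⇒obstruction C σ τ σ₀ τ₀ h1 h2 bx0 c2 with ∣p∣≡2⇒ (σ₀ ∪ τ₀) c2
... | i , j , ne , ti , tj , u = i , j , lookup σ₀ i , lookup σ₀ j , litX i ti , litX j tj , noPat
  where
  litX : ∀ x → lookup (σ₀ ∪ τ₀) x ≡ true → HasLiteral σ τ x (lookup σ₀ x)
  litX x tx with lookup σ₀ x in eq
  ... | true = ⊆⇒lookup h1 x eq
  ... | false = ⊆⇒lookup h2 x (trans (sym (BP.∨-identityˡ _)) (trans (cong (_∨ lookup τ₀ x) (sym eq)) (trans (sym (lookup-∪ σ₀ τ₀ x)) tx)))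
  noPat : ¬ Realized C i j (lookup σ₀ i) (lookup σ₀ j)
  noPat (c , c∈ , ci , cj) = true≢false (trans (sym (inBox-agreeing σ₀ τ₀ c mt)) (bx0 c c∈))
    where
    mt : ∀ x → (lookup σ₀ x ≡ true ⊎ lookup τ₀ x ≡ true) → lookup c x ≡ lookup σ₀ x
    mt x h with u x (trans (lookup-∪ σ₀ τ₀ x) (Data.Sum.[ (λ e → cong (_∨ lookup τ₀ x) e) , (λ e → trans (cong (lookup σ₀ x ∨_) e) (BP.∨-zeroʳ _)) ] h))
    ... | inj₁ refl = ci
    ... | inj₂ refl = cj

DegreeTwo⇒PairObstructed : ∀ {n} (C : Code n) → Conventions C → DegreeTwo C → PairObstructed C
DegreeTwo⇒PairObstructed C cv dt σ τ dj bx with minimalBoxMisses-below C (∣ σ ∣ + ∣ τ ∣) σ τ NP.≤-refl dj bx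
... | σ₀ , τ₀ , h1 , h2 , d0 , mb = size2Box⇒obstruction C σ τ σ₀ τ₀ h1 h2 (proj₁ mb) (HasDegree-pm⇒ σ₀ τ₀ 2 (dt (pm σ₀ τ₀) (MinimalBoxMisses⇒InCF C σ₀ τ₀ d0 mb)))

obstruction-distinct : ∀ {n} (C : Code n) → Conventions C → ∀ σ τ → Apart σ τ → ∀ i j a b →
  HasLiteral σ τ i a → HasLiteral σ τ j b → ¬ Realized C i j a b → i ≢ j
obstruction-distinct C cv σ τ dj i j a b li lj np refl = same a b li lj np
  where
  same : ∀ a b → HasLiteral σ τ i a → HasLiteral σ τ i b → ¬ Realized C i i a b → ⊥
  same true true _ _ np′ = np′ (Realized-diagonal C cv i true)
  same false false _ _ np′ = np′ (Realized-diagonal C cv i false)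
  same true false l1 l2 _ = dj i l1 l2
  same false true l1 l2 _ = dj i l2 l1

-- The box of the two obstructing literals alone already misses C, so by minimality it is the whole box.
obstructed⇒minimalBox-size2 : ∀ {n} (C : Code n) → Conventions C → ∀ σ τ → Apart σ τ → MinimalBoxMisses C σ τ → ∀ i j a b → HasLiteral σ τ i a → HasLiteral σ τ j b → ¬ Realized C i j a b → ∣ σ ∪ τ ∣ ≡ 2
obstructed⇒minimalBox-size2 {n} C cv σ τ dj mb i j a b li lj np = eq2
  where
  ne : i ≢ j
  ne = obstruction-distinct C cv σ τ dj i j a b li lj np
  σ' : Subset n
  σ' = tabulate (λ k → (eqᵇ i k ∧ a) ∨ (eqᵇ j k ∧ b))
  τ' : Subset n
  τ' = tabulate (λ k → (eqᵇ i k ∧ not a) ∨ (eqᵇ j k ∧ not b))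
  s⊆ : σ' ⊆ σ
  s⊆ = lookup⇒⊆ λ k e → Data.Sum.[ (λ e1 → subst (λ z → lookup σ z ≡ true) (eqᵇ⇒≡ (∧-trueˡ _ _ e1)) (HasLiteral-true li (∧-trueʳ _ _ e1)))
                            , (λ e2 → subst (λ z → lookup σ z ≡ true) (eqᵇ⇒≡ (∧-trueˡ _ _ e2)) (HasLiteral-true lj (∧-trueʳ _ _ e2))) ]
                   (∨≡true⇒ _ _ (trans (sym (lookup-tabulate _ k)) e))
  t⊆ : τ' ⊆ τ
  t⊆ = lookup⇒⊆ λ k e → Data.Sum.[ (λ e1 → subst (λ z → lookup τ z ≡ true) (eqᵇ⇒≡ (∧-trueˡ _ _ e1)) (HasLiteral-false li (notT a (∧-trueʳ _ _ e1))))
                            , (λ e2 → subst (λ z → lookup τ z ≡ true) (eqᵇ⇒≡ (∧-trueˡ _ _ e2)) (HasLiteral-false lj (notT b (∧-trueʳ _ _ e2)))) ]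
                   (∨≡true⇒ _ _ (trans (sym (lookup-tabulate _ k)) e))
    where
    notT : ∀ x → not x ≡ true → x ≡ false
    notT false _ = refl
  atI : lookup σ' i ≡ a × lookup τ' i ≡ not a
  atI rewrite lookup-tabulate (λ k → (eqᵇ i k ∧ a) ∨ (eqᵇ j k ∧ b)) i | lookup-tabulate (λ k → (eqᵇ i k ∧ not a) ∨ (eqᵇ j k ∧ not b)) i
        | eqᵇ-refl i | eqᵇ-≢ {i = j} {i} (λ e → ne (sym e)) = BP.∨-identityʳ a , BP.∨-identityʳ (not a)
  atJ : lookup σ' j ≡ b × lookup τ' j ≡ not b
  atJ rewrite lookup-tabulate (λ k → (eqᵇ i k ∧ a) ∨ (eqᵇ j k ∧ b)) j | lookup-tabulate (λ k → (eqᵇ i k ∧ not a) ∨ (eqᵇ j k ∧ not b)) j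
        | eqᵇ-refl j | eqᵇ-≢ {i = i} {j} ne = refl , refl
  bx' : BoxMisses C σ' τ'
  bx' c c∈ with inBox σ' τ' c in eq
  ... | false = refl
  ... | true = ⊥-elim (np (c , c∈ ,
          literalHolds-complement a (lookup c i) (subst₂ (λ u v → literalHolds u v (lookup c i) ≡ true) (proj₁ atI) (proj₂ atI) (inBox⇒literalHolds σ' τ' c eq i)) ,
          literalHolds-complement b (lookup c j) (subst₂ (λ u v → literalHolds u v (lookup c j) ≡ true) (proj₁ atJ) (proj₂ atJ) (inBox⇒literalHolds σ' τ' c eq j))))
  eqs : (σ' ≡ σ) × (τ' ≡ τ)
  eqs = proj₂ mb σ' τ' s⊆ t⊆ bx'
  eq2 : ∣ σ ∪ τ ∣ ≡ 2
  eq2 = trans (cong ∣_∣ (trans (sym (cong₂ _∪_ (proj₁ eqs) (proj₂ eqs)))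
          (subset-ext {p = σ' ∪ τ'} {q = ⁅ i ⁆ ∪ ⁅ j ⁆} λ k → trans (lookup-∪ σ' τ' k) (trans (cong₂ _∨_ (lookup-tabulate (λ k → (eqᵇ i k ∧ a) ∨ (eqᵇ j k ∧ b)) k) (lookup-tabulate (λ k → (eqᵇ i k ∧ not a) ∨ (eqᵇ j k ∧ not b)) k))
            (trans (∨-literals (eqᵇ i k) (eqᵇ j k) a b) (sym (trans (lookup-∪ ⁅ i ⁆ ⁅ j ⁆ k) (cong₂ _∨_ (lookup-⁅⁆ i k) (lookup-⁅⁆ j k)))))))))
          (∣⁅i⁆∪⁅j⁆∣≡2 i j ne)

PairObstructed⇒DegreeTwo : ∀ {n} (C : Code n) → Conventions C → PairObstructed C → DegreeTwo C
PairObstructed⇒DegreeTwo {n} C cv obstructed f cff with InCF⇒MinimalBoxMisses C f cff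
... | σ , τ , dj , f≈ , mb with obstructed σ τ dj (proj₁ mb)
... | i , j , a , b , li , lj , np =
  HasDegree-≈ {f = pm σ τ} {g = f} (≈-sym {p = f} {q = pm σ τ} f≈) (subst (HasDegree (pm σ τ)) (obstructed⇒minimalBox-size2 C cv σ τ dj mb i j a b li lj np) (pm-HasDegree σ τ))

module _ {n : ℕ} where
  Crossing : Code n → Fin n → Fin n → Set
  Crossing C i j = i ≢ j × Realized C i j true true × Realized C i j true false × Realized C i j false true

-- The graph G(C) as the crossing graph

singletonBox-hits : ∀ {n} (C : Code n) → Conventions C → ∀ σ τ → Apart σ τ → BoxMisses C σ τ → ∀ o → (∀ x → lookup σ x ≡ true ⊎ lookup τ x ≡ true → x ≡ o) → ⊥
singletonBox-hits C (∅∈C , act , _) σ τ dj bx o h with true-or-false (lookup σ o)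
... | inj₁ so = let (c , c∈ , co) = act o in
  true≢false (trans (sym (literalHolds⇒inBox σ τ c (λ x → go x c co))) (bx c c∈))
  where
  go : ∀ x c → lookup c o ≡ true → literalHolds (lookup σ x) (lookup τ x) (lookup c x) ≡ true
  go x c co with true-or-false (lookup σ x) | true-or-false (lookup τ x)
  ... | inj₁ sx | _ rewrite sx | h x (inj₁ sx) = co
  ... | inj₂ sx | inj₁ tx = ⊥-elim (dj o so (subst (λ z → lookup τ z ≡ true) (h x (inj₂ tx)) tx))
  ... | inj₂ sx | inj₂ tx rewrite sx | tx = refl
... | inj₂ so = true≢false (trans (sym (literalHolds⇒inBox σ τ S.⊥ (λ x → go x))) (bx S.⊥ ∅∈C))
  where
  go : ∀ x → literalHolds (lookup σ x) (lookup τ x) (lookup (S.⊥ {n = _}) x) ≡ true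
  go x with true-or-false (lookup σ x)
  ... | inj₁ sx = ⊥-elim (true≢false (trans (sym (subst (λ z → lookup σ z ≡ true) (h x (inj₁ sx)) sx)) so))
  ... | inj₂ sx rewrite sx | lookup-⊥ x with lookup τ x
  ...   | true = refl
  ...   | false = refl

pairBox-minimal : ∀ {n} (C : Code n) → Conventions C → ∀ σ τ i j → Apart σ τ → BoxMisses C σ τ → i ≢ j →
  (∀ x → lookup (σ ∪ τ) x ≡ eqᵇ i x ∨ eqᵇ j x) → MinimalBoxMisses C σ τ
pairBox-minimal C cv σ τ i j dj bx ne pt = bx , mn
  where
  mem : ∀ x → lookup σ x ≡ true ⊎ lookup τ x ≡ true → x ≡ i ⊎ x ≡ j
  mem x h = Data.Sum.map (λ e → sym (eqᵇ⇒≡ e)) (λ e → sym (eqᵇ⇒≡ e))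
    (∨≡true⇒ _ _ (trans (sym (pt x)) (trans (lookup-∪ σ τ x) (Data.Sum.[ (λ e → cong (_∨ lookup τ x) e) , (λ e → trans (cong (lookup σ x ∨_) e) (BP.∨-zeroʳ _)) ] h))))
  other : ∀ k → k ≡ i ⊎ k ≡ j → ∃[ o ] (∀ x → x ≡ i ⊎ x ≡ j → x ≢ k → x ≡ o)
  other k (inj₁ refl) = j , λ { x (inj₁ e) ne' → ⊥-elim (ne' e) ; x (inj₂ e) _ → e }
  other k (inj₂ refl) = i , λ { x (inj₁ e) _ → e ; x (inj₂ e) ne' → ⊥-elim (ne' e) }
  mn : ∀ σ' τ' → σ' ⊆ σ → τ' ⊆ τ → BoxMisses C σ' τ' → (σ' ≡ σ) × (τ' ≡ τ)
  mn σ' τ' h1 h2 bx' = subset-antisym h1 (lookup⇒⊆ g1) , subset-antisym h2 (lookup⇒⊆ g2)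
    where
    dj' : Apart σ' τ'
    dj' = Apart-mono {σ = σ} {τ} {σ'} {τ'} dj h1 h2
    lift' : ∀ x → lookup σ' x ≡ true ⊎ lookup τ' x ≡ true → lookup σ x ≡ true ⊎ lookup τ x ≡ true
    lift' x = Data.Sum.map (⊆⇒lookup h1 x) (⊆⇒lookup h2 x)
    g1 : ∀ k → lookup σ k ≡ true → lookup σ' k ≡ true
    g1 k e with true-or-false (lookup σ' k)
    ... | inj₁ ok = ok
    ... | inj₂ f with other k (mem k (inj₁ e))
    ...   | o , ho = ⊥-elim (singletonBox-hits C cv σ' τ' dj' bx' o (λ x h → ho x (mem x (lift' x h)) (λ { refl →
              Data.Sum.[ (λ s → true≢false (trans (sym s) f)) , (λ t → dj x e (⊆⇒lookup h2 x t)) ] h })))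
    g2 : ∀ k → lookup τ k ≡ true → lookup τ' k ≡ true
    g2 k e with true-or-false (lookup τ' k)
    ... | inj₁ ok = ok
    ... | inj₂ f with other k (mem k (inj₂ e))
    ...   | o , ho = ⊥-elim (singletonBox-hits C cv σ' τ' dj' bx' o (λ x h → ho x (mem x (lift' x h)) (λ { refl →
              Data.Sum.[ (λ s → dj x (⊆⇒lookup h1 x s) e) , (λ t → true≢false (trans (sym t) f)) ] h })))

lookup-pair : ∀ {n} (σ τ : Subset n) i j → σ ∪ τ ≡ ⁅ i ⁆ ∪ ⁅ j ⁆ → ∀ x → lookup (σ ∪ τ) x ≡ eqᵇ i x ∨ eqᵇ j x
lookup-pair σ τ i j e x = trans (cong (λ z → lookup z x) e) (trans (lookup-∪ ⁅ i ⁆ ⁅ j ⁆ x) (cong₂ _∨_ (lookup-⁅⁆ i x) (lookup-⁅⁆ j x)))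

Crossing⇒GEdge : ∀ {n} (C : Code n) → Conventions C → ∀ i j → Crossing C i j → GEdge C i j
Crossing⇒GEdge C cv i j (ne , r11 , r10 , r01) = ne , λ { (σ , τ , dj , cff , eq) → go σ τ (Disjoint⇒Apart dj) (InJ⇒BoxMisses C σ τ (proj₁ (proj₂ cff))) (lookup-pair σ τ i j eq) }
  where
  realAny : ∀ a b → Realized C i j a b
  realAny true true = r11
  realAny true false = r10
  realAny false true = r01
  realAny false false = Realized-00 C (proj₁ cv) i j
  go : ∀ σ τ → Apart σ τ → BoxMisses C σ τ → (∀ x → lookup (σ ∪ τ) x ≡ eqᵇ i x ∨ eqᵇ j x) → ⊥
  go σ τ dj bx pt with realAny (lookup σ i) (lookup σ j)
  ... | c , c∈ , ci , cj = true≢false (trans (sym (inBox-agreeing σ τ c mt)) (bx c c∈))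
    where
    mt : ∀ x → (lookup σ x ≡ true ⊎ lookup τ x ≡ true) → lookup c x ≡ lookup σ x
    mt x h with ∨≡true⇒ _ _ (trans (sym (pt x)) (trans (lookup-∪ σ τ x) (Data.Sum.[ (λ e → cong (_∨ lookup τ x) e) , (λ e → trans (cong (lookup σ x ∨_) e) (BP.∨-zeroʳ _)) ] h)))
    ... | inj₁ e with eqᵇ⇒≡ {i = i} {x} e
    ...   | refl = ci
    mt x h | inj₂ e with eqᵇ⇒≡ {i = j} {x} e
    ...   | refl = cj

inBox-positive : ∀ {n} (σ τ c : Subset n) x → inBox σ τ c ≡ true → lookup σ x ≡ true → lookup c x ≡ true
inBox-positive σ τ c x e s = subst (λ z → literalHolds z (lookup τ x) (lookup c x) ≡ true) s (inBox⇒literalHolds σ τ c e x)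

inBox-negative : ∀ {n} (σ τ c : Subset n) x → inBox σ τ c ≡ true → lookup σ x ≡ false → lookup τ x ≡ true → lookup c x ≡ false
inBox-negative σ τ c x e s t = literalHolds-negative (subst₂ (λ u v → literalHolds u v (lookup c x) ≡ true) s t (inBox⇒literalHolds σ τ c e x)) refl

BoxMisses-unrealized : ∀ {n} (C : Code n) σ τ i j a b → (∀ c → inBox σ τ c ≡ true → lookup c i ≡ a × lookup c j ≡ b) →
  ¬ Realized C i j a b → BoxMisses C σ τ
BoxMisses-unrealized C σ τ i j a b forced nr c c∈ with inBox σ τ c in e
... | false = refl
... | true = ⊥-elim (nr (c , c∈ , forced c e))

-- A missing pattern (a, b) on i, j gives a two-literal box missing C; being minimal, it would put a
-- pseudo-monomial in exactly x_i and x_j into CF(J_C).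
GEdge⇒Crossing : ∀ {n} (C : Code n) → Conventions C → ∀ i j → GEdge C i j → Crossing C i j
GEdge⇒Crossing {n} C cv i j (ne , no-CF) = ne , r11 , r10 , r01
  where
  excluded : ∀ σ τ → Apart σ τ → σ ∪ τ ≡ ⁅ i ⁆ ∪ ⁅ j ⁆ → BoxMisses C σ τ → ⊥
  excluded σ τ dj eq bx =
    no-CF (σ , τ , Apart⇒Disjoint dj , MinimalBoxMisses⇒InCF C σ τ dj (pairBox-minimal C cv σ τ i j dj bx ne (lookup-pair σ τ i j eq)) , eq)
  r11 : Realized C i j true true
  r11 with Realized? C i j true true
  ... | yes r = r
  ... | no nr = ⊥-elim (excluded (⁅ i ⁆ ∪ ⁅ j ⁆) S.⊥ (λ x _ b → true≢false (trans (sym b) (lookup-⊥ x))) (SP.∪-identityʳ _)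
            (BoxMisses-unrealized C (⁅ i ⁆ ∪ ⁅ j ⁆) S.⊥ i j true true (λ c e →
               inBox-positive (⁅ i ⁆ ∪ ⁅ j ⁆) S.⊥ c i e (trans (lookup-∪ ⁅ i ⁆ ⁅ j ⁆ i) (cong (_∨ lookup ⁅ j ⁆ i) (lookup-⁅⁆-self i))) ,
               inBox-positive (⁅ i ⁆ ∪ ⁅ j ⁆) S.⊥ c j e (trans (lookup-∪ ⁅ i ⁆ ⁅ j ⁆ j) (trans (cong (lookup ⁅ i ⁆ j ∨_) (lookup-⁅⁆-self j)) (BP.∨-zeroʳ _)))) nr))
  r10 : Realized C i j true false
  r10 with Realized? C i j true false
  ... | yes r = r
  ... | no nr = ⊥-elim (excluded ⁅ i ⁆ ⁅ j ⁆ (Apart-⁅⁆ ne) refl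
            (BoxMisses-unrealized C ⁅ i ⁆ ⁅ j ⁆ i j true false (λ c e →
               inBox-positive ⁅ i ⁆ ⁅ j ⁆ c i e (lookup-⁅⁆-self i) , inBox-negative ⁅ i ⁆ ⁅ j ⁆ c j e (lookup-⁅⁆-other ne) (lookup-⁅⁆-self j)) nr))
  r01 : Realized C i j false true
  r01 with Realized? C i j false true
  ... | yes r = r
  ... | no nr = ⊥-elim (excluded ⁅ j ⁆ ⁅ i ⁆ (Apart-⁅⁆ (ne ∘ sym)) (SP.∪-comm ⁅ j ⁆ ⁅ i ⁆)
            (BoxMisses-unrealized C ⁅ j ⁆ ⁅ i ⁆ i j false true (λ c e →
               inBox-negative ⁅ j ⁆ ⁅ i ⁆ c i e (lookup-⁅⁆-other (ne ∘ sym)) (lookup-⁅⁆-self i) , inBox-positive ⁅ j ⁆ ⁅ i ⁆ c j e (lookup-⁅⁆-self j)) nr))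

GEdge⇔Crossing : ∀ {n} (C : Code n) → Conventions C → ∀ i j → GEdge C i j ⇔ Crossing C i j
GEdge⇔Crossing C cv i j = mk⇔ (GEdge⇒Crossing C cv i j) (Crossing⇒GEdge C cv i j)

Chordal-⇔ : ∀ {n} {E E′ : Fin n → Fin n → Set} → (∀ x y → E x y ⇔ E′ x y) → Chordal E → Chordal E′
Chordal-⇔ E⇔E′ chordal l v inj adj with chordal l v inj (λ a b c → from (E⇔E′ _ _) (adj a b c))
... | a , b , a≢b , ¬adj , chord = a , b , a≢b , ¬adj , to (E⇔E′ _ _) chord

IsClique-map : ∀ {n} {E E′ : Fin n → Fin n → Set} → (∀ x y → E x y → E′ x y) → ∀ K → IsClique E K → IsClique E′ K
IsClique-map f K clique x y x∈ y∈ x≢y = f x y (clique x y x∈ y∈ x≢y)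

-- Chordal graphs: induced paths and Dirac's lemma

CycAdjℕ : ℕ → ℕ → ℕ → Set
CycAdjℕ l x y = (y ≡ suc x) ⊎ (x ≡ suc y) ⊎ (x ≡ 0 × y ≡ 3 + l) ⊎ (y ≡ 0 × x ≡ 3 + l)

≢suc-+ : ∀ (k x : ℕ) → x ≡ suc (k + x) → ⊥
≢suc-+ k zero ()
≢suc-+ k (suc x) e = ≢suc-+ k x (trans (NP.suc-injective e) (NP.+-suc k x))

cycle-neighboursℕ : ∀ l m → m < 4 + l → ∃[ x ] ∃[ y ] (x < 4 + l × y < 4 + l × CycAdjℕ l m x × CycAdjℕ l m y × x ≢ y × ¬ CycAdjℕ l x y)
cycle-neighboursℕ l zero lt = 1 , 3 + l , s≤s (s≤s z≤n) , NP.≤-refl , inj₁ refl , inj₂ (inj₂ (inj₁ (refl , refl))) ,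
  (λ ()) , bad
  where
  bad : ¬ CycAdjℕ l 1 (3 + l)
  bad (inj₁ ())
  bad (inj₂ (inj₁ ()))
  bad (inj₂ (inj₂ (inj₁ (() , _))))
  bad (inj₂ (inj₂ (inj₂ (() , _))))
cycle-neighboursℕ l (suc m) lt with m N.≟ 2 + l
... | yes refl = 2 + l , 0 , s≤s (NP.n≤1+n (2 + l)) , s≤s z≤n , inj₂ (inj₁ refl) , inj₂ (inj₂ (inj₂ (refl , refl))) , (λ ()) , bad
  where
  bad : ¬ CycAdjℕ l (2 + l) 0
  bad (inj₁ ())
  bad (inj₂ (inj₁ e)) = case l e
    where
    case : ∀ l → 2 + l ≡ 1 → ⊥
    case l ()
  bad (inj₂ (inj₂ (inj₁ (() , _))))
  bad (inj₂ (inj₂ (inj₂ (_ , e)))) = ≢suc-+ 0 (2 + l) e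
... | no ne = m , suc (suc m) , NP.≤-trans (NP.n≤1+n (suc m)) lt , lt2 , inj₂ (inj₁ refl) , inj₁ refl , (λ e → ≢suc-+ 1 m e) , bad
  where
  lt2 : suc (suc m) < 4 + l
  lt2 with NP.m≤n⇒m<n∨m≡n (NP.≤-pred lt)
  ... | inj₁ lt' = s≤s lt'
  ... | inj₂ e = ⊥-elim (ne (NP.suc-injective e))
  bad : ¬ CycAdjℕ l m (suc (suc m))
  bad (inj₁ e) = ≢suc-+ 0 (suc m) (sym e)
  bad (inj₂ (inj₁ e)) = ≢suc-+ 2 m e
  bad (inj₂ (inj₂ (inj₁ (refl , ()))))
  bad (inj₂ (inj₂ (inj₂ (() , _))))

cycle-neighbours : ∀ l (a : Fin (4 + l)) → ∃[ b ] ∃[ c ] (CycAdj l a b × CycAdj l a c × b ≢ c × ¬ CycAdj l b c)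
cycle-neighbours l a with cycle-neighboursℕ l (toℕ a) (FP.toℕ<n a)
... | x , y , xl , yl , ax , ay , ne , nxy =
  F.fromℕ< xl , F.fromℕ< yl ,
  subst (CycAdjℕ l (toℕ a)) (sym (FP.toℕ-fromℕ< xl)) ax ,
  subst (CycAdjℕ l (toℕ a)) (sym (FP.toℕ-fromℕ< yl)) ay ,
  (λ e → ne (trans (sym (FP.toℕ-fromℕ< xl)) (trans (cong toℕ e) (FP.toℕ-fromℕ< yl)))) ,
  (λ c → nxy (subst₂ (CycAdjℕ l) (FP.toℕ-fromℕ< xl) (FP.toℕ-fromℕ< yl) c))

module Paths {n : ℕ} (E : Fin n → Fin n → Set) (E? : ∀ x y → Dec (E x y))
         (Esym : ∀ {x y} → E x y → E y x) (Eirr : ∀ {x} → E x x → ⊥) where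

  data Walk (P : Fin n → Set) : Fin n → Fin n → Set where
    walk-[] : ∀ {a} → P a → Walk P a a
    walk-∷ : ∀ {a b c} → P a → E a b → Walk P b c → Walk P a c

  walk-head : ∀ {P a b} → Walk P a b → P a
  walk-head (walk-[] p) = p
  walk-head (walk-∷ p _ _) = p

  walk-map : ∀ {P Q : Fin n → Set} {a b} → (∀ z → P z → Q z) → Walk P a b → Walk Q a b
  walk-map f (walk-[] p) = walk-[] (f _ p)
  walk-map f (walk-∷ p e w) = walk-∷ (f _ p) e (walk-map f w)

  walk-++ : ∀ {P a b c} → Walk P a b → Walk P b c → Walk P a c
  walk-++ (walk-[] p) w = w
  walk-++ (walk-∷ p e w) w' = walk-∷ p e (walk-++ w w')

  walk-reverse : ∀ {P a b} → Walk P a b → Walk P b a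
  walk-reverse (walk-[] p) = walk-[] p
  walk-reverse (walk-∷ p e w) = walk-++ (walk-reverse w) (walk-∷ (walk-head w) (Esym e) (walk-[] p))

  NonNeighbours : Fin n → List (Fin n) → Set
  NonNeighbours u l = All (λ w → u ≢ w × ¬ E u w) l

  InducedPath : List (Fin n) → Set
  InducedPath [] = ⊤
  InducedPath (u ∷ []) = ⊤
  InducedPath (u ∷ v ∷ l) = E u v × NonNeighbours u l × InducedPath (v ∷ l)

  endpoint : Fin n → List (Fin n) → Fin n
  endpoint a [] = a
  endpoint a (b ∷ l) = endpoint b l

  ≡-or-adjacent? : ∀ u w → Dec (w ≡ u ⊎ E u w)
  ≡-or-adjacent? u w = (w FP.≟ u) ⊎-dec E? u w

  -- Restart the path at its last vertex that is u or adjacent to u.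
  shortcut : ∀ {P : Fin n → Set} u b l → InducedPath (b ∷ l) → All P (b ∷ l) → Any (λ w → w ≡ u ⊎ E u w) (b ∷ l) →
    ∃[ z ] ∃[ r ] (InducedPath (z ∷ r) × All P (z ∷ r) × endpoint z r ≡ endpoint b l × (z ≡ u ⊎ E u z) × NonNeighbours u r)
  shortcut u b [] ip ap (here h) = b , [] , tt , ap , refl , h , []
  shortcut u b [] ip ap (there ())
  shortcut u b (c ∷ l) ip (pb ∷ ap) an with Any.any? (≡-or-adjacent? u) (c ∷ l)
  ... | yes an' = shortcut u c l (proj₂ (proj₂ ip)) ap an'
  ... | no nan with an
  ...   | here h = b , c ∷ l , ip , pb ∷ ap , refl , h , All.tabulate (λ {w} w∈ → (λ e → nan (Any.map (λ eq → inj₁ (trans (sym eq) (sym e))) w∈)) ,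
                                                                         (λ e → nan (Any.map (λ eq → inj₂ (subst (E u) eq e)) w∈)))
  ...   | there t = ⊥-elim (nan t)

  induced-path : ∀ {P : Fin n → Set} {a c} → Walk P a c → ∃[ l ] (InducedPath (a ∷ l) × endpoint a l ≡ c × All P (a ∷ l))
  induced-path (walk-[] pa) = [] , tt , refl , pa ∷ []
  induced-path {a = a} (walk-∷ pa eab w) with induced-path w
  ... | l' , ip , lst , ap with shortcut a _ l' ip ap (here (inj₂ eab))
  ...   | z , r , ipz , apz , lz , inj₁ refl , na = r , ipz , trans lz lst , apz
  ...   | z , r , ipz , apz , lz , inj₂ eaz , na = z ∷ r , (eaz , na , ipz) , trans lz lst , pa ∷ apz

  vertexAt : Fin n → List (Fin n) → ℕ → Fin n
  vertexAt d [] t = d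
  vertexAt d (u ∷ l) zero = u
  vertexAt d (u ∷ l) (suc t) = vertexAt d l t

  vertexAt-All : ∀ {Q : Fin n → Set} d (p : List (Fin n)) t → All Q p → t < length p → Q (vertexAt d p t)
  vertexAt-All d (u ∷ p) zero (q ∷ _) _ = q
  vertexAt-All d (u ∷ p) (suc t) (_ ∷ qs) (s≤s lt) = vertexAt-All d p t qs lt

  vertexAt-adjacent : ∀ d (p : List (Fin n)) → InducedPath p → ∀ t → suc t < length p → E (vertexAt d p t) (vertexAt d p (suc t))
  vertexAt-adjacent d (u ∷ v ∷ l) (e , _ , _) zero _ = e
  vertexAt-adjacent d (u ∷ v ∷ l) (_ , _ , ip) (suc t) (s≤s lt) = vertexAt-adjacent d (v ∷ l) ip t lt
  vertexAt-adjacent d (u ∷ []) _ t (s≤s ())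

  vertexAt-far : ∀ d (p : List (Fin n)) → InducedPath p → ∀ t t' → suc t < t' → t' < length p → (vertexAt d p t ≢ vertexAt d p t') × ¬ E (vertexAt d p t) (vertexAt d p t')
  vertexAt-far d (u ∷ v ∷ l) (_ , na , _) zero (suc (suc k)) _ (s≤s (s≤s lt)) = vertexAt-All d l k na lt
  vertexAt-far d (u ∷ v ∷ l) (_ , _ , ip) (suc t) (suc t') (s≤s lt1) (s≤s lt2) = vertexAt-far d (v ∷ l) ip t t' lt1 lt2
  vertexAt-far d (u ∷ v ∷ l) _ zero (suc zero) (s≤s ()) _
  vertexAt-far d (u ∷ []) _ zero (suc (suc k)) _ (s≤s ())
  vertexAt-far d (u ∷ []) _ (suc t) (suc t') _ (s≤s ())

  vertexAt-injective : ∀ d (p : List (Fin n)) → InducedPath p → ∀ t t' → t < t' → t' < length p → vertexAt d p t ≢ vertexAt d p t'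
  vertexAt-injective d p ip t t' lt lt' e with NP.m≤n⇒m<n∨m≡n lt
  ... | inj₁ far = proj₁ (vertexAt-far d p ip t t' far lt') e
  ... | inj₂ refl = Eirr (subst (E (vertexAt d p t)) (sym e) (vertexAt-adjacent d p ip t lt'))

  vertexAt-endpoint : ∀ d a (l : List (Fin n)) → vertexAt d (a ∷ l) (length l) ≡ endpoint a l
  vertexAt-endpoint d a [] = refl
  vertexAt-endpoint d a (b ∷ l) = vertexAt-endpoint d b l

  CycAdjℕ-sym : ∀ L t t' → CycAdjℕ L t t' → CycAdjℕ L t' t
  CycAdjℕ-sym L t t' (inj₁ e) = inj₂ (inj₁ e)
  CycAdjℕ-sym L t t' (inj₂ (inj₁ e)) = inj₁ e
  CycAdjℕ-sym L t t' (inj₂ (inj₂ (inj₁ (a , b)))) = inj₂ (inj₂ (inj₂ (a , b)))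
  CycAdjℕ-sym L t t' (inj₂ (inj₂ (inj₂ (a , b)))) = inj₂ (inj₂ (inj₁ (a , b)))

  -- x followed by the induced path s1 … s2 is a cycle of length at least 4 without chords.
  module ClosedDetour (ch : Chordal E) (x s1 q1 q2 : Fin n) (l'' : List (Fin n)) (ip : InducedPath (s1 ∷ q1 ∷ q2 ∷ l''))
    (e1 : E x s1) (e2 : E x (endpoint s1 (q1 ∷ q2 ∷ l''))) (ne12 : ¬ E s1 (endpoint s1 (q1 ∷ q2 ∷ l''))) (d12 : s1 ≢ endpoint s1 (q1 ∷ q2 ∷ l''))
    (int : ∀ t → 0 < t → t < length (q1 ∷ q2 ∷ l'') → (x ≢ vertexAt s1 (s1 ∷ q1 ∷ q2 ∷ l'') t) × ¬ E x (vertexAt s1 (s1 ∷ q1 ∷ q2 ∷ l'') t)) where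
    L : ℕ
    L = length l''
    p : List (Fin n)
    p = s1 ∷ q1 ∷ q2 ∷ l''
    h : ℕ → Fin n
    h zero = x
    h (suc t) = vertexAt s1 p t
    s2 : Fin n
    s2 = endpoint s1 (q1 ∷ q2 ∷ l'')
    lastEq : vertexAt s1 p (2 + L) ≡ s2
    lastEq = vertexAt-endpoint s1 s1 (q1 ∷ q2 ∷ l'')
    x≢s1 : x ≢ s1
    x≢s1 e = Eirr (subst (E x) (sym e) e1)
    x≢s2 : x ≢ s2
    x≢s2 e = Eirr (subst (E x) (sym e) e2)
    A1 : ∀ t → suc t < 4 + L → E (h t) (h (suc t))
    A1 zero _ = e1
    A1 (suc u) (s≤s lt) = vertexAt-adjacent s1 p ip u lt
    hAdj : ∀ t t' → t < 4 + L → t' < 4 + L → CycAdjℕ L t t' → E (h t) (h t')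
    hAdj t t' lt lt' (inj₁ refl) = A1 t lt'
    hAdj t t' lt lt' (inj₂ (inj₁ refl)) = Esym (A1 t' lt)
    hAdj t t' lt lt' (inj₂ (inj₂ (inj₁ (refl , refl)))) = subst (E x) (sym lastEq) e2
    hAdj t t' lt lt' (inj₂ (inj₂ (inj₂ (refl , refl)))) = Esym (subst (E x) (sym lastEq) e2)
    xfree : ∀ u → u < 3 + L → x ≢ vertexAt s1 p u
    xfree zero _ = x≢s1
    xfree (suc u) lt with suc u N.≟ 2 + L
    ... | yes e = λ z → x≢s2 (trans z (trans (cong (vertexAt s1 p) e) lastEq))
    ... | no ne = proj₁ (int (suc u) (s≤s z≤n) (lt' lt ne))
      where
      lt' : suc u < 3 + L → suc u ≢ 2 + L → suc u < 2 + L
      lt' (s≤s le) ne' with NP.m≤n⇒m<n∨m≡n le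
      ... | inj₁ r = r
      ... | inj₂ r = ⊥-elim (ne' r)
    hInj : ∀ t t' → t < 4 + L → t' < 4 + L → h t ≡ h t' → t ≡ t'
    hInj zero zero _ _ _ = refl
    hInj zero (suc u) _ (s≤s lt) e = ⊥-elim (xfree u lt e)
    hInj (suc u) zero (s≤s lt) _ e = ⊥-elim (xfree u lt (sym e))
    hInj (suc u) (suc u') (s≤s lt) (s≤s lt') e with NP.<-cmp u u'
    ... | tri< a _ _ = ⊥-elim (vertexAt-injective s1 p ip u u' a lt' e)
    ... | tri≈ _ b _ = cong suc b
    ... | tri> _ _ c = ⊥-elim (vertexAt-injective s1 p ip u' u c lt (sym e))
    hNC< : ∀ t t' → t < t' → t' < 4 + L → ¬ CycAdjℕ L t t' → ¬ E (h t) (h t')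
    hNC< zero (suc zero) _ _ nca _ = nca (inj₁ refl)
    hNC< zero (suc (suc u)) _ (s≤s lt) nca with suc u N.≟ 2 + L
    ... | yes e = ⊥-elim (nca (inj₂ (inj₂ (inj₁ (refl , cong suc e)))))
    ... | no ne = proj₂ (int (suc u) (s≤s z≤n) (lt' lt ne))
      where
      lt' : suc u < 3 + L → suc u ≢ 2 + L → suc u < 2 + L
      lt' (s≤s le) ne' with NP.m≤n⇒m<n∨m≡n le
      ... | inj₁ r = r
      ... | inj₂ r = ⊥-elim (ne' r)
    hNC< (suc u) (suc u') (s≤s lt) (s≤s lt') nca with NP.m≤n⇒m<n∨m≡n lt
    ... | inj₁ far = proj₂ (vertexAt-far s1 p ip u u' far lt')
    ... | inj₂ refl = ⊥-elim (nca (inj₁ refl))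
    hNC : ∀ t t' → t < 4 + L → t' < 4 + L → t ≢ t' → ¬ CycAdjℕ L t t' → ¬ E (h t) (h t')
    hNC t t' lt lt' ne nca with NP.<-cmp t t'
    ... | tri< a _ _ = hNC< t t' a lt' nca
    ... | tri≈ _ b _ = ⊥-elim (ne b)
    ... | tri> _ _ c = λ e → hNC< t' t c lt (λ z → nca (CycAdjℕ-sym L t' t z)) (Esym e)
    inj : ∀ a b → h (toℕ a) ≡ h (toℕ b) → a ≡ b
    inj a b e = FP.toℕ-injective (hInj (toℕ a) (toℕ b) (FP.toℕ<n a) (FP.toℕ<n b) e)
    adj : ∀ a b → CycAdj L a b → E (h (toℕ a)) (h (toℕ b))
    adj a b c = hAdj (toℕ a) (toℕ b) (FP.toℕ<n a) (FP.toℕ<n b) c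

    res : ⊥
    res with ch L (λ a → h (toℕ a)) inj adj
    ... | a , b , ne , nca , e = hNC (toℕ a) (toℕ b) (FP.toℕ<n a) (FP.toℕ<n b) (λ z → ne (FP.toℕ-injective z)) nca e

  chordal⇒no-detour : Chordal E → ∀ x s1 l → InducedPath (s1 ∷ l) → E x s1 → E x (endpoint s1 l) → ¬ E s1 (endpoint s1 l) → s1 ≢ endpoint s1 l →
    (∀ t → 0 < t → t < length l → (x ≢ vertexAt s1 (s1 ∷ l) t) × ¬ E x (vertexAt s1 (s1 ∷ l) t)) → ⊥
  chordal⇒no-detour ch x s1 [] ip e1 e2 ne12 d12 int = d12 refl
  chordal⇒no-detour ch x s1 (q ∷ []) (e , _) e1 e2 ne12 d12 int = ne12 e
  chordal⇒no-detour ch x s1 (q1 ∷ q2 ∷ l'') ip e1 e2 ne12 d12 int = ClosedDetour.res ch x s1 q1 q2 l'' ip e1 e2 ne12 d12 int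

module Dirac {n : ℕ} (E : Fin n → Fin n → Set) (E? : ∀ x y → Dec (E x y))
         (Esym : ∀ {x y} → E x y → E y x) (Eirr : ∀ {x} → E x x → ⊥) (ch : Chordal E) where
  open Paths E E? Esym Eirr

  SimplicialIn : Subset n → Fin n → Set
  SimplicialIn V s = ∀ x y → lookup V x ≡ true → lookup V y ≡ true → E s x → E s y → x ≢ y → E x y

  CliqueIn : Subset n → Set
  CliqueIn Q = ∀ x y → lookup Q x ≡ true → lookup Q y ≡ true → x ≢ y → E x y

  module Component (W : Subset n) (y : Fin n) (Wy : lookup W y ≡ true) where
    adjacent? : (Q : Subset n) → (z : Fin n) → Dec (∃[ b ] (lookup Q b ≡ true × E z b))
    adjacent? Q z = FP.any? (λ b → (lookup Q b B.≟ true) ×-dec E? z b)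

    grow : Subset n → Subset n
    grow R = tabulate (λ z → lookup R z ∨ (lookup W z ∧ does (adjacent? R z)))

    R : ℕ → Subset n
    R zero = ⁅ y ⁆
    R (suc k) = grow (R k)

    grow-⊇ : ∀ Q z → lookup Q z ≡ true → lookup (grow Q) z ≡ true
    grow-⊇ Q z e = trans (lookup-tabulate _ z) (cong (_∨ (lookup W z ∧ does (adjacent? Q z))) e)

    grow-adjacent : ∀ Q z b → lookup W z ≡ true → lookup Q b ≡ true → E z b → lookup (grow Q) z ≡ true
    grow-adjacent Q z b wz qb e = trans (lookup-tabulate _ z) (trans (cong (λ u → lookup Q z ∨ (lookup W z ∧ u)) (dec-true (adjacent? Q z) (b , qb , e)))
                                  (trans (cong (λ u → lookup Q z ∨ (u ∧ true)) wz) (BP.∨-zeroʳ _)))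

    grow-elim : ∀ Q z → lookup (grow Q) z ≡ true → lookup Q z ≡ true ⊎ (lookup W z ≡ true × ∃[ b ] (lookup Q b ≡ true × E z b))
    grow-elim Q z e with ∨≡true⇒ _ _ (trans (sym (lookup-tabulate (λ z → lookup Q z ∨ (lookup W z ∧ does (adjacent? Q z))) z)) e)
    ... | inj₁ q = inj₁ q
    ... | inj₂ w with adjacent? Q z
    ...   | yes wit = inj₂ (∧-trueˡ _ _ w , wit)
    ...   | no _ = ⊥-elim (true≢false (trans (sym w) (BP.∧-zeroʳ _)))

    ball-centre : ∀ k → lookup (R k) y ≡ true
    ball-centre zero = lookup-⁅⁆-self y
    ball-centre (suc k) = grow-⊇ (R k) y (ball-centre k)

    ball⊆W : ∀ k z → lookup (R k) z ≡ true → lookup W z ≡ true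
    ball⊆W zero z e = subst (λ u → lookup W u ≡ true) (eqᵇ⇒≡ {i = y} {z} (trans (sym (lookup-⁅⁆ y z)) e)) Wy
    ball⊆W (suc k) z e with grow-elim (R k) z e
    ... | inj₁ q = ball⊆W k z q
    ... | inj₂ (w , _) = w

    ball-walk : ∀ k z → lookup (R k) z ≡ true → Walk (λ w → lookup (R k) w ≡ true) z y
    ball-walk zero z e with eqᵇ⇒≡ {i = y} {z} (trans (sym (lookup-⁅⁆ y z)) e)
    ... | refl = walk-[] e
    ball-walk (suc k) z e with grow-elim (R k) z e
    ... | inj₁ q = walk-map (λ w → grow-⊇ (R k) w) (ball-walk k z q)
    ... | inj₂ (wz , b , rb , eb) = walk-∷ e eb (walk-map (λ w → grow-⊇ (R k) w) (ball-walk k b rb))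

    GrowthClosed : Subset n → Set
    GrowthClosed Q = ∀ z → lookup (grow Q) z ≡ true → lookup Q z ≡ true

    grow-fixed : ∀ Q → GrowthClosed Q → grow Q ≡ Q
    grow-fixed Q cl = subset-ext λ z → go z (true-or-false (lookup Q z))
      where
      go : ∀ z → lookup Q z ≡ true ⊎ lookup Q z ≡ false → lookup (grow Q) z ≡ lookup Q z
      go z (inj₁ t) = trans (grow-⊇ Q z t) (sym t)
      go z (inj₂ f) with true-or-false (lookup (grow Q) z)
      ... | inj₁ t = ⊥-elim (true≢false (trans (sym (cl z t)) f))
      ... | inj₂ f' = trans f' (sym f)

    closed-or-large : ∀ k → GrowthClosed (R k) ⊎ suc k ≤ ∣ R k ∣
    closed-or-large zero = inj₂ (NP.≤-reflexive (sym (SP.∣⁅x⁆∣≡1 y)))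
    closed-or-large (suc k) with closed-or-large k
    ... | inj₁ cl = inj₁ (subst GrowthClosed (sym (grow-fixed (R k) cl)) cl)
    ... | inj₂ big with FP.all? (λ z → (lookup (grow (R k)) z B.≟ true) →-dec (lookup (R k) z B.≟ true))
    ...   | yes cl = inj₁ (subst GrowthClosed (sym (grow-fixed (R k) cl)) cl)
    ...   | no ncl with FP.¬∀⟶∃¬ n _ (λ z → (lookup (grow (R k)) z B.≟ true) →-dec (lookup (R k) z B.≟ true)) ncl
    ...     | z , nz = inj₂ (NP.<-≤-trans (s≤s big) (SP.p⊂q⇒∣p∣<∣q∣ sub))
      where
      st : lookup (grow (R k)) z ≡ true
      st with true-or-false (lookup (grow (R k)) z)
      ... | inj₁ t = t
      ... | inj₂ f = ⊥-elim (nz (λ t → ⊥-elim (true≢false (trans (sym t) f))))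
      sub : R k S.⊂ grow (R k)
      sub = lookup⇒⊆ (λ w e → grow-⊇ (R k) w e) , z , lookup⇒∈ st , λ zi → nz (λ _ → ∈⇒lookup zi)

    B : Subset n
    B = R n

    component-closed : GrowthClosed B
    component-closed with closed-or-large n
    ... | inj₁ cl = cl
    ... | inj₂ big = ⊥-elim (NP.<⇒≱ big (SP.∣p∣≤n (R n)))

    component-absorbs : ∀ b z → lookup B b ≡ true → lookup W z ≡ true → E z b → lookup B z ≡ true
    component-absorbs b z bb wz e = component-closed z (grow-adjacent B z b wz bb e)

  SimplicialOutside : ℕ → Set
  SimplicialOutside k = ∀ (V Q : Subset n) → ∣ V ∣ ≤ k → (∀ z → lookup Q z ≡ true → lookup V z ≡ true) → CliqueIn Q →
             ∀ v → lookup V v ≡ true → lookup Q v ≡ false → ∃[ s ] (lookup V s ≡ true × lookup Q s ≡ false × SimplicialIn V s)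

  -- With B the component of y in V ∖ N[x] and Sep its neighbours in V, Sep ⊆ N(x) is a clique: a
  -- non-edge in Sep would close a chordless cycle through B and x. Recursing into B ∪ Sep with the
  -- clique Sep yields a vertex of B whose neighbourhood lies in B ∪ Sep, hence is simplicial in V.
  module NonAdjacentPair (k : ℕ) (ih : SimplicialOutside k) (V Q : Subset n) (le : ∣ V ∣ ≤ suc k) (QV : ∀ z → lookup Q z ≡ true → lookup V z ≡ true)
              (cq : CliqueIn Q) (x y : Fin n) (vx : lookup V x ≡ true) (vy : lookup V y ≡ true) (x≢y : x ≢ y) (nxy : ¬ E x y)
              (Qx : ∀ q → lookup Q q ≡ true → q ≡ x ⊎ E x q) where
    W-member : Fin n → Bool
    W-member z = lookup V z ∧ (not (eqᵇ x z) ∧ not (does (E? x z)))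
    W : Subset n
    W = tabulate W-member
    W-elim : ∀ z → lookup W z ≡ true → lookup V z ≡ true × x ≢ z × ¬ E x z
    W-elim z e with lookup V z | x FP.≟ z | E? x z | trans (sym (lookup-tabulate W-member z)) e
    ... | true | no ne | no nE | _ = refl , ne , nE
    ... | true | yes _ | _ | ()
    ... | true | no _ | yes _ | ()
    ... | false | _ | _ | ()
    W-intro : ∀ z → lookup V z ≡ true → x ≢ z → ¬ E x z → lookup W z ≡ true
    W-intro z vz ne nE = trans (lookup-tabulate W-member z) (trans (cong₂ (λ a b → a ∧ (not b ∧ not (does (E? x z)))) vz (eqᵇ-≢ ne))
                            (cong (λ b → not b) (dec-false (E? x z) nE)))
    Wy : lookup W y ≡ true
    Wy = W-intro y vy x≢y nxy
    open Component W y Wy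

    sepᵇ : Fin n → Bool
    sepᵇ z = lookup V z ∧ (not (lookup B z) ∧ does (adjacent? B z))
    Sep : Subset n
    Sep = tabulate sepᵇ

    Sep-elim : ∀ z → lookup Sep z ≡ true → lookup V z ≡ true × lookup B z ≡ false × ∃[ b ] (lookup B b ≡ true × E z b)
    Sep-elim z e with lookup V z | true-or-false (lookup B z) | adjacent? B z | trans (sym (lookup-tabulate sepᵇ z)) e
    ... | true | inj₂ bz | yes w | _ = refl , bz , w
    ... | true | inj₁ bz | _ | e' = ⊥-elim (true≢false (trans (sym e') (cong (λ u → not u ∧ _) bz)))
    ... | true | inj₂ bz | no _ | e' = ⊥-elim (true≢false (trans (sym e') (BP.∧-zeroʳ _)))
    ... | false | _ | _ | ()

    Sep-intro : ∀ z b → lookup V z ≡ true → lookup B z ≡ false → lookup B b ≡ true → E z b → lookup Sep z ≡ true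
    Sep-intro z b vz bz bb e = trans (lookup-tabulate sepᵇ z) (trans (cong₂ (λ u w → u ∧ (not w ∧ does (adjacent? B z))) vz bz) (dec-true (adjacent? B z) (b , bb , e)))

    B⊆W : ∀ z → lookup B z ≡ true → lookup W z ≡ true
    B⊆W = ball⊆W n

    Sep⊆N[x] : ∀ z → lookup Sep z ≡ true → E x z
    Sep⊆N[x] z sz with Sep-elim z sz
    ... | vz , bz , b , bb , ezb with E? x z
    ...   | yes e = e
    ...   | no nE with x FP.≟ z
    ...     | yes refl = ⊥-elim (proj₂ (proj₂ (W-elim b (B⊆W b bb))) ezb)
    ...     | no ne = ⊥-elim (true≢false (trans (sym (component-absorbs b z bb (W-intro z vz ne nE) ezb)) bz))

    OnDetour : Fin n → Fin n → Fin n → Set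
    OnDetour s1 s2 w = lookup B w ≡ true ⊎ (w ≡ s1 ⊎ w ≡ s2)

    Sep-clique : CliqueIn Sep
    Sep-clique s1 s2 q1 q2 ne with E? s1 s2
    ... | yes e = e
    ... | no n12 with Sep-elim s1 q1 | Sep-elim s2 q2
    ...   | _ , _ , b1 , bb1 , e1b | _ , _ , b2 , bb2 , e2b with induced-path wfull
      where
      wB : Walk (λ w → lookup B w ≡ true) b1 b2
      wB = walk-++ (ball-walk n b1 bb1) (walk-reverse (ball-walk n b2 bb2))
      wfull : Walk (OnDetour s1 s2) s1 s2
      wfull = walk-∷ (inj₂ (inj₁ refl)) e1b (walk-++ (walk-map (λ w e → inj₁ e) wB) (walk-∷ (inj₁ bb2) (Esym e2b) (walk-[] (inj₂ (inj₂ refl)))))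
    ...     | l , ip , lst , ap = ⊥-elim (chordal⇒no-detour ch x s1 l ip (Sep⊆N[x] s1 q1) (subst (E x) (sym lst) (Sep⊆N[x] s2 q2))
                 (λ e → n12 (subst (E s1) lst e)) (λ e → ne (trans e lst)) int)
      where
      int : ∀ t → 0 < t → t < length l → (x ≢ vertexAt s1 (s1 ∷ l) t) × ¬ E x (vertexAt s1 (s1 ∷ l) t)
      int t pos lt with vertexAt-All s1 (s1 ∷ l) t ap (NP.m≤n⇒m≤1+n lt)
      ... | inj₁ bw = let (_ , a , b) = W-elim _ (B⊆W _ bw) in a , b
      ... | inj₂ (inj₁ w≡s1) = ⊥-elim (vertexAt-injective s1 (s1 ∷ l) ip 0 t pos (NP.m≤n⇒m≤1+n lt) (sym w≡s1))
      ... | inj₂ (inj₂ w≡s2) = ⊥-elim (vertexAt-injective s1 (s1 ∷ l) ip t (length l) lt NP.≤-refl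
                                  (trans w≡s2 (trans (sym lst) (sym (vertexAt-endpoint s1 s1 l)))))

    B∪Sep : Subset n
    B∪Sep = B ∪ Sep

    B∪Sep-elim : ∀ z → lookup B∪Sep z ≡ true → lookup B z ≡ true ⊎ lookup Sep z ≡ true
    B∪Sep-elim z e = ∨≡true⇒ _ _ (trans (sym (lookup-∪ B Sep z)) e)

    B∪Sep⊆V : ∀ z → lookup B∪Sep z ≡ true → lookup V z ≡ true
    B∪Sep⊆V z e with B∪Sep-elim z e
    ... | inj₁ b = proj₁ (W-elim z (B⊆W z b))
    ... | inj₂ s = proj₁ (Sep-elim z s)

    x∉B∪Sep : lookup B∪Sep x ≡ true → ⊥
    x∉B∪Sep e with B∪Sep-elim x e
    ... | inj₁ b = proj₁ (proj₂ (W-elim x (B⊆W x b))) refl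
    ... | inj₂ s = Eirr (Sep⊆N[x] x s)

    ∣B∪Sep∣≤k : ∣ B∪Sep ∣ ≤ k
    ∣B∪Sep∣≤k = NP.≤-pred (NP.<-≤-trans (SP.p⊂q⇒∣p∣<∣q∣ {p = B∪Sep} {q = V} (lookup⇒⊆ B∪Sep⊆V , x , lookup⇒∈ vx , λ xi → x∉B∪Sep (∈⇒lookup xi))) le)

    y∉Sep : lookup Sep y ≡ false
    y∉Sep with true-or-false (lookup Sep y)
    ... | inj₁ t = ⊥-elim (true≢false (trans (sym (ball-centre n)) (proj₁ (proj₂ (Sep-elim y t)))))
    ... | inj₂ f = f

    simplicial-in-B : ∃[ s ] (lookup V s ≡ true × lookup Q s ≡ false × SimplicialIn V s)
    simplicial-in-B with ih B∪Sep Sep ∣B∪Sep∣≤k (λ z e → trans (lookup-∪ B Sep z) (trans (cong (lookup B z ∨_) e) (BP.∨-zeroʳ _))) Sep-clique y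
                   (trans (lookup-∪ B Sep y) (cong (_∨ lookup Sep y) (ball-centre n))) y∉Sep
    ... | s , v''s , s's , simp'' = s , B∪Sep⊆V s v''s , qs , simp
      where
      bs : lookup B s ≡ true
      bs with B∪Sep-elim s v''s
      ... | inj₁ b = b
      ... | inj₂ t = ⊥-elim (true≢false (trans (sym t) s's))
      ws : lookup V s ≡ true × x ≢ s × ¬ E x s
      ws = W-elim s (B⊆W s bs)
      qs : lookup Q s ≡ false
      qs with true-or-false (lookup Q s)
      ... | inj₂ f = f
      ... | inj₁ t with Qx s t
      ...   | inj₁ refl = ⊥-elim (proj₁ (proj₂ ws) refl)
      ...   | inj₂ e = ⊥-elim (proj₂ (proj₂ ws) e)
      neighbour∈B∪Sep : ∀ z → lookup V z ≡ true → E s z → lookup B∪Sep z ≡ true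
      neighbour∈B∪Sep z vz e with true-or-false (lookup B z)
      ... | inj₁ b = trans (lookup-∪ B Sep z) (cong (_∨ lookup Sep z) b)
      ... | inj₂ b = trans (lookup-∪ B Sep z) (trans (cong (lookup B z ∨_) (Sep-intro z s vz b bs (Esym e))) (BP.∨-zeroʳ _))
      simp : SimplicialIn V s
      simp x' y' vx' vy' e1 e2 ne = simp'' x' y' (neighbour∈B∪Sep x' vx' e1) (neighbour∈B∪Sep y' vy' e2) e1 e2 ne

  universal-vertex : ∀ k → SimplicialOutside k → ∀ (V Q : Subset n) → ∣ V ∣ ≤ suc k →
    (∀ z → lookup Q z ≡ true → lookup V z ≡ true) → CliqueIn Q → ∀ v → lookup V v ≡ true → lookup Q v ≡ false →
    (∀ w → lookup V w ≡ true → w ≢ v → E v w) → ∃[ s ] (lookup V s ≡ true × lookup Q s ≡ false × SimplicialIn V s)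
  universal-vertex k ih V Q le QV cq v vv qv univ with FP.any? (λ u → (lookup V u B.≟ true) ×-dec ((lookup Q u B.≟ false) ×-dec ¬? (u FP.≟ v)))
  ... | yes (u , vu , qu , u≢v) with ih (V - v) Q (NP.≤-pred (NP.<-≤-trans (SP.x∈p⇒∣p-x∣<∣p∣ (lookup⇒∈ {p = V} vv)) le))
                                    (λ z qz → trans (lookup-minus V v z) (trans (cong₂ (λ a b → a ∧ not b) (QV z qz) (eqᵇ-≢ (λ e → true≢false (trans (sym qz) (trans (cong (lookup Q) (sym e)) qv))))) refl))
                                    cq u (trans (lookup-minus V v u) (trans (cong₂ (λ a b → a ∧ not b) vu (eqᵇ-≢ (λ e → u≢v (sym e)))) refl)) qu
  ...   | s , v's , qs , simp' = s , ∧-trueˡ _ _ (trans (sym (lookup-minus V v s)) v's) , qs , simp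
    where
    inV' : ∀ z → lookup V z ≡ true → z ≢ v → lookup (V - v) z ≡ true
    inV' z vz ne = trans (lookup-minus V v z) (trans (cong₂ (λ a b → a ∧ not b) vz (eqᵇ-≢ (λ e → ne (sym e)))) refl)
    simp : SimplicialIn V s
    simp x' y' vx' vy' e1 e2 ne with x' FP.≟ v | y' FP.≟ v
    ... | yes refl | _ = univ y' vy' (λ e → ne (sym e))
    ... | no _ | yes refl = Esym (univ x' vx' ne)
    ... | no nx | no ny = simp' x' y' (inV' x' vx' nx) (inV' y' vy' ny) e1 e2 ne
  universal-vertex k ih V Q le QV cq v vv qv univ | no ¬U = v , vv , qv , simp
    where
    inQ : ∀ z → lookup V z ≡ true → z ≢ v → lookup Q z ≡ true
    inQ z vz ne with true-or-false (lookup Q z)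
    ... | inj₁ t = t
    ... | inj₂ f = ⊥-elim (¬U (z , vz , f , ne))
    simp : SimplicialIn V v
    simp x' y' vx' vy' e1 e2 ne = cq x' y' (inQ x' vx' (λ e → Eirr (subst (E v) e e1))) (inQ y' vy' (λ e → Eirr (subst (E v) e e2))) ne

  -- A non-neighbour of v in Q, or failing that a non-neighbour of v in V, supplies the non-adjacent pair.
  dirac : ∀ k → SimplicialOutside k
  dirac zero V Q le QV cq v vv qv = ⊥-elim (NP.<⇒≱ (SP.x∈p⇒∣p-x∣<∣p∣ (lookup⇒∈ {p = V} vv)) (NP.≤-trans le z≤n))
  dirac (suc k) V Q le QV cq v vv qv with FP.any? (λ w → (lookup Q w B.≟ true) ×-dec ¬? (E? v w))
  ... | yes (w , qw , nE) = NonAdjacentPair.simplicial-in-B k (dirac k) V Q le QV cq w v (QV w qw) vv (λ e → true≢false (trans (sym qw) (trans (cong (lookup Q) e) qv)))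
                               (λ e → nE (Esym e)) Q⊆N[w]
    where
    Q⊆N[w] : ∀ q → lookup Q q ≡ true → q ≡ w ⊎ E w q
    Q⊆N[w] q qq with q FP.≟ w
    ... | yes e = inj₁ e
    ... | no ne = inj₂ (cq w q qw qq (λ e → ne (sym e)))
  ... | no ¬A with FP.any? (λ w → (lookup V w B.≟ true) ×-dec (¬? (w FP.≟ v) ×-dec ¬? (E? v w)))
  ...   | yes (w , vw , w≢v , nE) = NonAdjacentPair.simplicial-in-B k (dirac k) V Q le QV cq v w vv vw (λ e → w≢v (sym e)) nE (λ q qq → inj₂ (Q⊆N[v] q qq))
    where
    Q⊆N[v] : ∀ q → lookup Q q ≡ true → E v q
    Q⊆N[v] q qq with E? v q
    ... | yes e = e
    ... | no ne = ⊥-elim (¬A (q , qq , ne))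
  ...   | no ¬B = universal-vertex k (dirac k) V Q le QV cq v vv qv universal
    where
    universal : ∀ w → lookup V w ≡ true → w ≢ v → E v w
    universal w vw ne with E? v w
    ... | yes e = e
    ... | no nE = ⊥-elim (¬B (w , vw , ne , nE))

-- Piercing preserves degree two, chordality and the clique bound

module Deletion {n : ℕ} (D : Code n) (i : Fin n) where
  deleted : Code n
  deleted = delete i D

  ∈-deleted : ∀ e → e ∈ deleted → ∃[ c ] (c ∈ D × e ≡ c - i)
  ∈-deleted e e∈ = ∈-map⁻ (λ c → c - i) e∈

  Realized-deleted⁻ : ∀ j k a b → Realized deleted j k a b → i ≢ j → i ≢ k → Realized D j k a b
  Realized-deleted⁻ j k a b (e , e∈ , ej , ek) nj nk with ∈-deleted e e∈
  ... | c , c∈ , refl = c , c∈ , trans (sym (lookup-minus-other c i j nj)) ej , trans (sym (lookup-minus-other c i k nk)) ek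

  Realized-deleted⁺ : ∀ j k a b → Realized D j k a b → i ≢ j → i ≢ k → Realized deleted j k a b
  Realized-deleted⁺ j k a b (c , c∈ , cj , ck) nj nk = c - i , ∈-map⁺ (λ c → c - i) c∈ , trans (lookup-minus-other c i j nj) cj , trans (lookup-minus-other c i k nk) ck

  Realized-deleted-true : ∀ j k b → Realized deleted j k true b → i ≢ j
  Realized-deleted-true j k b (e , e∈ , ej , _) refl with ∈-deleted e e∈
  ... | c , _ , refl = true≢false (trans (sym ej) (lookup-minus-self c i))

  Crossing-deleted⁻ : ∀ j k → Crossing deleted j k → Crossing D j k × i ≢ j × i ≢ k
  Crossing-deleted⁻ j k (ne , r11 , r10 , r01) = (ne , Realized-deleted⁻ j k true true r11 nj nk , Realized-deleted⁻ j k true false r10 nj nk , Realized-deleted⁻ j k false true r01 nj nk) , nj , nk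
    where
    nj : i ≢ j
    nj = Realized-deleted-true j k true r11
    nk : i ≢ k
    nk e = Realized-deleted-true k j true (let (c , c∈ , a , b) = r11 in c , c∈ , b , a) e

  Crossing-deleted⁺ : ∀ j k → Crossing D j k → i ≢ j → i ≢ k → Crossing deleted j k
  Crossing-deleted⁺ j k (ne , r11 , r10 , r01) nj nk = ne , Realized-deleted⁺ j k true true r11 nj nk , Realized-deleted⁺ j k true false r10 nj nk , Realized-deleted⁺ j k false true r01 nj nk

module PiercingStep {n : ℕ} (D : Code n) (i : Fin n) (σ τ : Subset n) (st : σ ⊆ τ)
  (pc : ∀ γ → (γ ∈ D) ⇔ ((γ ∈ delete i D) ⊎ InInterval (σ ∪ ⁅ i ⁆) (τ ∪ ⁅ i ⁆) γ)) where

  open Deletion D i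

  pierced-codeword : ∀ d → d ∈ D → lookup d i ≡ true → (∀ x → lookup σ x ≡ true → lookup d x ≡ true) × (∀ x → lookup d x ≡ true → lookup τ x ≡ true ⊎ x ≡ i)
  pierced-codeword d d∈ di with to (pc d) d∈
  ... | inj₁ d∈' with ∈-deleted d d∈'
  ...   | c , _ , refl = ⊥-elim (true≢false (trans (sym di) (lookup-minus-self c i)))
  pierced-codeword d d∈ di | inj₂ (lo , hi) = (λ x sx → ⊆⇒lookup lo x (trans (lookup-∪ σ ⁅ i ⁆ x) (cong (_∨ lookup ⁅ i ⁆ x) sx))) ,
     (λ x dx → Data.Sum.map (λ e → e) (λ e → sym (eqᵇ⇒≡ {i = i} {x} (trans (sym (lookup-⁅⁆ i x)) e))) (∨≡true⇒ _ _ (trans (sym (lookup-∪ τ ⁅ i ⁆ x)) (⊆⇒lookup hi x dx))))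

  interval-codeword : ∀ γ → lookup γ i ≡ true → (∀ x → lookup σ x ≡ true → lookup γ x ≡ true) → (∀ x → lookup γ x ≡ true → lookup τ x ≡ true ⊎ x ≡ i) → γ ∈ D
  interval-codeword γ gi lo hi = from (pc γ) (inj₂ (lookup⇒⊆ lo' , lookup⇒⊆ hi'))
    where
    lo' : ∀ x → lookup (σ ∪ ⁅ i ⁆) x ≡ true → lookup γ x ≡ true
    lo' x e with ∨≡true⇒ _ _ (trans (sym (lookup-∪ σ ⁅ i ⁆ x)) e)
    ... | inj₁ s = lo x s
    ... | inj₂ s with eqᵇ⇒≡ {i = i} {x} (trans (sym (lookup-⁅⁆ i x)) s)
    ...   | refl = gi
    hi' : ∀ x → lookup γ x ≡ true → lookup (τ ∪ ⁅ i ⁆) x ≡ true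
    hi' x e with hi x e
    ... | inj₁ t = trans (lookup-∪ τ ⁅ i ⁆ x) (cong (_∨ lookup ⁅ i ⁆ x) t)
    ... | inj₂ refl = trans (lookup-∪ τ ⁅ i ⁆ i) (trans (cong (lookup τ i ∨_) (lookup-⁅⁆-self i)) (BP.∨-zeroʳ _))

  minus-pierced-codeword : ∀ d → d ∈ D → (d - i) ∈ D
  minus-pierced-codeword d d∈ = from (pc (d - i)) (inj₁ (∈-map⁺ (λ c → c - i) d∈))

  neighbour∈τ─σ : ∀ x → Crossing D i x → lookup τ x ≡ true × lookup σ x ≡ false
  neighbour∈τ─σ x (ne , (c , c∈ , ci , cx) , (d , d∈ , di , dx) , _) =
    Data.Sum.[ (λ t → t) , (λ e → ⊥-elim (ne (sym e))) ] (proj₂ (pierced-codeword c c∈ ci) x cx) ,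
    go (true-or-false (lookup σ x))
    where
    go : lookup σ x ≡ true ⊎ lookup σ x ≡ false → lookup σ x ≡ false
    go (inj₁ s) = ⊥-elim (true≢false (trans (sym (proj₁ (pierced-codeword d d∈ di) x s)) dx))
    go (inj₂ f) = f

  fill-codeword : ∀ (g : Fin n → Bool) → (∀ z → g z ≡ true → lookup τ z ≡ true) → tabulate (λ z → (lookup σ z ∨ g z) ∨ eqᵇ i z) ∈ D
  fill-codeword g hg = interval-codeword γ gi lo hi
    where
    γ : Subset n
    γ = tabulate (λ z → (lookup σ z ∨ g z) ∨ eqᵇ i z)
    gi : lookup γ i ≡ true
    gi = trans (lookup-tabulate _ i) (trans (cong ((lookup σ i ∨ g i) ∨_) (eqᵇ-refl i)) (BP.∨-zeroʳ _))
    lo : ∀ x → lookup σ x ≡ true → lookup γ x ≡ true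
    lo x s = trans (lookup-tabulate _ x) (cong (λ z → (z ∨ g x) ∨ eqᵇ i x) s)
    hi : ∀ x → lookup γ x ≡ true → lookup τ x ≡ true ⊎ x ≡ i
    hi x e with ∨≡true⇒ _ _ (trans (sym (lookup-tabulate _ x)) e)
    ... | inj₂ q = inj₂ (sym (eqᵇ⇒≡ {i = i} {x} q))
    ... | inj₁ q with ∨≡true⇒ _ _ q
    ...   | inj₁ s = inj₁ (⊆⇒lookup st x s)
    ...   | inj₂ s = inj₁ (hg x s)

  neighbours-cross : ∀ x y → Crossing D i x → Crossing D i y → x ≢ y → Crossing D x y
  neighbours-cross x y ex ey ne = ne , r11 , r10 , r01
    where
    nx : lookup τ x ≡ true × lookup σ x ≡ false
    nx = neighbour∈τ─σ x ex
    ny : lookup τ y ≡ true × lookup σ y ≡ false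
    ny = neighbour∈τ─σ y ey
    ix : i ≢ x
    ix = proj₁ ex
    iy : i ≢ y
    iy = proj₁ ey
    tab-at : ∀ (g : Fin n → Bool) z → lookup (tabulate (λ z → (lookup σ z ∨ g z) ∨ eqᵇ i z)) z ≡ (lookup σ z ∨ g z) ∨ eqᵇ i z
    tab-at g z = lookup-tabulate _ z
    r11 : Realized D x y true true
    r11 = _ , fill-codeword (λ z → eqᵇ x z ∨ eqᵇ y z)
      (λ z e → Data.Sum.[ (λ q → subst (λ w → lookup τ w ≡ true) (eqᵇ⇒≡ {i = x} {z} q) (proj₁ nx)) , (λ q → subst (λ w → lookup τ w ≡ true) (eqᵇ⇒≡ {i = y} {z} q) (proj₁ ny)) ] (∨≡true⇒ _ _ e)) ,
      trans (tab-at _ x) (trans (cong (λ w → (lookup σ x ∨ (w ∨ eqᵇ y x)) ∨ eqᵇ i x) (eqᵇ-refl x)) (trans (cong (_∨ eqᵇ i x) (BP.∨-zeroʳ (lookup σ x))) refl)) ,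
      trans (tab-at _ y) (trans (cong (λ w → (lookup σ y ∨ (eqᵇ x y ∨ w)) ∨ eqᵇ i y) (eqᵇ-refl y)) (trans (cong (λ w → (lookup σ y ∨ w) ∨ eqᵇ i y) (BP.∨-zeroʳ (eqᵇ x y))) (cong (_∨ eqᵇ i y) (BP.∨-zeroʳ (lookup σ y)))))
    r10 : Realized D x y true false
    r10 = _ , fill-codeword (λ z → eqᵇ x z) (λ z q → subst (λ w → lookup τ w ≡ true) (eqᵇ⇒≡ {i = x} {z} q) (proj₁ nx)) ,
      trans (tab-at _ x) (trans (cong (λ w → (lookup σ x ∨ w) ∨ eqᵇ i x) (eqᵇ-refl x)) (cong (_∨ eqᵇ i x) (BP.∨-zeroʳ (lookup σ x)))) ,
      trans (tab-at _ y) (trans (cong₂ (λ u v → (u ∨ eqᵇ x y) ∨ v) (proj₂ ny) (eqᵇ-≢ iy)) (trans (cong (_∨ false) (eqᵇ-≢ ne)) refl))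
    r01 : Realized D x y false true
    r01 = _ , fill-codeword (λ z → eqᵇ y z) (λ z q → subst (λ w → lookup τ w ≡ true) (eqᵇ⇒≡ {i = y} {z} q) (proj₁ ny)) ,
      trans (tab-at _ x) (trans (cong₂ (λ u v → (u ∨ eqᵇ y x) ∨ v) (proj₂ nx) (eqᵇ-≢ ix)) (trans (cong (_∨ false) (eqᵇ-≢ (λ e → ne (sym e)))) refl)) ,
      trans (tab-at _ y) (trans (cong (λ w → (lookup σ y ∨ w) ∨ eqᵇ i y) (eqᵇ-refl y)) (cong (_∨ eqᵇ i y) (BP.∨-zeroʳ (lookup σ y))))

  -- Codewords containing i contain σ and lie within τ ∪ {i}; a box forcing i that meets neither
  -- σ ∩ T nor P ∖ (τ ∪ {i}) therefore contains the codeword σ ∪ P.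
  obstruction-forcing-i : ∀ P T → BoxMisses D P T → lookup P i ≡ true → Obstruction D P T
  obstruction-forcing-i P T bx pi with FP.any? (λ k → (lookup σ k B.≟ true) ×-dec (lookup T k B.≟ true))
  ... | yes (k , sk , tk) = i , k , true , false , pi , tk , λ { (c , c∈ , ci , ck) → true≢false (trans (sym (proj₁ (pierced-codeword c c∈ ci) k sk)) ck) }
  ... | no ¬σ∩T with FP.any? (λ k → (¬? (i FP.≟ k)) ×-dec ((lookup P k B.≟ true) ×-dec (lookup τ k B.≟ false)))
  ...   | yes (k , ne , pk , tk) = i , k , true , true , pi , pk ,
            λ { (c , c∈ , ci , ck) → Data.Sum.[ (λ t → true≢false (trans (sym t) tk)) , (λ e → ne (sym e)) ] (proj₂ (pierced-codeword c c∈ ci) k ck) }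
  ...   | no ¬P─τ = ⊥-elim (true≢false (trans (sym γ-inBox) (bx γ γ∈D)))
    where
    γ : Subset n
    γ = tabulate (λ z → lookup σ z ∨ lookup P z)
    lookup-γ : ∀ z → lookup γ z ≡ lookup σ z ∨ lookup P z
    lookup-γ z = lookup-tabulate (λ z → lookup σ z ∨ lookup P z) z
    γ∈D : γ ∈ D
    γ∈D = interval-codeword γ (trans (lookup-γ i) (trans (cong (lookup σ i ∨_) pi) (BP.∨-zeroʳ _)))
           (λ x s → trans (lookup-γ x) (cong (_∨ lookup P x) s))
           (λ x e → within x (∨≡true⇒ _ _ (trans (sym (lookup-γ x)) e)))
      where
      within : ∀ x → lookup σ x ≡ true ⊎ lookup P x ≡ true → lookup τ x ≡ true ⊎ x ≡ i
      within x (inj₁ s) = inj₁ (⊆⇒lookup st x s)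
      within x (inj₂ p) with i FP.≟ x
      ... | yes e = inj₂ (sym e)
      ... | no ne with true-or-false (lookup τ x)
      ...   | inj₁ t = inj₁ t
      ...   | inj₂ f = ⊥-elim (¬P─τ (x , ne , p , f))
    γ-inBox : inBox P T γ ≡ true
    γ-inBox = literalHolds⇒inBox P T γ λ z → holds z (true-or-false (lookup P z)) (true-or-false (lookup T z))
      where
      holds : ∀ z → lookup P z ≡ true ⊎ lookup P z ≡ false → lookup T z ≡ true ⊎ lookup T z ≡ false →
              literalHolds (lookup P z) (lookup T z) (lookup γ z) ≡ true
      holds z (inj₁ p) _ rewrite p | lookup-γ z | p = BP.∨-zeroʳ _
      holds z (inj₂ p) (inj₁ t) with true-or-false (lookup σ z)
      ... | inj₁ s = ⊥-elim (¬σ∩T (z , s , t))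
      ... | inj₂ s rewrite p | t | lookup-γ z | s | p = refl
      holds z (inj₂ p) (inj₂ t) rewrite p | t = refl

  obstruction-avoiding-i : PairObstructed deleted → ∀ P T → Apart P T → BoxMisses D P T → lookup P i ≡ false → Obstruction D P T
  obstruction-avoiding-i obstructed P T dj bx pi
    with obstructed P (T - i) (Apart-mono {σ = P} {T} {P} {T - i} dj (λ x → x) (SP.p─q⊆p T ⁅ i ⁆)) misses
    where
    misses : BoxMisses deleted P (T - i)
    misses e e∈ with ∈-deleted e e∈
    ... | c , c∈ , refl with inBox P (T - i) (c - i) in eq
    ...   | false = refl
    ...   | true = ⊥-elim (true≢false (trans (sym (literalHolds⇒inBox P T (c - i) holds)) (bx (c - i) (minus-pierced-codeword c c∈))))
      where
      holds : ∀ z → literalHolds (lookup P z) (lookup T z) (lookup (c - i) z) ≡ true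
      holds z with i FP.≟ z
      ... | yes refl rewrite pi | lookup-minus-self c i with lookup T i
      ...   | true = refl
      ...   | false = refl
      holds z | no ne = subst (λ w → literalHolds (lookup P z) w (lookup (c - i) z) ≡ true) (lookup-minus-other T i z ne) (inBox⇒literalHolds P (T - i) (c - i) eq z)
  ... | j , k , a , b , lj , lk , nr = j , k , a , b , literal-lift j a lj , literal-lift k b lk ,
        λ r → nr (Realized-deleted⁺ j k a b r (≢i j a lj) (≢i k b lk))
    where
    ≢i : ∀ x a → HasLiteral P (T - i) x a → i ≢ x
    ≢i x true l refl = true≢false (trans (sym l) pi)
    ≢i x false l refl = true≢false (trans (sym l) (lookup-minus-self T i))
    literal-lift : ∀ x a → HasLiteral P (T - i) x a → HasLiteral P T x a
    literal-lift x true l = l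
    literal-lift x false l = ∧-trueˡ _ _ (trans (sym (lookup-minus T i x)) l)

  PairObstructed-lift : PairObstructed deleted → PairObstructed D
  PairObstructed-lift obstructed P T dj bx with true-or-false (lookup P i)
  ... | inj₁ pi = obstruction-forcing-i P T bx pi
  ... | inj₂ pi = obstruction-avoiding-i obstructed P T dj bx pi

  Chordal-lift : Chordal (Crossing deleted) → Chordal (Crossing D)
  Chordal-lift ch l v inj adj with FP.any? (λ a → v a FP.≟ i)
  ... | yes (a , va) with cycle-neighbours l a
  ...   | b , c , ab , ac , b≢c , nbc = b , c , b≢c , nbc ,
          neighbours-cross (v b) (v c) (subst (λ z → Crossing D z (v b)) va (adj a b ab)) (subst (λ z → Crossing D z (v c)) va (adj a c ac)) (λ e → b≢c (inj b c e))
  Chordal-lift ch l v inj adj | no nv with ch l v inj (λ a b c → Crossing-deleted⁺ (v a) (v b) (adj a b c) (λ e → nv (a , sym e)) (λ e → nv (b , sym e)))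
  ... | a , b , ne , nc , e = a , b , ne , nc , proj₁ (Crossing-deleted⁻ (v a) (v b) e)

  clique-bound-lift : ∀ k k' → k' ≤ k → ∣ τ ─ σ ∣ ≡ k' → (∀ K → IsClique (Crossing deleted) K → ∣ K ∣ ≤ suc k) → ∀ K → IsClique (Crossing D) K → ∣ K ∣ ≤ suc k
  clique-bound-lift k k' le card ih K cl with true-or-false (lookup K i)
  ... | inj₁ ki = NP.≤-trans (SP.p⊆q⇒∣p∣≤∣q∣ {p = K} {q = (τ ─ σ) ∪ ⁅ i ⁆} (lookup⇒⊆ sub)) (NP.≤-trans (∣p∪⁅i⁆∣≤ (τ ─ σ) i) (s≤s (subst (_≤ k) (sym card) le)))
    where
    sub : ∀ x → lookup K x ≡ true → lookup ((τ ─ σ) ∪ ⁅ i ⁆) x ≡ true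
    sub x kx with i FP.≟ x
    ... | yes refl = trans (lookup-∪ (τ ─ σ) ⁅ i ⁆ i) (trans (cong (lookup (τ ─ σ) i ∨_) (lookup-⁅⁆-self i)) (BP.∨-zeroʳ _))
    ... | no ne = trans (lookup-∪ (τ ─ σ) ⁅ i ⁆ x) (trans (cong (_∨ lookup ⁅ i ⁆ x) (trans (lookup-─ τ σ x) (cong₂ (λ u w → u ∧ not w) (proj₁ nb) (proj₂ nb)))) refl)
      where
      nb : lookup τ x ≡ true × lookup σ x ≡ false
      nb = neighbour∈τ─σ x (cl i x (lookup⇒∈ ki) (lookup⇒∈ kx) ne)
  ... | inj₂ ki = ih K (λ x y xk yk ne → Crossing-deleted⁺ x y (cl x y xk yk ne) (λ e → true≢false (trans (sym (∈⇒lookup (subst (S._∈ K) (sym e) xk))) ki))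
                                                        (λ e → true≢false (trans (sym (∈⇒lookup (subst (S._∈ K) (sym e) yk))) ki)))

PiercedInvariants : ∀ {n} → ℕ → Code n → Set
PiercedInvariants k D = PairObstructed D × Chordal (Crossing D) × (∀ K → IsClique (Crossing D) K → ∣ K ∣ ≤ suc k)

emptyCode-invariants : ∀ {n} k (D : Code n) → D ≐ emptyCode → PiercedInvariants k D
emptyCode-invariants {n} k D e = obstructed , chordal , cliques
  where
  only-∅ : ∀ c → c ∈ D → c ≡ S.⊥
  only-∅ c c∈ with to (e c) c∈
  ... | here eq = eq
  nothing-active : ∀ x y b → ¬ Realized D x y true b
  nothing-active x y b (c , c∈ , cx , _) = true≢false (trans (sym cx) (trans (cong (λ z → lookup z x) (only-∅ c c∈)) (lookup-⊥ x)))
  obstructed : PairObstructed D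
  obstructed P T dj bx with FP.any? (λ k → lookup P k B.≟ true)
  ... | yes (k , pk) = k , k , true , true , pk , pk , nothing-active k k true
  ... | no np = ⊥-elim (true≢false (trans (sym (literalHolds⇒inBox P T S.⊥ (λ z → ∅-holds z (true-or-false (lookup P z))))) (bx S.⊥ (from (e S.⊥) (here refl)))))
    where
    ∅-holds : ∀ z → lookup P z ≡ true ⊎ lookup P z ≡ false → literalHolds (lookup P z) (lookup T z) (lookup (S.⊥ {n}) z) ≡ true
    ∅-holds z (inj₁ p) = ⊥-elim (np (z , p))
    ∅-holds z (inj₂ p) rewrite p | lookup-⊥ {n} z with lookup T z
    ... | true = refl
    ... | false = refl
  chordal : Chordal (Crossing D)
  chordal l v inj adj = ⊥-elim (nothing-active (v zero) (v (suc zero)) true (proj₁ (proj₂ (adj zero (suc zero) (inj₁ refl)))))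
  cliques : ∀ K → IsClique (Crossing D) K → ∣ K ∣ ≤ suc k
  cliques K c = NP.≤-trans (edgeless⇒∣K∣≤1 K (λ x y kx ky ne → nothing-active x y true (proj₁ (proj₂ (c x y (lookup⇒∈ kx) (lookup⇒∈ ky) ne))))) (s≤s z≤n)

inductivelyPierced⇒invariants : ∀ {n} k (D : Code n) → KIndPierced k D → PiercedInvariants k D
inductivelyPierced⇒invariants k D (base e) = emptyCode-invariants k D e
inductivelyPierced⇒invariants k D (step i k′ k′≤k (σ , τ , σ⊆τ , _ , card , _ , pc) rest)
  with inductivelyPierced⇒invariants k (delete i D) rest
... | obstructed , chordal , cliques =
  PairObstructed-lift obstructed , Chordal-lift chordal , clique-bound-lift k k′ k′≤k card cliques
  where open PiercingStep D i σ τ σ⊆τ pc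

-- A minimal simplicial neuron is a piercing

module _ {n : ℕ} (D : Code n) where
  Active : Fin n → Set
  Active j = Realized D j j true true

  Crossing? : ∀ x y → Dec (Crossing D x y)
  Crossing? x y = ¬? (x FP.≟ y) ×-dec (Realized? D x y true true ×-dec (Realized? D x y true false ×-dec Realized? D x y false true))

  Realized-swap : ∀ {x y a b} → Realized D x y a b → Realized D y x b a
  Realized-swap (c , c∈ , p , q) = c , c∈ , q , p

  Crossing-sym : ∀ {x y} → Crossing D x y → Crossing D y x
  Crossing-sym (ne , r11 , r10 , r01) = (λ e → ne (sym e)) , Realized-swap r11 , Realized-swap r01 , Realized-swap r10

  Crossing-irrefl : ∀ {x} → Crossing D x x → ⊥
  Crossing-irrefl (ne , _) = ne refl

  Separated : Set
  Separated = ∀ j k → Active j → (∀ c → c ∈ D → lookup c j ≡ lookup c k) → j ≡ k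

  -- ¬ Realized D j i true false says Uⱼ ⊆ Uᵢ: every codeword containing j contains i.
  Minimal : Fin n → Set
  Minimal i = ∀ j → Active j → j ≢ i → Realized D j i true false

  IsSimplicial : Fin n → Set
  IsSimplicial i = ∀ x y → Crossing D i x → Crossing D i y → x ≢ y → Crossing D x y

  Realized⇒Active : ∀ {x y b} → Realized D x y true b → Active x
  Realized⇒Active (c , c∈ , p , _) = c , c∈ , p , p

  ⊆-field-trans : ∀ {x y z} → ¬ Realized D x y true false → ¬ Realized D y z true false → ¬ Realized D x z true false
  ⊆-field-trans {x} {y} {z} n1 n2 (c , c∈ , cx , cz) with true-or-false (lookup c y)
  ... | inj₁ cy = n2 (c , c∈ , cy , cz)
  ... | inj₂ cy = n1 (c , c∈ , cx , cy)

  module MinimalSimplicial (ch : Chordal (Crossing D)) (dist : Separated) where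
    open Dirac (Crossing D) Crossing? Crossing-sym Crossing-irrefl ch

    activeSet : Subset n
    activeSet = tabulate (λ j → does (Realized? D j j true true))

    activeSet⇒Active : ∀ j → lookup activeSet j ≡ true → Active j
    activeSet⇒Active j e = does-true⇒ (Realized? D j j true true) (trans (sym (lookup-tabulate (λ j → does (Realized? D j j true true)) j)) e)
    Active⇒activeSet : ∀ j → Active j → lookup activeSet j ≡ true
    Active⇒activeSet j a = trans (lookup-tabulate (λ j → does (Realized? D j j true true)) j) (dec-true (Realized? D j j true true) a)

    -- The active neurons m ≠ i with Uₘ ⊆ Uᵢ.
    below : Fin n → Subset n
    below i = tabulate (λ m → does (Realized? D m m true true) ∧ (not (eqᵇ i m) ∧ not (does (Realized? D m i true false))))

    below⇒ : ∀ i m → lookup (below i) m ≡ true → Active m × i ≢ m × ¬ Realized D m i true false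
    below⇒ i m e = does-true⇒ (Realized? D m m true true) (∧-trueˡ A (Bq ∧ Cq) e') , does-false⇒ (i FP.≟ m) (∧-trueˡ Bq Cq (∧-trueʳ A (Bq ∧ Cq) e')) ,
                   does-false⇒ (Realized? D m i true false) (∧-trueʳ Bq Cq (∧-trueʳ A (Bq ∧ Cq) e'))
      where
      A Bq Cq : Bool
      A = does (Realized? D m m true true)
      Bq = not (eqᵇ i m)
      Cq = not (does (Realized? D m i true false))
      e' : A ∧ (Bq ∧ Cq) ≡ true
      e' = trans (sym (lookup-tabulate (λ m → does (Realized? D m m true true) ∧ (not (eqᵇ i m) ∧ not (does (Realized? D m i true false)))) m)) e

    below⁺ : ∀ i m → Active m → i ≢ m → ¬ Realized D m i true false → lookup (below i) m ≡ true
    below⁺ i m a ne nr = trans (lookup-tabulate (λ m → does (Realized? D m m true true) ∧ (not (eqᵇ i m) ∧ not (does (Realized? D m i true false)))) m)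
       (trans (cong₂ (λ u w → u ∧ (not w ∧ not (does (Realized? D m i true false)))) (dec-true (Realized? D m m true true) a) (eqᵇ-≢ ne))
         (cong not (dec-false (Realized? D m i true false) nr)))

    nbhd : Fin n → Subset n
    nbhd i = tabulate (λ z → does (Crossing? i z))

    nbhd⇒Crossing : ∀ i z → lookup (nbhd i) z ≡ true → Crossing D i z
    nbhd⇒Crossing i z e = does-true⇒ (Crossing? i z) (trans (sym (lookup-tabulate (λ z → does (Crossing? i z)) z)) e)
    Crossing⇒nbhd : ∀ i z → Crossing D i z → lookup (nbhd i) z ≡ true
    Crossing⇒nbhd i z p = trans (lookup-tabulate (λ z → does (Crossing? i z)) z) (dec-true (Crossing? i z) p)

    simplicial-active⇒IsSimplicial : ∀ i → SimplicialIn activeSet i → IsSimplicial i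
    simplicial-active⇒IsSimplicial i sp x y ex ey ne = sp x y (Active⇒activeSet x (Realized⇒Active (Realized-swap (proj₁ (proj₂ ex))))) (Active⇒activeSet y (Realized⇒Active (Realized-swap (proj₁ (proj₂ ey))))) ex ey ne

    below-neighbours : ∀ i s → lookup (below i) s ≡ true → ∀ z → Crossing D s z → lookup (below i ∪ nbhd i) z ≡ true
    below-neighbours i s bs z (ne , (c , c∈ , cs , cz) , r10 , r01) = place (Realized? D z i true false)
      where
      s⊆i : ¬ Realized D s i true false
      s⊆i = proj₂ (proj₂ (below⇒ i s bs))
      ci : lookup c i ≡ true
      ci with true-or-false (lookup c i)
      ... | inj₁ t = t
      ... | inj₂ f = ⊥-elim (s⊆i (c , c∈ , cs , f))
      i≢z : i ≢ z
      i≢z refl = s⊆i r10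
      r-iz : Realized D i z true false
      r-iz = decidable-stable (Realized? D i z true false) (λ nr → ⊆-field-trans {s} {i} {z} s⊆i nr r10)
      place : Dec (Realized D z i true false) → lookup (below i ∪ nbhd i) z ≡ true
      place (yes r) = trans (lookup-∪ (below i) (nbhd i) z) (trans (cong (lookup (below i) z ∨_)
                        (Crossing⇒nbhd i z (i≢z , (c , c∈ , ci , cz) , r-iz , Realized-swap r))) (BP.∨-zeroʳ _))
      place (no nr) = trans (lookup-∪ (below i) (nbhd i) z) (cong (_∨ lookup (nbhd i) z) (below⁺ i z (c , c∈ , cz , cz) i≢z nr))

    below-⊂ : ∀ i s → lookup (below i) s ≡ true → below s S.⊂ below i
    below-⊂ i s bs = lookup⇒⊆ sub , s , lookup⇒∈ bs , λ s∈ → proj₁ (proj₂ (below⇒ s s (∈⇒lookup s∈))) refl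
      where
      as : Active s
      as = proj₁ (below⇒ i s bs)
      i≢s : i ≢ s
      i≢s = proj₁ (proj₂ (below⇒ i s bs))
      s⊆i : ¬ Realized D s i true false
      s⊆i = proj₂ (proj₂ (below⇒ i s bs))
      sub : ∀ m → lookup (below s) m ≡ true → lookup (below i) m ≡ true
      sub m e with below⇒ s m e
      ... | am , s≢m , m⊆s = below⁺ i m am (λ i≡m → i≢s (sym (dist s i as (same-fields i≡m)))) (⊆-field-trans {m} {s} {i} m⊆s s⊆i)
        where
        same-fields : i ≡ m → ∀ c → c ∈ D → lookup c s ≡ lookup c i
        same-fields refl c c∈ with true-or-false (lookup c s) | true-or-false (lookup c i)
        ... | inj₁ a | inj₁ b = trans a (sym b)
        ... | inj₂ a | inj₂ b = trans a (sym b)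
        ... | inj₁ a | inj₂ b = ⊥-elim (s⊆i (c , c∈ , a , b))
        ... | inj₂ a | inj₁ b = ⊥-elim (m⊆s (c , c∈ , b , a))

    -- Dirac's lemma in below i ∪ N(i), avoiding the clique N(i), gives a simplicial vertex strictly below i.
    descend-simplicial : ∀ f i → ∣ below i ∣ ≤ f → Active i → IsSimplicial i → ∃[ s ] (Active s × Minimal s × IsSimplicial s)
    descend-simplicial f i le ai si with FP.any? (λ m → lookup (below i) m B.≟ true)
    ... | no nm = i , ai , (λ j aj ne → decidable-stable (Realized? D j i true false) (λ nr → nm (j , below⁺ i j aj (λ e → ne (sym e)) nr))) , si
    ... | yes (m , bm) with dirac n (below i ∪ nbhd i) (nbhd i) (SP.∣p∣≤n (below i ∪ nbhd i)) nbhd⊆ nbhd-clique m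
                              (trans (lookup-∪ (below i) (nbhd i) m) (cong (_∨ lookup (nbhd i) m) bm)) m∉nbhd
      where
      nbhd⊆ : ∀ z → lookup (nbhd i) z ≡ true → lookup (below i ∪ nbhd i) z ≡ true
      nbhd⊆ z e = trans (lookup-∪ (below i) (nbhd i) z) (trans (cong (lookup (below i) z ∨_) e) (BP.∨-zeroʳ _))
      nbhd-clique : CliqueIn (nbhd i)
      nbhd-clique x y ex ey ne = si x y (nbhd⇒Crossing i x ex) (nbhd⇒Crossing i y ey) ne
      m∉nbhd : lookup (nbhd i) m ≡ false
      m∉nbhd with true-or-false (lookup (nbhd i) m)
      ... | inj₂ f = f
      ... | inj₁ t = ⊥-elim (proj₂ (proj₂ (below⇒ i m bm)) (Realized-swap (proj₂ (proj₂ (proj₂ (nbhd⇒Crossing i m t))))))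
    ... | s , s∈ , s∉nbhd , simp with ∨≡true⇒ _ _ (trans (sym (lookup-∪ (below i) (nbhd i) s)) s∈)
    ...   | inj₂ t = ⊥-elim (true≢false (trans (sym t) s∉nbhd))
    ...   | inj₁ bs with f
    ...     | zero = ⊥-elim (NP.<-irrefl refl (NP.<-≤-trans (NP.≤-<-trans z≤n (SP.x∈p⇒∣p-x∣<∣p∣ (lookup⇒∈ {p = below i} bm))) le))
    ...     | suc f′ = descend-simplicial f′ s (NP.≤-pred (NP.<-≤-trans (SP.p⊂q⇒∣p∣<∣q∣ (below-⊂ i s bs)) le))
                         (proj₁ (below⇒ i s bs))
                         (λ x y ex ey ne → simp x y (below-neighbours i s bs x ex) (below-neighbours i s bs y ey) ex ey ne)

    minimal-simplicial : ∀ a → Active a → ∃[ s ] (Active s × Minimal s × IsSimplicial s)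
    minimal-simplicial a aa with dirac n activeSet S.⊥ (SP.∣p∣≤n activeSet) (λ z e → ⊥-elim (true≢false (trans (sym e) (lookup-⊥ z))))
                       (λ x y e _ _ → ⊥-elim (true≢false (trans (sym e) (lookup-⊥ x)))) a (Active⇒activeSet a aa) (lookup-⊥ a)
    ... | i , ai , _ , sp = descend-simplicial n i (SP.∣p∣≤n (below i)) (activeSet⇒Active i ai) (simplicial-active⇒IsSimplicial i sp)

patterns⇒codeword : ∀ {n} (D : Code n) → PairObstructed D → ∀ γ → (∀ j k → Realized D j k (lookup γ j) (lookup γ k)) → γ ∈ D
patterns⇒codeword D obstructed γ R with DecMem._∈?_ (VP.≡-dec B._≟_) γ D
... | yes p = p
... | no np with obstructed γ (∁ γ) γ-apart γ-misses
  where
  γ-apart : Apart γ (∁ γ)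
  γ-apart k a b = true≢false (trans (sym b) (trans (lookup-∁ γ k) (cong not a)))
  γ-misses : BoxMisses D γ (∁ γ)
  γ-misses c c∈ with true-or-false (inBox γ (∁ γ) c)
  ... | inj₂ f = f
  ... | inj₁ t = ⊥-elim (np (subst (_∈ D) (inBox-ρ γ c t) c∈))
... | j , k , a , b , lj , lk , nr = ⊥-elim (nr (subst₂ (Realized D j k) (literal-value j a lj) (literal-value k b lk) (R j k)))
  where
  literal-value : ∀ x a → HasLiteral γ (∁ γ) x a → lookup γ x ≡ a
  literal-value x true l = l
  literal-value x false l with lookup γ x | trans (sym l) (lookup-∁ γ x)
  ... | false | _ = refl
  ... | true | ()

-- σp = {j : Uᵢ ⊆ Uⱼ} (no codeword contains i but not j) and τp = σp ∪ N(i).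
module SimplicialPiercing {n : ℕ} (D : Code n) (∅∈D : S.⊥ ∈ D) (obstructed : PairObstructed D) (i : Fin n) (ai : Active D i) (mi : Minimal D i) (si : IsSimplicial D i) where

  σf : Fin n → Bool
  σf j = not (eqᵇ i j) ∧ not (does (Realized? D i j true false))
  σp : Subset n
  σp = tabulate σf
  Nf : Fin n → Bool
  Nf z = does (Crossing? D i z)
  nbhd : Subset n
  nbhd = tabulate Nf
  τp : Subset n
  τp = σp ∪ nbhd

  σp⇒ : ∀ j → lookup σp j ≡ true → i ≢ j × ¬ Realized D i j true false
  σp⇒ j e = does-false⇒ (i FP.≟ j) (∧-trueˡ (not (eqᵇ i j)) _ e') , does-false⇒ (Realized? D i j true false) (∧-trueʳ (not (eqᵇ i j)) _ e')
    where e' = trans (sym (lookup-tabulate σf j)) e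
  σp⁺ : ∀ j → i ≢ j → ¬ Realized D i j true false → lookup σp j ≡ true
  σp⁺ j ne nr = trans (lookup-tabulate σf j) (trans (cong₂ (λ u w → not u ∧ not w) (eqᵇ-≢ ne) (dec-false (Realized? D i j true false) nr)) refl)
  nbhd⇒Crossing : ∀ z → lookup nbhd z ≡ true → Crossing D i z
  nbhd⇒Crossing z e = does-true⇒ (Crossing? D i z) (trans (sym (lookup-tabulate Nf z)) e)
  Crossing⇒nbhd : ∀ z → Crossing D i z → lookup nbhd z ≡ true
  Crossing⇒nbhd z p = trans (lookup-tabulate Nf z) (dec-true (Crossing? D i z) p)
  τp⇒ : ∀ j → lookup τp j ≡ true → lookup σp j ≡ true ⊎ Crossing D i j
  τp⇒ j e with ∨≡true⇒ _ _ (trans (sym (lookup-∪ σp nbhd j)) e)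
  ... | inj₁ s = inj₁ s
  ... | inj₂ t = inj₂ (nbhd⇒Crossing j t)
  σp⊆τp : ∀ j → lookup σp j ≡ true → lookup τp j ≡ true
  σp⊆τp j e = trans (lookup-∪ σp nbhd j) (cong (_∨ lookup nbhd j) e)
  nbhd⊆τp : ∀ j → Crossing D i j → lookup τp j ≡ true
  nbhd⊆τp j p = trans (lookup-∪ σp nbhd j) (trans (cong (lookup σp j ∨_) (Crossing⇒nbhd j p)) (BP.∨-zeroʳ _))

  lookup-σp-i : lookup σp i ≡ false
  lookup-σp-i with true-or-false (lookup σp i)
  ... | inj₁ t = ⊥-elim (proj₁ (σp⇒ i t) refl)
  ... | inj₂ f = f
  lookup-τp-i : lookup τp i ≡ false
  lookup-τp-i with true-or-false (lookup τp i)
  ... | inj₂ f = f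
  ... | inj₁ t with τp⇒ i t
  ...   | inj₁ s = ⊥-elim (true≢false (trans (sym s) lookup-σp-i))
  ...   | inj₂ p = ⊥-elim (Crossing-irrefl D p)

  c0 : Subset n
  c0 = proj₁ ai
  c0∈ : c0 ∈ D
  c0∈ = proj₁ (proj₂ ai)
  c0i : lookup c0 i ≡ true
  c0i = proj₁ (proj₂ (proj₂ ai))

  σp⊆c0 : ∀ x → lookup σp x ≡ true → lookup c0 x ≡ true
  σp⊆c0 x s with true-or-false (lookup c0 x)
  ... | inj₁ t = t
  ... | inj₂ f = ⊥-elim (proj₂ (σp⇒ x s) (c0 , c0∈ , c0i , f))

  -- Each pair of coordinates of a set in the interval [σp ∪ {i}, τp ∪ {i}] shows a pattern occurring
  -- in D, so the set is a codeword.
  module Interval (γ : Subset n) (gi : lookup γ i ≡ true) (lo : ∀ x → lookup σp x ≡ true → lookup γ x ≡ true)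
               (hi : ∀ x → lookup γ x ≡ true → lookup τp x ≡ true ⊎ x ≡ i) where
    σp-or-neighbour : ∀ x → x ≢ i → lookup γ x ≡ true → lookup σp x ≡ true ⊎ Crossing D i x
    σp-or-neighbour x ne g with hi x g
    ... | inj₁ t = τp⇒ x t
    ... | inj₂ e = ⊥-elim (ne e)
    absent⇒i-without : ∀ x → lookup γ x ≡ false → x ≢ i → Realized D i x true false
    absent⇒i-without x g ne = decidable-stable (Realized? D i x true false) (λ nr → true≢false (trans (sym (lo x (σp⁺ x (λ e → ne (sym e)) nr))) g))
    patterns-with-i : ∀ k → Realized D i k true (lookup γ k)
    patterns-with-i k with k FP.≟ i
    ... | yes refl = subst (Realized D i i true) (sym gi) ai
    ... | no ne with true-or-false (lookup γ k)
    ...   | inj₂ g = subst (Realized D i k true) (sym g) (absent⇒i-without k g ne)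
    ...   | inj₁ g with σp-or-neighbour k ne g
    ...     | inj₁ s = subst (Realized D i k true) (sym g) (c0 , c0∈ , c0i , σp⊆c0 k s)
    ...     | inj₂ p = subst (Realized D i k true) (sym g) (proj₁ (proj₂ p))
    pattern-10 : ∀ j k → j ≢ i → k ≢ i → lookup γ j ≡ true → lookup γ k ≡ false → Realized D j k true false
    pattern-10 j k nj nk gj gk with Realized? D j k true false
    ... | yes r = r
    ... | no jk with σp-or-neighbour j nj gj
    ...   | inj₁ s = ⊥-elim (true≢false (trans (sym (lo k (σp⁺ k (λ e → nk (sym e)) (⊆-field-trans D {i} {j} {k} (proj₂ (σp⇒ j s)) jk)))) gk))
    ...   | inj₂ eij = proj₁ (proj₂ (proj₂ (si j k eij eik (λ e → true≢false (trans (sym gj) (trans (cong (lookup γ) e) gk))))))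
      where
      has : ∀ c → c ∈ D → lookup c j ≡ true → lookup c k ≡ true
      has c c∈ cj with true-or-false (lookup c k)
      ... | inj₁ t = t
      ... | inj₂ f = ⊥-elim (jk (c , c∈ , cj , f))
      r11 : Realized D i k true true
      r11 = let (c , c∈ , ci , cj) = proj₁ (proj₂ eij) in c , c∈ , ci , has c c∈ cj
      r01 : Realized D i k false true
      r01 = let (c , c∈ , ci , cj) = proj₂ (proj₂ (proj₂ eij)) in c , c∈ , ci , has c c∈ cj
      eik : Crossing D i k
      eik = (λ e → nk (sym e)) , r11 , absent⇒i-without k gk nk , r01
    σp-with-i : ∀ x → lookup σp x ≡ true → ∀ c → c ∈ D → lookup c i ≡ true → lookup c x ≡ true
    σp-with-i x s c c∈ ci with true-or-false (lookup c x)
    ... | inj₁ t = t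
    ... | inj₂ f = ⊥-elim (proj₂ (σp⇒ x s) (c , c∈ , ci , f))
    pattern-11 : ∀ j k → j ≢ i → k ≢ i → lookup γ j ≡ true → lookup γ k ≡ true → Realized D j k true true
    pattern-11 j k nj nk gj gk with j FP.≟ k
    ... | yes refl with σp-or-neighbour j nj gj
    ...   | inj₁ s = c0 , c0∈ , σp⊆c0 j s , σp⊆c0 j s
    ...   | inj₂ p = Realized⇒Active D (Realized-swap D (proj₁ (proj₂ p)))
    pattern-11 j k nj nk gj gk | no ne with σp-or-neighbour j nj gj | σp-or-neighbour k nk gk
    ... | inj₁ sj | inj₁ sk = c0 , c0∈ , σp⊆c0 j sj , σp⊆c0 k sk
    ... | inj₁ sj | inj₂ pk = let (c , c∈ , ci , ck) = proj₁ (proj₂ pk) in c , c∈ , σp-with-i j sj c c∈ ci , ck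
    ... | inj₂ pj | inj₁ sk = let (c , c∈ , ci , cj) = proj₁ (proj₂ pj) in c , c∈ , cj , σp-with-i k sk c c∈ ci
    ... | inj₂ pj | inj₂ pk = proj₁ (proj₂ (si j k pj pk ne))
    patterns-without-i : ∀ j k → j ≢ i → k ≢ i → Realized D j k (lookup γ j) (lookup γ k)
    patterns-without-i j k nj nk with true-or-false (lookup γ j) | true-or-false (lookup γ k)
    ... | inj₂ a | inj₂ b = subst₂ (Realized D j k) (sym a) (sym b) (Realized-00 D ∅∈D j k)
    ... | inj₁ a | inj₂ b = subst₂ (Realized D j k) (sym a) (sym b) (pattern-10 j k nj nk a b)
    ... | inj₂ a | inj₁ b = subst₂ (Realized D j k) (sym a) (sym b) (Realized-swap D (pattern-10 k j nk nj b a))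
    ... | inj₁ a | inj₁ b = subst₂ (Realized D j k) (sym a) (sym b) (pattern-11 j k nj nk a b)
    R : ∀ j k → Realized D j k (lookup γ j) (lookup γ k)
    R j k with j FP.≟ i | k FP.≟ i
    ... | yes refl | _ = subst (λ u → Realized D j k u (lookup γ k)) (sym gi) (patterns-with-i k)
    ... | no nj | yes refl = subst (Realized D j k (lookup γ j)) (sym gi) (Realized-swap D (patterns-with-i j))
    ... | no nj | no nk = patterns-without-i j k nj nk
    interval-member : γ ∈ D
    interval-member = patterns⇒codeword D obstructed γ R

  -- By minimality every active k ≠ i occurs without i.
  minus-i-codeword : ∀ e → e ∈ D → (e - i) ∈ D
  minus-i-codeword e e∈ = patterns⇒codeword D obstructed (e - i) R
    where
    atI : lookup (e - i) i ≡ false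
    atI = lookup-minus-self e i
    atK : ∀ k → k ≢ i → lookup (e - i) k ≡ lookup e k
    atK k ne = lookup-minus-other e i k (λ x → ne (sym x))
    patterns-with-i : ∀ k → Realized D i k false (lookup (e - i) k)
    patterns-with-i k with k FP.≟ i
    ... | yes refl = subst (Realized D i i false) (sym atI) (Realized-00 D ∅∈D i i)
    ... | no ne with true-or-false (lookup e k)
    ...   | inj₂ f = subst (Realized D i k false) (sym (trans (atK k ne) f)) (Realized-00 D ∅∈D i k)
    ...   | inj₁ t = subst (Realized D i k false) (sym (trans (atK k ne) t)) (Realized-swap D (mi k (e , e∈ , t , t) ne))
    R : ∀ j k → Realized D j k (lookup (e - i) j) (lookup (e - i) k)
    R j k with j FP.≟ i | k FP.≟ i
    ... | yes refl | _ = subst (λ u → Realized D j k u (lookup (e - i) k)) (sym atI) (patterns-with-i k)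
    ... | no nj | yes refl = subst (Realized D j k (lookup (e - i) j)) (sym atI) (Realized-swap D (patterns-with-i j))
    ... | no nj | no nk = e , e∈ , sym (atK j nj) , sym (atK k nk)

  open Deletion D i

  i∉τ : i S.∉ τp
  i∉τ x = true≢false (trans (sym (∈⇒lookup x)) lookup-τp-i)

  lookup-∪⁅i⁆ : ∀ (γ : Subset n) k → lookup (γ ∪ ⁅ i ⁆) k ≡ lookup γ k ∨ eqᵇ i k
  lookup-∪⁅i⁆ γ k = trans (lookup-∪ γ ⁅ i ⁆ k) (cong (lookup γ k ∨_) (lookup-⁅⁆ i k))

  interval⊆deleted : ∀ γ → InInterval σp τp γ → γ ∈ delete i D
  interval⊆deleted γ (lo , hi) = subst (_∈ delete i D) eq (∈-map⁺ (λ c → c - i) γ'∈)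
    where
    γ' : Subset n
    γ' = γ ∪ ⁅ i ⁆
    γi : lookup γ i ≡ false
    γi with true-or-false (lookup γ i)
    ... | inj₂ f = f
    ... | inj₁ t = ⊥-elim (true≢false (trans (sym (⊆⇒lookup hi i t)) lookup-τp-i))
    γ'∈ : γ' ∈ D
    γ'∈ = Interval.interval-member γ' (trans (lookup-∪⁅i⁆ γ i) (trans (cong (lookup γ i ∨_) (eqᵇ-refl i)) (BP.∨-zeroʳ _)))
      (λ x s → trans (lookup-∪⁅i⁆ γ x) (cong (_∨ eqᵇ i x) (⊆⇒lookup lo x s)))
      (λ x e → Data.Sum.map (⊆⇒lookup hi x) (λ q → sym (eqᵇ⇒≡ {i = i} {x} q)) (∨≡true⇒ _ _ (trans (sym (lookup-∪⁅i⁆ γ x)) e)))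
    eq : γ' - i ≡ γ
    eq = subset-ext {p = γ' - i} {q = γ} λ k → trans (lookup-minus γ' i k) (trans (cong (_∧ not (eqᵇ i k)) (lookup-∪⁅i⁆ γ k)) (go k))
      where
      go : ∀ k → (lookup γ k ∨ eqᵇ i k) ∧ not (eqᵇ i k) ≡ lookup γ k
      go k with i FP.≟ k
      ... | yes refl = trans (BP.∧-zeroʳ _) (sym γi)
      ... | no ne = trans (BP.∧-identityʳ _) (BP.∨-identityʳ _)

  minus-absent : ∀ γ → lookup γ i ≡ false → γ - i ≡ γ
  minus-absent γ gi = subset-ext {p = γ - i} {q = γ} λ k → trans (lookup-minus γ i k) (go k)
    where
    go : ∀ k → lookup γ k ∧ not (eqᵇ i k) ≡ lookup γ k
    go k with i FP.≟ k
    ... | yes refl = trans (BP.∧-zeroʳ _) (sym gi)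
    ... | no ne = BP.∧-identityʳ _

  pierce-decomposition : ∀ γ → (γ ∈ D) ⇔ ((γ ∈ delete i D) ⊎ InInterval (σp ∪ ⁅ i ⁆) (τp ∪ ⁅ i ⁆) γ)
  pierce-decomposition γ = mk⇔ to' from'
    where
    to' : γ ∈ D → (γ ∈ delete i D) ⊎ InInterval (σp ∪ ⁅ i ⁆) (τp ∪ ⁅ i ⁆) γ
    to' γ∈ with true-or-false (lookup γ i)
    ... | inj₂ gi = inj₁ (subst (_∈ delete i D) (minus-absent γ gi) (∈-map⁺ (λ c → c - i) γ∈))
    ... | inj₁ gi = inj₂ (lookup⇒⊆ lo , lookup⇒⊆ hi)
      where
      lo : ∀ x → lookup (σp ∪ ⁅ i ⁆) x ≡ true → lookup γ x ≡ true
      lo x e with ∨≡true⇒ _ _ (trans (sym (lookup-∪⁅i⁆ σp x)) e)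
      ... | inj₂ q = subst (λ w → lookup γ w ≡ true) (eqᵇ⇒≡ {i = i} {x} q) gi
      ... | inj₁ s with true-or-false (lookup γ x)
      ...   | inj₁ t = t
      ...   | inj₂ f = ⊥-elim (proj₂ (σp⇒ x s) (γ , γ∈ , gi , f))
      hi : ∀ x → lookup γ x ≡ true → lookup (τp ∪ ⁅ i ⁆) x ≡ true
      hi x g with i FP.≟ x
      ... | yes refl = trans (lookup-∪⁅i⁆ τp i) (trans (cong (lookup τp i ∨_) (eqᵇ-refl i)) (BP.∨-zeroʳ _))
      ... | no ne = trans (lookup-∪⁅i⁆ τp x) (cong (_∨ eqᵇ i x) tx)
        where
        tx : lookup τp x ≡ true
        tx with Realized? D i x true false
        ... | no nr = σp⊆τp x (σp⁺ x ne nr)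
        ... | yes r = nbhd⊆τp x (ne , (γ , γ∈ , gi , g) , r , Realized-swap D (mi x (γ , γ∈ , g , g) (λ e → ne (sym e))))
    from' : (γ ∈ delete i D) ⊎ InInterval (σp ∪ ⁅ i ⁆) (τp ∪ ⁅ i ⁆) γ → γ ∈ D
    from' (inj₁ d∈) with ∈-deleted γ d∈
    ... | e , e∈ , refl = minus-i-codeword e e∈
    from' (inj₂ (lo , hi)) = Interval.interval-member γ (⊆⇒lookup lo i (trans (lookup-∪⁅i⁆ σp i) (trans (cong (lookup σp i ∨_) (eqᵇ-refl i)) (BP.∨-zeroʳ _))))
      (λ x s → ⊆⇒lookup lo x (trans (lookup-∪⁅i⁆ σp x) (cong (_∨ eqᵇ i x) s)))
      (λ x g → Data.Sum.map (λ t → t) (λ q → sym (eqᵇ⇒≡ {i = i} {x} q)) (∨≡true⇒ _ _ (trans (sym (lookup-∪⁅i⁆ τp x)) (⊆⇒lookup hi x g))))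

  piercing : IsPiercing ∣ τp ─ σp ∣ i D
  piercing = σp , τp , SP.p⊆p∪q nbhd , i∉τ , refl , interval⊆deleted , pierce-decomposition

  closedNbhd : Subset n
  closedNbhd = (τp ─ σp) ∪ ⁅ i ⁆

  ∣p∪⁅i⁆∣≡ : ∀ {m} (p : Subset m) j → lookup p j ≡ false → ∣ p ∪ ⁅ j ⁆ ∣ ≡ suc ∣ p ∣
  ∣p∪⁅i⁆∣≡ (false ∷ p) zero e = cong suc (cong ∣_∣ (SP.∪-identityʳ p))
  ∣p∪⁅i⁆∣≡ (true ∷ p) (suc j) e = cong suc (∣p∪⁅i⁆∣≡ p j e)
  ∣p∪⁅i⁆∣≡ (false ∷ p) (suc j) e = ∣p∪⁅i⁆∣≡ p j e

  closedNbhd-size : ∣ closedNbhd ∣ ≡ suc ∣ τp ─ σp ∣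
  closedNbhd-size = ∣p∪⁅i⁆∣≡ (τp ─ σp) i (trans (lookup-─ τp σp i) (trans (cong (_∧ not (lookup σp i)) lookup-τp-i) refl))

  closedNbhd⇒ : ∀ x → lookup closedNbhd x ≡ true → x ≡ i ⊎ Crossing D i x
  closedNbhd⇒ x e with ∨≡true⇒ _ _ (trans (sym (lookup-∪⁅i⁆ (τp ─ σp) x)) e)
  ... | inj₂ q = inj₁ (sym (eqᵇ⇒≡ {i = i} {x} q))
  ... | inj₁ t with τp⇒ x (∧-trueˡ _ _ (trans (sym (lookup-─ τp σp x)) t))
  ...   | inj₂ p = inj₂ p
  ...   | inj₁ s = ⊥-elim (true≢false (trans (sym (∧-trueʳ (lookup τp x) _ (trans (sym (lookup-─ τp σp x)) t))) (cong not s)))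

  closedNbhd-clique : IsClique (Crossing D) closedNbhd
  closedNbhd-clique x y xk yk ne with closedNbhd⇒ x (∈⇒lookup xk) | closedNbhd⇒ y (∈⇒lookup yk)
  ... | inj₁ refl | inj₁ refl = ⊥-elim (ne refl)
  ... | inj₁ refl | inj₂ p = p
  ... | inj₂ p | inj₁ refl = Crossing-sym D p
  ... | inj₂ p | inj₂ q = si x y p q ne

  ∅∈deleted : S.⊥ ∈ deleted
  ∅∈deleted = subst (_∈ deleted) (subset-ext {p = S.⊥ - i} {q = S.⊥} λ k → trans (lookup-minus S.⊥ i k) (trans (cong (_∧ not (eqᵇ i k)) (lookup-⊥ k)) (sym (lookup-⊥ k))))
            (∈-map⁺ (λ c → c - i) ∅∈D)

  PairObstructed-delete : PairObstructed deleted
  PairObstructed-delete P T dj bx with true-or-false (lookup P i)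
  ... | inj₁ pi = i , i , true , true , pi , pi , λ r → Realized-deleted-true i i true r refl
  ... | inj₂ pi with obstructed P (T - i) (Apart-mono {σ = P} {T} {P} {T - i} dj (λ x → x) (SP.p─q⊆p T ⁅ i ⁆)) bxD
    where
    bxD : BoxMisses D P (T - i)
    bxD c c∈ with true-or-false (inBox P (T - i) c)
    ... | inj₂ f = f
    ... | inj₁ t = ⊥-elim (true≢false (trans (sym (literalHolds⇒inBox P T (c - i) pw)) (bx (c - i) (∈-map⁺ (λ c → c - i) c∈))))
      where
      pw : ∀ z → literalHolds (lookup P z) (lookup T z) (lookup (c - i) z) ≡ true
      pw z with i FP.≟ z
      ... | yes refl rewrite pi | lookup-minus-self c i with lookup T i
      ...   | true = refl
      ...   | false = refl
      pw z | no ne = subst₂ (λ w u → literalHolds (lookup P z) w u ≡ true) (lookup-minus-other T i z ne) (sym (lookup-minus-other c i z ne)) (inBox⇒literalHolds P (T - i) c t z)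
  ... | j , k , a , b , lj , lk , nr = j , k , a , b , litUp j a lj , litUp k b lk ,
        λ r → nr (Realized-deleted⁻ j k a b r (notI j a lj) (notI k b lk))
    where
    notI : ∀ x a → HasLiteral P (T - i) x a → i ≢ x
    notI x true l refl = true≢false (trans (sym l) pi)
    notI x false l refl = true≢false (trans (sym l) (lookup-minus-self T i))
    litUp : ∀ x a → HasLiteral P (T - i) x a → HasLiteral P T x a
    litUp x true l = l
    litUp x false l = ∧-trueˡ _ _ (trans (sym (lookup-minus T i x)) l)

  Chordal-delete : Chordal (Crossing D) → Chordal (Crossing deleted)
  Chordal-delete ch l v inj adj with ch l v inj (λ a b c → proj₁ (Crossing-deleted⁻ (v a) (v b) (adj a b c)))
  ... | a , b , ne , nc , e = a , b , ne , nc , Crossing-deleted⁺ (v a) (v b) e (notI a) (notI b)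
    where
    notI : ∀ a → i ≢ v a
    notI a with cycle-neighbours l a
    ... | b' , _ , ab , _ = proj₁ (proj₂ (Crossing-deleted⁻ (v a) (v b') (adj a b' ab)))

  Separated-delete : Separated D → Separated deleted
  Separated-delete dist j k aj same with Realized-deleted-true j j true aj
  ... | nj with i FP.≟ k
  ...   | yes refl = ⊥-elim (let (e , e∈ , ej , _) = aj in true≢false (trans (sym ej) (trans (same e e∈) (i-absent e e∈))))
    where
    i-absent : ∀ e → e ∈ deleted → lookup e i ≡ false
    i-absent e e∈ with ∈-deleted e e∈
    ... | c , _ , refl = lookup-minus-self c i
  ...   | no nk = dist j k (Realized-deleted⁻ j j true true aj nj nj)
                    (λ c c∈ → trans (sym (lookup-minus-other c i j nj)) (trans (same (c - i) (∈-map⁺ (λ c → c - i) c∈)) (lookup-minus-other c i k nk)))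

  Active-delete : ∀ j → Active deleted j → Active D j × i ≢ j
  Active-delete j aj = Realized-deleted⁻ j j true true aj nj nj , nj
    where nj = Realized-deleted-true j j true aj

KIndPierced-mono : ∀ {n} {k k2} {D : Code n} → k ≤ k2 → KIndPierced k D → KIndPierced k2 D
KIndPierced-mono le (base e) = base e
KIndPierced-mono le (step i k' le' p rest) = step i k' (NP.≤-trans le' le) p (KIndPierced-mono le rest)

PiercedWithClique : ∀ {n} → Code n → Set
PiercedWithClique D = ∃[ r ] (KIndPierced r D × (r ≡ 0 ⊎ ∃[ K ] (IsClique (Crossing D) K × ∣ K ∣ ≡ suc r)))

noActive⇒emptyCode : ∀ {n} (D : Code n) → S.⊥ ∈ D → (∀ j → ¬ Active D j) → D ≐ emptyCode
noActive⇒emptyCode D ∅∈D none γ = mk⇔ (λ γ∈ → here (only-∅ γ∈)) (λ { (here refl) → ∅∈D })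
  where
  only-∅ : γ ∈ D → γ ≡ S.⊥
  only-∅ γ∈ = subset-ext λ k → trans (absent k (true-or-false (lookup γ k))) (sym (lookup-⊥ k))
    where
    absent : ∀ k → lookup γ k ≡ true ⊎ lookup γ k ≡ false → lookup γ k ≡ false
    absent k (inj₁ t) = ⊥-elim (none k (γ , γ∈ , t , t))
    absent k (inj₂ f) = f

module _ {n : ℕ} (D : Code n) (∅∈D : S.⊥ ∈ D) (obstructed : PairObstructed D)
         {i : Fin n} (ai : Active D i) (mi : Minimal D i) (si : IsSimplicial D i) where
  open SimplicialPiercing D ∅∈D obstructed i ai mi si

  PiercedWithClique-extend : PiercedWithClique (delete i D) → PiercedWithClique D
  PiercedWithClique-extend (r , pierced , clique) =
    ri ⊔ r , step i ri (NP.m≤m⊔n ri r) piercing (KIndPierced-mono (NP.m≤n⊔m ri r) pierced) , largest (r N.≤? ri) clique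
    where
    ri : ℕ
    ri = ∣ τp ─ σp ∣
    largest : Dec (r ≤ ri) → r ≡ 0 ⊎ ∃[ K ] (IsClique (Crossing (delete i D)) K × ∣ K ∣ ≡ suc r) →
              ri ⊔ r ≡ 0 ⊎ ∃[ K ] (IsClique (Crossing D) K × ∣ K ∣ ≡ suc (ri ⊔ r))
    largest (yes r≤ri) _ = inj₂ (closedNbhd , closedNbhd-clique , trans closedNbhd-size (cong suc (sym (NP.m≥n⇒m⊔n≡m r≤ri))))
    largest (no r≰ri) (inj₁ refl) = ⊥-elim (r≰ri z≤n)
    largest (no r≰ri) (inj₂ (K , K-clique , ∣K∣≡)) =
      inj₂ (K , IsClique-map (λ x y → proj₁ ∘ Deletion.Crossing-deleted⁻ D i x y) K K-clique ,
            trans ∣K∣≡ (cong suc (sym (NP.m≤n⇒m⊔n≡n (NP.<⇒≤ (NP.≰⇒> r≰ri))))))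

pierced-with-clique : ∀ {n} f (D : Code n) (A : Subset n) → ∣ A ∣ ≤ f → (∀ j → Active D j → lookup A j ≡ true) →
  S.⊥ ∈ D → PairObstructed D → Chordal (Crossing D) → Separated D → PiercedWithClique D
pierced-with-clique zero D A ∣A∣≤0 act⊆A ∅∈D _ _ _ =
  0 , base (noActive⇒emptyCode D ∅∈D λ j aj → NP.<⇒≱ (SP.x∈p⇒∣p-x∣<∣p∣ (lookup⇒∈ {p = A} (act⊆A j aj))) (NP.≤-trans ∣A∣≤0 z≤n)) , inj₁ refl
pierced-with-clique (suc f) D A ∣A∣≤ act⊆A ∅∈D obstructed chordal separated with FP.any? (λ j → Realized? D j j true true)
... | no none = 0 , base (noActive⇒emptyCode D ∅∈D (λ j aj → none (j , aj))) , inj₁ refl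
... | yes (a , aa) with MinimalSimplicial.minimal-simplicial D chordal separated a aa
...   | i , ai , mi , si = PiercedWithClique-extend D ∅∈D obstructed ai mi si
          (pierced-with-clique f (delete i D) (A - i) ∣A-i∣≤f act⊆A-i ∅∈deleted PairObstructed-delete
             (Chordal-delete chordal) (Separated-delete separated))
  where
  open SimplicialPiercing D ∅∈D obstructed i ai mi si
  ∣A-i∣≤f : ∣ A - i ∣ ≤ f
  ∣A-i∣≤f = NP.≤-pred (NP.<-≤-trans (SP.x∈p⇒∣p-x∣<∣p∣ (lookup⇒∈ {p = A} (act⊆A i ai))) ∣A∣≤)
  act⊆A-i : ∀ j → Active (delete i D) j → lookup (A - i) j ≡ true
  act⊆A-i j aj = let (ad , i≢j) = Active-delete j aj in
    trans (lookup-minus A i j) (cong₂ (λ u w → u ∧ not w) (act⊆A j ad) (eqᵇ-≢ i≢j))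

degreeTwo-chordal⇒piercedWithClique : ∀ {n} (C : Code n) → Conventions C → DegreeTwo C × Chordal (GEdge C) → PiercedWithClique C
degreeTwo-chordal⇒piercedWithClique {n} C cv@(∅∈C , _ , separated) (degreeTwo , chordal) =
  pierced-with-clique n C S.⊤ (SP.∣p∣≤n S.⊤) (λ j _ → VP.lookup-replicate j true) ∅∈C (DegreeTwo⇒PairObstructed C cv degreeTwo)
    (Chordal-⇔ (GEdge⇔Crossing C cv) chordal) (λ j k _ → separated j k)

pierced⇒degreeTwo-chordal : ∀ {n} (C : Code n) → Conventions C → InductivelyPierced C → DegreeTwo C × Chordal (GEdge C)
pierced⇒degreeTwo-chordal C cv (k , pierced) with inductivelyPierced⇒invariants k C pierced
... | obstructed , chordal , _ = PairObstructed⇒DegreeTwo C cv obstructed , Chordal-⇔ (λ x y → ⇔-sym (GEdge⇔Crossing C cv x y)) chordal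

minPiercing⇒maxClique : ∀ {n} (C : Code n) → Conventions C → ∀ k → MinPiercing k C → 1 ≤ n → MaxCliqueSize (GEdge C) (k + 1)
minPiercing⇒maxClique {suc m} C cv k (pierced , minimal) _ =
  attained (degreeTwo-chordal⇒piercedWithClique C cv (pierced⇒degreeTwo-chordal C cv (k , pierced))) ,
  λ K K-clique → subst (∣ K ∣ ≤_) (NP.+-comm 1 k) (bounded K (IsClique-map (λ x y → to (GEdge⇔Crossing C cv x y)) K K-clique))
  where
  bounded : ∀ K → IsClique (Crossing C) K → ∣ K ∣ ≤ suc k
  bounded = proj₂ (proj₂ (inductivelyPierced⇒invariants k C pierced))
  attained : PiercedWithClique C → ∃[ K ] (IsClique (GEdge C) K × ∣ K ∣ ≡ k + 1)
  attained (r , pierced-r , inj₁ refl) with minimal 0 pierced-r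
  ... | z≤n = ⁅ zero ⁆ , (λ x y x∈ y∈ x≢y → ⊥-elim (x≢y (trans (SP.x∈⁅y⁆⇒x≡y zero x∈) (sym (SP.x∈⁅y⁆⇒x≡y zero y∈))))) ,
              SP.∣⁅x⁆∣≡1 {n = suc m} zero
  attained (r , pierced-r , inj₂ (K , K-clique , ∣K∣≡)) =
    K , IsClique-map (λ x y → from (GEdge⇔Crossing C cv x y)) K K-clique , trans ∣K∣≡ (trans (cong suc r≡k) (NP.+-comm 1 k))
    where
    r≡k : r ≡ k
    r≡k = NP.≤-antisym (NP.≤-pred (subst (_≤ suc k) ∣K∣≡ (bounded K K-clique))) (minimal r pierced-r)

theorem1 : ∀ (n : ℕ) (C : Code n) → StandingConventions C →
    (InductivelyPierced C ⇔ (DegreeTwo C × Chordal (GEdge C)))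
    × (∀ (k : ℕ) → MinPiercing k C → 1 ≤ n → MaxCliqueSize (GEdge C) (k + 1))
theorem1 n C sc =
  mk⇔ (pierced⇒degreeTwo-chordal C cv) (λ h → let (r , pierced , _) = degreeTwo-chordal⇒piercedWithClique C cv h in r , pierced) ,
  minPiercing⇒maxClique C cv
  where
  cv : Conventions C
  cv = conventions C sc
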